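{- Let $\mu=(\mu_1,\dots,\mu_k)$ be a composition of $n$ and let $\pi\in\mathcal{I}_\mu$ be a $\mu$--involution with blocks $B_1,\dots,B_k$. Then \[ \mathcal{A}_\mu^{ -1}(\pi)=\{Q_1Q_2\cdots Q_k : Q_i\in\mathcal{A}^{ -1}(B_i)\text{ for } i\in[k]\}, \] where $Q_1Q_2\cdots Q_k$ denotes the concatenation of the words $Q_1,\dots,Q_k$ (a permutation of $[n]$ in one-line notation).
   Context: Permutations are written in one-line notation; for a finite $A\subset\mathbb{N}$, $S_A$ is the set of words using each element of $A$ exactly once, and $S_n=S_{[n]}$. The standardization $\mathrm{std}(Q)\in S_{|A|}$ of $Q\in S_A$ is the permutation with the same relative order as $Q$. $\ell(w)$ is the Coxeter length (number of inversions) of $w\in S_n$, $s_i=(i,i{+}1)$, and $e$ is the identity. The 0--Hecke product is defined by $w\circ s_i=ws_i$ if $\ell(ws_i)>\ell(w)$ and $w\circ s_i=w$ otherwise (similarly $s_i\circ w$), extending to an associative monoid $(S_n,\circ)$. For an involution $y\in S_m$ ($y=y^{ -1}$), $\mathrm{Cyc}(y)=\{(j,i): y(i)=j,\ i\le j\}$, $\hat\ell(y)=\tfrac12(\ell(y)+m-|\mathrm{Cyc}(y)|)$, the atoms are $\mathcal{A}(y)=\{w\in S_m: w^{ -1}\circ w=y,\ \ell(w)=\hat\ell(y)\}$, and the inverse atoms are $\mathcal{A}^{ -1}(y)=\{w^{ -1}:w\in\mathcal{A}(y)\}$. A word $Q\in S_A$ is a block involution if $\mathrm{std}(Q)$ is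 an involution; its inverse block atoms are $\mathcal{A}^{ -1}(Q)=\{Q'\in S_A: \mathrm{std}(Q')\in\mathcal{A}^{ -1}(\mathrm{std}(Q))\}$. For a composition $\mu=(\mu_1,\dots,\mu_k)$ of $n$ and $\pi\in S_n$, set $m_r=\mu_1+\dots+\mu_{r-1}$; the $r$th block of $\pi$ is the word $B_r=\pi(m_r{+}1)\cdots\pi(m_r{+}\mu_r)$. $\pi$ is a $\mu$--involution if every block is a block involution; $\mathcal{I}_\mu$ is the set of these. For $\pi\in\mathcal{I}_\mu$ and $i\in[n-1]$ define $\pi\circ_\mu s_i$: if the values $i,i{+}1$ lie in different blocks, $\pi\circ_\mu s_i=s_i\circ\pi$ (swap the values $i,i{+}1$ if $i$ occurs to the left of $i{+}1$, otherwise leave $\pi$ unchanged); if they lie in the same block $B$, replace $B$ by the word on the same values whose standardization is $s_r\circ\mathrm{std}(B)\circ s_r$, where $i$ is the $r$th smallest value of $B$, leaving other blocks unchanged. This extends to a right action of the 0--Hecke monoid, so $e\circ_\mu w$ is well defined for $w\in S_n$. A $\mu$--word for $\pi$ is $(a_1,\dots,a_p)$ with $\pi=e\circ_\mu s_{a_1}\circ_\mu\cdots\circ_\mu s_{a_p}$; $\ell_\mu(\pi)$ is the minimal length of one. The $\mu$--atoms are $\mathcal{A}_\mu(\pi)=\{w\in S_n: e\circ_\mu w=\pi,\ \ell(w)=\ell_\mu(\pi)\}$ and $\mathcal{A}_\mu^{ -1}(\pi)=\{w^{ -1}:w\in\mathcal{A}_\mu(\pi)\}$. -}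

module Defs where

open import Data.Nat using (ℕ; zero; suc; _+_; _*_; _∸_; _≤_; _<_; _<ᵇ_; _≡ᵇ_; _≤ᵇ_)
open import Data.Bool using (Bool; true; false; if_then_else_; _∧_; _∨_)
open import Data.List using (List; []; _∷_; map; foldl; length; take; drop; concat)
open import Data.Nat.ListAction using (sum)
open import Data.Bool.ListAction using (any)
open import Data.List.Relation.Unary.All using (All)
open import Data.List.Relation.Binary.Permutation.Propositional using (_↭_)
open import Data.Product using (Σ; ∃; _×_; _,_)
open import Relation.Binary.PropositionalEquality using (_≡_)

-- Permutations / words are lists of naturals in one-line notation.
-- Positions and values are 1-indexed.

iden : ℕ → List ℕ
iden n = go n 1
  where
  go : ℕ → ℕ → List ℕ
  go zero    _ = []
  go (suc k) s = s ∷ go k (suc s)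

InS : ℕ → List ℕ → Set
InS n w = w ↭ iden n

-- w(i), 1-indexed (0 if out of range)
at : List ℕ → ℕ → ℕ
at []       _             = 0
at (x ∷ xs) zero          = 0
at (x ∷ xs) (suc zero)    = x
at (x ∷ xs) (suc (suc k)) = at xs (suc k)

-- 1-indexed position of value v in w (0 if absent)
pos : ℕ → List ℕ → ℕ
pos v []       = 0
pos v (x ∷ xs) = if v ≡ᵇ x then 1 else (if posAbsent then 0 else suc p)
  where
  p = pos v xs
  posAbsent = p ≡ᵇ 0

elem : ℕ → List ℕ → Bool
elem v []       = false
elem v (x ∷ xs) = (v ≡ᵇ x) ∨ elem v xs

countLT : ℕ → List ℕ → ℕ
countLT x []       = 0
countLT x (y ∷ ys) = (if y <ᵇ x then 1 else 0) + countLT x ys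

inverse : List ℕ → List ℕ
inverse w = map (λ j → pos j w) (iden (length w))

len : List ℕ → ℕ
len []       = 0
len (x ∷ xs) = countLT x xs + len xs

std : List ℕ → List ℕ
std Q = map (λ x → suc (countLT x Q)) Q

insert : ℕ → List ℕ → List ℕ
insert x []       = x ∷ []
insert x (y ∷ ys) = if x ≤ᵇ y then x ∷ y ∷ ys else y ∷ insert x ys

isort : List ℕ → List ℕ
isort []       = []
isort (x ∷ xs) = insert x (isort xs)

-- destandardization: the word on the values of B whose standardization is x
destd : List ℕ → List ℕ → List ℕ
destd B x = map (λ j → at (isort B) j) x

-- swap the entries at positions r, r+1 (right multiplication by s_r)
swapAt : List ℕ → ℕ → List ℕ
swapAt []           _             = []
swapAt (x ∷ [])     _             = x ∷ []
swapAt (x ∷ y ∷ xs) zero          = x ∷ y ∷ xs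
swapAt (x ∷ y ∷ xs) (suc zero)    = y ∷ x ∷ xs
swapAt (x ∷ y ∷ xs) (suc (suc k)) = x ∷ swapAt (y ∷ xs) (suc k)

heckeR : List ℕ → ℕ → List ℕ
heckeR w r = if at w r <ᵇ at w (suc r) then swapAt w r else w

swapVal : ℕ → List ℕ → List ℕ
swapVal v = map (λ x → if x ≡ᵇ v then suc v else (if x ≡ᵇ suc v then v else x))

heckeL : List ℕ → ℕ → List ℕ
heckeL w v = if pos v w <ᵇ pos (suc v) w then swapVal v w else w

Reduced : ℕ → List ℕ → List ℕ → Set
Reduced m w as =
  All (λ a → 1 ≤ a × a < m) as × length as ≡ len w × foldl swapAt (iden m) as ≡ w

-- u ∘ w ≡ v  in the 0-Hecke monoid (S_m, ∘):
-- u ∘ w = u ∘ s_{a₁} ∘ ⋯ ∘ s_{a_p} for a reduced word of w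
HeckeProd : ℕ → List ℕ → List ℕ → List ℕ → Set
HeckeProd m u w v = ∃ λ as → Reduced m w as × foldl heckeR u as ≡ v

IsInvolution : ℕ → List ℕ → Set
IsInvolution m y = InS m y × inverse y ≡ y

-- |Cyc(y)| = #{ i ∈ [m] : i ≤ y(i) }
cycCount : List ℕ → ℕ
cycCount y = go (iden (length y))
  where
  go : List ℕ → ℕ
  go []       = 0
  go (i ∷ is) = (if i ≤ᵇ at y i then 1 else 0) + go is

-- w ∈ 𝒜(y) for an involution y ∈ S_m  (ℓ(w) = ℓ̂(y) written as 2ℓ(w) = ℓ(y)+m-|Cyc(y)|)
Atom : ℕ → List ℕ → List ℕ → Set
Atom m y w =
  InS m w × HeckeProd m (inverse w) w y × 2 * len w ≡ len y + m ∸ cycCount y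

InvAtom : ℕ → List ℕ → List ℕ → Set
InvAtom m y v = ∃ λ w → Atom m y w × v ≡ inverse w

BlockInvolution : List ℕ → Set
BlockInvolution Q = IsInvolution (length Q) (std Q)

InvBlockAtom : List ℕ → List ℕ → Set
InvBlockAtom Q Q' = (Q' ↭ Q) × InvAtom (length Q) (std Q) (std Q')

IsComposition : ℕ → List ℕ → Set
IsComposition n μ = All (λ p → 1 ≤ p) μ × sum μ ≡ n

blocks : List ℕ → List ℕ → List (List ℕ)
blocks []      π = []
blocks (m ∷ μ) π = take m π ∷ blocks μ (drop m π)

IsMuInvolution : ℕ → List ℕ → List ℕ → Set
IsMuInvolution n μ π = InS n π × All BlockInvolution (blocks μ π)

blockStep : List ℕ → ℕ → List ℕ
blockStep B i = destd B (heckeL (heckeR (std B) r) r)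
  where
  r = suc (countLT i B)

bothIn : ℕ → List ℕ → Bool
bothIn i B = elem i B ∧ elem (suc i) B

actMu : List ℕ → List ℕ → ℕ → List ℕ
actMu μ π i =
  if any (bothIn i) bs
  then concat (map (λ B → if bothIn i B then blockStep B i else B) bs)
  else heckeL π i
  where
  bs = blocks μ π

actWord : ℕ → List ℕ → List ℕ → List ℕ
actWord n μ as = foldl (actMu μ) (iden n) as

Letters : ℕ → List ℕ → Set
Letters n as = All (λ a → 1 ≤ a × a < n) as

MuAtom : ℕ → List ℕ → List ℕ → List ℕ → Set
MuAtom n μ π w =
  InS n w
  × (∃ λ as → Reduced n w as × actWord n μ as ≡ π)
  × (∀ as → Letters n as → actWord n μ as ≡ π → len w ≤ length as)

InvMuAtom : ℕ → List ℕ → List ℕ → List ℕ → Set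
InvMuAtom n μ π v = ∃ λ w → MuAtom n μ π w × v ≡ inverse w

-- Let Ψ(π) be twice the number of inversions of π between different blocks plus
-- Σ_B 2ℓ̂(std B).  Then Ψ(e) = 0 and a μ-step s_i raises Ψ by at most 2: across blocks it
-- creates one inversion, inside a block it replaces std B by its Demazure conjugate
-- s_j ∘ std B ∘ s_j, whose involution length is at most one larger.  Hence ℓ_μ(π) ≥ Ψ(π)/2.
--
-- Read a μ-word of π letter by letter, keeping v = w⁻¹ for the product w of the letters
-- read so far.  While every letter is an ascent of w and changes the current μ-involution,
-- Ψ grows by exactly 2 per letter and the blocks of v remain inverse block atoms of the
-- blocks of the current μ-involution, since an atom x of y turns into the atom x s_j of
-- s_j ∘ y ∘ s_j.  A reduced word of minimal length has both properties, which gives ⊆.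
-- Conversely, for v = Q₁⋯Q_k with Q_r ∈ 𝒜⁻¹(B_r) one removes a last letter from v (a pair
-- i+1, i inverted in v and lying in different blocks, or the last letter of a reduced word
-- of an atom of one block) and by induction on ℓ(v) obtains such a word of length
-- ℓ(v) = Ψ(π)/2, which is therefore minimal.

module Submission where

open import Defs
open import Function.Base using (_∘_)
open import Data.Nat
open import Data.Nat.Properties
open import Data.Nat.ListAction using (sum)
open import Data.Nat.Solver using (module +-*-Solver)
open +-*-Solver using (solve; _:+_; _:=_)
open import Algebra.Properties.CommutativeSemigroup +-commutativeSemigroup using () renaming (x∙yz≈y∙xz to +-left-comm)
open import Data.Bool using (Bool; true; false; if_then_else_; T; _∨_)
open import Data.Bool.Properties using () renaming (_≟_ to _≟B_)
open import Data.Bool.ListAction using (any)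
open import Data.Unit using (tt)
open import Data.Empty using (⊥-elim)
open import Data.List using (List; []; _∷_; map; foldl; length; take; drop; concat; _++_; [_]; initLast; _∷ʳ′_)
open import Data.List.Properties using (length-map; length-++; foldl-++; take-map; drop-map; concat-map; ++-identityʳ; ++-assoc; take++drop≡id; length-take; length-drop; map-∘; map-cong-local; map-id-local; ∷-injective)
open import Data.List.Membership.Propositional using (_∈_; _∉_)
open import Data.List.Membership.Propositional.Properties using (∈-++⁺ˡ; ∈-++⁺ʳ; ∈-++⁻; ∈-map⁺; ∈-map⁻)
open import Data.List.Membership.DecPropositional _≟_ using (_∈?_)
open import Data.List.Relation.Unary.Any using (here; there)
open import Data.List.Relation.Unary.All using (All; []; _∷_) renaming (lookup to All-lookup; tabulate to All-tabulate)
open import Data.List.Relation.Unary.All.Properties using (∷ʳ⁻) renaming (++⁺ to All++⁺; ++⁻ˡ to All++⁻ˡ; map⁻ to All-map⁻)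
open import Data.List.Relation.Binary.Pointwise using (Pointwise; []; _∷_) renaming (refl to Pointwise-refl)
open import Data.List.Relation.Binary.Permutation.Propositional using (_↭_; ↭-sym; ↭-refl; ↭-trans; ↭-prep; ↭-swap)
import Data.List.Relation.Binary.Permutation.Propositional as ↭
open import Data.List.Relation.Binary.Permutation.Propositional.Properties using (∈-resp-↭; ↭-length; map⁺) renaming (++⁺ to ↭-++⁺)
open import Data.Product using (Σ; ∃; _×_; _,_; proj₁; proj₂; map₂)
open import Data.Sum using (_⊎_; inj₁; inj₂)
import Data.Sum as Sum
open import Relation.Nullary using (¬_; Dec; yes; no; contradiction)
open import Relation.Nullary.Decidable using (_×-dec_)
open import Relation.Binary.Definitions using (tri<; tri≈; tri>)
open import Relation.Binary.PropositionalEquality hiding ([_])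

-- Defs.iden and Defs.cycCount are defined through local loops that cannot be
-- named; each metavariable below is solved to such a loop by the equation after it.
mutual
  idenLoop : ℕ → ℕ → ℕ → List ℕ
  idenLoop = _
  iden-suc-unfold : ∀ n → iden (suc n) ≡ 1 ∷ idenLoop (suc n) n 2
  iden-suc-unfold n with suc n | 2
  ... | _ | _ = refl

mutual
  cycLoop : List ℕ → List ℕ → ℕ
  cycLoop = _
  cycCount-unfold : ∀ y → cycCount y ≡ cycLoop y (iden (length y))
  cycCount-unfold y with iden (length y)
  ... | _ = refl

consecutive : ℕ → ℕ → List ℕ
consecutive zero    _ = []
consecutive (suc k) s = s ∷ consecutive k (suc s)

idenLoop≡consecutive : ∀ p k s → idenLoop p k s ≡ consecutive k s
idenLoop≡consecutive p zero    s = refl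
idenLoop≡consecutive p (suc k) s = cong (s ∷_) (idenLoop≡consecutive p k (suc s))

iden≡consecutive : ∀ n → iden n ≡ consecutive n 1
iden≡consecutive zero    = refl
iden≡consecutive (suc n) = trans (iden-suc-unfold n) (cong (1 ∷_) (idenLoop≡consecutive (suc n) n 2))

indicator : Bool → ℕ
indicator b = if b then 1 else 0

countTrue : (ℕ → Bool) → List ℕ → ℕ
countTrue f []      = 0
countTrue f (x ∷ L) = indicator (f x) + countTrue f L

cycLoop≡countTrue : ∀ y L → cycLoop y L ≡ countTrue (λ k → k ≤ᵇ at y k) L
cycLoop≡countTrue y []      = refl
cycLoop≡countTrue y (i ∷ L) = cong (indicator (i ≤ᵇ at y i) +_) (cycLoop≡countTrue y L)

T⇒≡true : ∀ {b} → T b → b ≡ true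
T⇒≡true {true} _ = refl

¬T⇒≡false : ∀ {b} → ¬ T b → b ≡ false
¬T⇒≡false {false} _  = refl
¬T⇒≡false {true}  ¬t = contradiction tt ¬t

≡true⇒T : ∀ {b} → b ≡ true → T b
≡true⇒T refl = tt

T-cong : ∀ {b c} → (T b → T c) → (T c → T b) → b ≡ c
T-cong {false} {false} _ _ = refl
T-cong {false} {true}  _ g = ⊥-elim (g tt)
T-cong {true}  {false} f _ = ⊥-elim (f tt)
T-cong {true}  {true}  _ _ = refl

≡⇒≡ᵇ≡true : ∀ {m n} → m ≡ n → (m ≡ᵇ n) ≡ true
≡⇒≡ᵇ≡true {m} {n} e = T⇒≡true (≡⇒≡ᵇ m n e)

≢⇒≡ᵇ≡false : ∀ {m n} → m ≢ n → (m ≡ᵇ n) ≡ false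
≢⇒≡ᵇ≡false {m} {n} ne = ¬T⇒≡false (ne ∘ ≡ᵇ⇒≡ m n)

<⇒<ᵇ≡true : ∀ {m n} → m < n → (m <ᵇ n) ≡ true
<⇒<ᵇ≡true lt = T⇒≡true (<⇒<ᵇ lt)

≮⇒<ᵇ≡false : ∀ {m n} → ¬ (m < n) → (m <ᵇ n) ≡ false
≮⇒<ᵇ≡false {m} {n} nlt = ¬T⇒≡false (nlt ∘ <ᵇ⇒< m n)

<ᵇ≡true⇒< : ∀ m n → (m <ᵇ n) ≡ true → m < n
<ᵇ≡true⇒< m n e = <ᵇ⇒< m n (≡true⇒T e)

≤⇒≤ᵇ≡true : ∀ {m n} → m ≤ n → (m ≤ᵇ n) ≡ true
≤⇒≤ᵇ≡true le = T⇒≡true (≤⇒≤ᵇ le)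

≰⇒≤ᵇ≡false : ∀ {m n} → ¬ (m ≤ n) → (m ≤ᵇ n) ≡ false
≰⇒≤ᵇ≡false {m} {n} nle = ¬T⇒≡false (nle ∘ ≤ᵇ⇒≤ m n)

<ᵇ-cong : ∀ {a b c d} → (a < b → c < d) → (c < d → a < b) → (a <ᵇ b) ≡ (c <ᵇ d)
<ᵇ-cong {a} {b} {c} {d} f g = T-cong (<⇒<ᵇ ∘ f ∘ <ᵇ⇒< a b) (<⇒<ᵇ ∘ g ∘ <ᵇ⇒< c d)

≤ᵇ-cong : ∀ {a b c d} → (a ≤ b → c ≤ d) → (c ≤ d → a ≤ b) → (a ≤ᵇ b) ≡ (c ≤ᵇ d)
≤ᵇ-cong {a} {b} {c} {d} f g = T-cong (≤⇒≤ᵇ ∘ f ∘ ≤ᵇ⇒≤ a b) (≤⇒≤ᵇ ∘ g ∘ ≤ᵇ⇒≤ c d)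

τ : ℕ → ℕ → ℕ
τ v x = if x ≡ᵇ v then suc v else (if x ≡ᵇ suc v then v else x)

τ-self : ∀ v → τ v v ≡ suc v
τ-self v rewrite ≡⇒≡ᵇ≡true {v} refl = refl

τ-suc : ∀ v → τ v (suc v) ≡ v
τ-suc v rewrite ≢⇒≡ᵇ≡false {suc v} {v} 1+n≢n | ≡⇒≡ᵇ≡true {suc v} refl = refl

τ-fixes : ∀ v x → x ≢ v → x ≢ suc v → τ v x ≡ x
τ-fixes v x n1 n2 rewrite ≢⇒≡ᵇ≡false n1 | ≢⇒≡ᵇ≡false n2 = refl

data τView (v x : ℕ) : Set where
  is-i     : x ≡ v → τView v x
  is-suc-i : x ≡ suc v → τView v x
  is-other : x ≢ v → x ≢ suc v → τView v x

τ-view : ∀ v x → τView v x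
τ-view v x with x ≟ v | x ≟ suc v
... | yes p | _     = is-i p
... | no p  | yes q = is-suc-i q
... | no p  | no q  = is-other p q

τ-involutive : ∀ v x → τ v (τ v x) ≡ x
τ-involutive v x with τ-view v x
... | is-i refl = trans (cong (τ v) (τ-self v)) (τ-suc v)
... | is-suc-i refl = trans (cong (τ v) (τ-suc v)) (τ-self v)
... | is-other p q = trans (cong (τ v) (τ-fixes v x p q)) (τ-fixes v x p q)

τ-injective : ∀ v {x y} → τ v x ≡ τ v y → x ≡ y
τ-injective v {x} {y} e = trans (sym (τ-involutive v x)) (trans (cong (τ v) e) (τ-involutive v y))

τ-0 : ∀ v → 1 ≤ v → τ v 0 ≡ 0
τ-0 (suc v) _ = refl

NotPair : ℕ → ℕ → ℕ → Set
NotPair v x y = ¬ (x ≡ v × y ≡ suc v) × ¬ (x ≡ suc v × y ≡ v)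

τ-preserves-< : ∀ v x y → NotPair v x y → (x < y → τ v x < τ v y) × (τ v x < τ v y → x < y)
τ-preserves-< v x y (np1 , np2) with τ-view v x | τ-view v y
... | is-i refl | is-i refl = (λ p → ⊥-elim (<-irrefl refl p)) , (λ p → ⊥-elim (<-irrefl refl p))
... | is-i refl | is-suc-i refl = ⊥-elim (np1 (refl , refl))
... | is-i refl | is-other p q rewrite τ-self v | τ-fixes v y p q =
      (λ lt → ≤∧≢⇒< lt (λ e → q (sym e))) , (λ lt → <-trans (n<1+n v) lt)
... | is-suc-i refl | is-i refl = ⊥-elim (np2 (refl , refl))
... | is-suc-i refl | is-suc-i refl = (λ p → ⊥-elim (<-irrefl refl p)) , (λ p → ⊥-elim (<-irrefl refl p))
... | is-suc-i refl | is-other p q rewrite τ-suc v | τ-fixes v y p q =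
      (λ lt → <-trans (n<1+n v) lt) , (λ lt → ≤∧≢⇒< lt (λ e → q (sym e)))
... | is-other p q | is-i refl rewrite τ-self v | τ-fixes v x p q =
      (λ lt → <-trans lt (n<1+n v)) , (λ lt → ≤∧≢⇒< (s≤s⁻¹ lt) p)
... | is-other p q | is-suc-i refl rewrite τ-suc v | τ-fixes v x p q =
      (λ lt → ≤∧≢⇒< (s≤s⁻¹ lt) p) , (λ lt → <-trans lt (n<1+n v))
... | is-other p q | is-other p2 q2 rewrite τ-fixes v x p q | τ-fixes v y p2 q2 = (λ z → z) , (λ z → z)

τ-<ᵇ : ∀ v x y → NotPair v x y → (τ v x <ᵇ τ v y) ≡ (x <ᵇ y)
τ-<ᵇ v x y np = <ᵇ-cong (proj₂ (τ-preserves-< v x y np)) (proj₁ (τ-preserves-< v x y np))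

data Uniq : List ℕ → Set where
  []u : Uniq []
  _∷u_ : ∀ {x xs} → x ∉ xs → Uniq xs → Uniq (x ∷ xs)

elem-true : ∀ {v L} → v ∈ L → elem v L ≡ true
elem-true {v} {x ∷ xs} (here p) rewrite ≡⇒≡ᵇ≡true p = refl
elem-true {v} {x ∷ xs} (there m) rewrite elem-true m with v ≡ᵇ x
... | true = refl
... | false = refl

elem-false : ∀ {v L} → v ∉ L → elem v L ≡ false
elem-false {v} {[]} nm = refl
elem-false {v} {x ∷ xs} nm rewrite ≢⇒≡ᵇ≡false {v} {x} (λ e → nm (here e)) = elem-false (λ m → nm (there m))

elem-true⇒∈ : ∀ {v L} → elem v L ≡ true → v ∈ L
elem-true⇒∈ {v} {L} e with v ∈? L
... | yes p = p
... | no p with trans (sym e) (elem-false p)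
... | ()

at-∈ : ∀ w q → q < length w → at w (suc q) ∈ w
at-∈ (x ∷ xs) zero _ = here refl
at-∈ (x ∷ xs) (suc q) (s≤s lt) = there (at-∈ xs q lt)

PosSpec : ℕ → List ℕ → Set
PosSpec v w = Σ ℕ λ q → pos v w ≡ suc q × q < length w × at w (suc q) ≡ v

pos-cons : ∀ {v x xs q} → v ≢ x → pos v xs ≡ suc q → pos v (x ∷ xs) ≡ suc (suc q)
pos-cons {v} {x} {xs} ne e rewrite ≢⇒≡ᵇ≡false ne | e = refl

pos-spec : ∀ {v w} → v ∈ w → PosSpec v w
pos-spec {v} {x ∷ xs} m with v ≟ x
... | yes e rewrite ≡⇒≡ᵇ≡true e = 0 , refl , s≤s z≤n , sym e
... | no ne with m
... | here e = ⊥-elim (ne e)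
... | there m2 with pos-spec m2
... | q , e1 , lt , e2 = suc q , pos-cons {xs = xs} ne e1 , s≤s lt , e2

pos-at : ∀ {v w} → v ∈ w → at w (pos v w) ≡ v
pos-at m with pos-spec m
... | q , e1 , lt , e2 rewrite e1 = e2

pos-∉ : ∀ {v w} → v ∉ w → pos v w ≡ 0
pos-∉ {v} {[]} nm = refl
pos-∉ {v} {x ∷ xs} nm rewrite ≢⇒≡ᵇ≡false {v} {x} (λ e → nm (here e)) | pos-∉ {v} {xs} (λ m → nm (there m)) = refl

pos-of-at : ∀ {v w} q → Uniq w → q < length w → at w (suc q) ≡ v → pos v w ≡ suc q
pos-of-at {v} {x ∷ xs} zero u lt e rewrite ≡⇒≡ᵇ≡true (sym e) = refl
pos-of-at {v} {x ∷ xs} (suc q) (nx ∷u u) (s≤s lt) e =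
  pos-cons {xs = xs} (λ e2 → nx (subst (_∈ xs) (trans e e2) (at-∈ xs q lt))) (pos-of-at q u lt e)

pos-∈-range : ∀ {v w} → v ∈ w → 1 ≤ pos v w × pos v w ≤ length w
pos-∈-range m with pos-spec m
... | q , e1 , lt , e2 rewrite e1 = s≤s z≤n , lt

at-ext : ∀ (u w : List ℕ) → length u ≡ length w → (∀ q → q < length w → at u (suc q) ≡ at w (suc q)) → u ≡ w
at-ext [] [] _ _ = refl
at-ext (x ∷ u) (y ∷ w) le f =
  cong₂ _∷_ (f 0 (s≤s z≤n)) (at-ext u w (suc-injective le) (λ q lt → f (suc q) (s≤s lt)))

at-map : ∀ (f : ℕ → ℕ) w q → q < length w → at (map f w) (suc q) ≡ f (at w (suc q))
at-map f (x ∷ w) zero lt = refl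
at-map f (x ∷ w) (suc q) (s≤s lt) = at-map f w q lt

map-cong-∈ : ∀ (f g : ℕ → ℕ) w → (∀ v → v ∈ w → f v ≡ g v) → map f w ≡ map g w
map-cong-∈ f g w h = map-cong-local (All-tabulate (h _))

map-id-∈ : ∀ (f : ℕ → ℕ) w → (∀ v → v ∈ w → f v ≡ v) → map f w ≡ w
map-id-∈ f w h = map-id-local (All-tabulate (h _))

uniq-map : ∀ (f : ℕ → ℕ) {w} → (∀ a b → a ∈ w → b ∈ w → f a ≡ f b → a ≡ b) → Uniq w → Uniq (map f w)
uniq-map f {[]} inj []u = []u
uniq-map f {x ∷ w} inj (nx ∷u u) =
  (λ m → let (v , m2 , e) = ∈-map⁻ f m in nx (subst (_∈ w) (sym (inj x v (here refl) (there m2) e)) m2))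
  ∷u uniq-map f (λ a b ma mb e → inj a b (there ma) (there mb) e) u

uniq-↭ : ∀ {xs ys} → xs ↭ ys → Uniq xs → Uniq ys
uniq-↭ ↭.refl u = u
uniq-↭ (↭.prep x p) (nx ∷u u) = (λ m → nx (∈-resp-↭ (↭-sym p) m)) ∷u uniq-↭ p u
uniq-↭ {x ∷ y ∷ xs} {.y ∷ .x ∷ ys} (↭.swap .x .y p) (nx ∷u (ny ∷u u)) =
  (λ { (here e) → nx (here (sym e)) ; (there m) → ny (∈-resp-↭ (↭-sym p) m) })
  ∷u ((λ m → nx (there (∈-resp-↭ (↭-sym p) m))) ∷u uniq-↭ p u)
uniq-↭ (↭.trans p q) u = uniq-↭ q (uniq-↭ p u)

length-consecutive : ∀ k s → length (consecutive k s) ≡ k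
length-consecutive zero s = refl
length-consecutive (suc k) s = cong suc (length-consecutive k (suc s))

at-consecutive : ∀ k s q → q < k → at (consecutive k s) (suc q) ≡ s + q
at-consecutive (suc k) s zero lt = sym (+-identityʳ s)
at-consecutive (suc k) s (suc q) (s≤s lt) = trans (at-consecutive k (suc s) q lt) (sym (+-suc s q))

∈-consecutive⁻ : ∀ {k s v} → v ∈ consecutive k s → s ≤ v × v < s + k
∈-consecutive⁻ {suc k} {s} (here refl) = ≤-refl , m<m+n s (s≤s z≤n)
∈-consecutive⁻ {suc k} {s} (there m) with ∈-consecutive⁻ {k} {suc s} m
... | a , b = <⇒≤ a , ≤-trans b (≤-reflexive (sym (+-suc s k)))

∈-consecutive⁺ : ∀ {k s v} → s ≤ v → v < s + k → v ∈ consecutive k s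
∈-consecutive⁺ {zero} {s} {v} le lt = ⊥-elim (<-irrefl refl (≤-trans lt (≤-trans (≤-reflexive (+-identityʳ s)) le)))
∈-consecutive⁺ {suc k} {s} {v} le lt with s ≟ v
... | yes e = here (sym e)
... | no ne = there (∈-consecutive⁺ {k} {suc s} (≤∧≢⇒< le ne) (≤-trans lt (≤-reflexive (+-suc s k))))

consecutive-uniq : ∀ k s → Uniq (consecutive k s)
consecutive-uniq zero s = []u
consecutive-uniq (suc k) s = (λ m → <-irrefl refl (proj₁ (∈-consecutive⁻ {k} {suc s} m))) ∷u consecutive-uniq k (suc s)

length-iden : ∀ n → length (iden n) ≡ n
length-iden n rewrite iden≡consecutive n = length-consecutive n 1

InS-length : ∀ {n w} → InS n w → length w ≡ n
InS-length {n} p = trans (↭-length p) (length-iden n)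

iden-uniq : ∀ n → Uniq (iden n)
iden-uniq n rewrite iden≡consecutive n = consecutive-uniq n 1

InS-uniq : ∀ {n w} → InS n w → Uniq w
InS-uniq {n} p = uniq-↭ (↭-sym p) (iden-uniq n)

InS-∈⁻ : ∀ {n w v} → InS n w → v ∈ w → 1 ≤ v × v ≤ n
InS-∈⁻ {n} {w} {v} p m with ∈-consecutive⁻ {n} {1} (subst (v ∈_) (iden≡consecutive n) (∈-resp-↭ p m))
... | a , b = a , s≤s⁻¹ b

InS-∈⁺ : ∀ {n w v} → InS n w → 1 ≤ v → v ≤ n → v ∈ w
InS-∈⁺ {n} {w} {v} p a b = ∈-resp-↭ (↭-sym p) (subst (v ∈_) (sym (iden≡consecutive n)) (∈-consecutive⁺ a (s≤s b)))

length-swapAt : ∀ w r → length (swapAt w r) ≡ length w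
length-swapAt [] r = refl
length-swapAt (x ∷ []) r = refl
length-swapAt (x ∷ y ∷ xs) zero = refl
length-swapAt (x ∷ y ∷ xs) (suc zero) = refl
length-swapAt (x ∷ y ∷ xs) (suc (suc k)) = cong suc (length-swapAt (y ∷ xs) (suc k))

swapAt-↭ : ∀ w r → swapAt w r ↭ w
swapAt-↭ [] r = ↭-refl
swapAt-↭ (x ∷ []) r = ↭-refl
swapAt-↭ (x ∷ y ∷ xs) zero = ↭-refl
swapAt-↭ (x ∷ y ∷ xs) (suc zero) = ↭-swap y x ↭-refl
swapAt-↭ (x ∷ y ∷ xs) (suc (suc k)) = ↭-prep x (swapAt-↭ (y ∷ xs) (suc k))

map-swapAt : ∀ (f : ℕ → ℕ) w r → swapAt (map f w) r ≡ map f (swapAt w r)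
map-swapAt f [] r = refl
map-swapAt f (x ∷ []) r = refl
map-swapAt f (x ∷ y ∷ xs) zero = refl
map-swapAt f (x ∷ y ∷ xs) (suc zero) = refl
map-swapAt f (x ∷ y ∷ xs) (suc (suc k)) = cong (f x ∷_) (map-swapAt f (y ∷ xs) (suc k))

τ-shift : ∀ v x → τ (suc v) (suc x) ≡ suc (τ v x)
τ-shift v x with τ-view v x
... | is-i refl = trans (τ-self (suc v)) (cong suc (sym (τ-self v)))
... | is-suc-i refl = trans (τ-suc (suc v)) (cong suc (sym (τ-suc v)))
... | is-other p q = trans (τ-fixes (suc v) (suc x) (λ e → p (suc-injective e)) (λ e → q (suc-injective e))) (cong suc (sym (τ-fixes v x p q)))

τ-1 : ∀ v → 2 ≤ v → τ v 1 ≡ 1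
τ-1 v le = τ-fixes v 1 (<⇒≢ le) (<⇒≢ (m<n⇒m<1+n le))

at-swapAt : ∀ w r q → 1 ≤ r → suc r ≤ length w → q < length w → at (swapAt w r) (suc q) ≡ at w (τ r (suc q))
at-swapAt [] r q _ _ ()
at-swapAt (x ∷ []) (suc r) q _ (s≤s ()) _
at-swapAt (x ∷ y ∷ xs) (suc zero) zero _ _ _ = refl
at-swapAt (x ∷ y ∷ xs) (suc zero) (suc zero) _ _ _ = refl
at-swapAt (x ∷ y ∷ xs) (suc zero) (suc (suc q)) _ _ _ = refl
at-swapAt (x ∷ y ∷ xs) (suc (suc r)) zero _ _ _ rewrite τ-1 (suc (suc r)) (s≤s (s≤s z≤n)) = refl
at-swapAt (x ∷ y ∷ xs) (suc (suc r)) (suc q) _ (s≤s le) (s≤s lt) =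
  trans (at-swapAt (y ∷ xs) (suc r) q (s≤s z≤n) le lt)
     (trans (cong (at (y ∷ xs)) (τ-shift r q))
         (cong (at (x ∷ y ∷ xs)) (sym (trans (τ-shift (suc r) (suc q)) (cong suc (τ-shift r q))))))

τ-range : ∀ r p L → 1 ≤ r → suc r ≤ L → 1 ≤ p → p ≤ L → 1 ≤ τ r p × τ r p ≤ L
τ-range r p L a b c d with τ-view r p
... | is-i refl rewrite τ-self r = s≤s z≤n , b
... | is-suc-i refl rewrite τ-suc r = a , <⇒≤ b
... | is-other e1 e2 rewrite τ-fixes r p e1 e2 = c , d

pred-of : ∀ p → 1 ≤ p → Σ ℕ λ q → p ≡ suc q
pred-of (suc p) _ = p , refl

pos-swapAt : ∀ {v w} r → Uniq w → 1 ≤ r → suc r ≤ length w → pos v (swapAt w r) ≡ τ r (pos v w)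
pos-swapAt {v} {w} r u a b with v ∈? w
... | no nm rewrite pos-∉ nm | pos-∉ {v} {swapAt w r} (λ m → nm (∈-resp-↭ (swapAt-↭ w r) m)) = sym (τ-0 r a)
... | yes m with pos-spec m
... | q , e1 , lt , e2 rewrite e1 with τ-range r (suc q) (length w) a b (s≤s z≤n) lt
... | c , d with pred-of (τ r (suc q)) c
... | q2 , e3 = trans (pos-of-at q2 (uniq-↭ (↭-sym (swapAt-↭ w r)) u) lt2 atq) (sym e3)
  where
  lt2 : q2 < length (swapAt w r)
  lt2 = subst (q2 <_) (sym (length-swapAt w r)) (subst (_≤ length w) e3 d)
  atq : at (swapAt w r) (suc q2) ≡ v
  atq = trans (at-swapAt w r q2 a b (subst (q2 <_) (length-swapAt w r) lt2))
           (trans (cong (λ z → at w (τ r z)) (sym e3)) (trans (cong (at w) (τ-involutive r (suc q))) e2))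

τ-≡ᵇ : ∀ a v x → (v ≡ᵇ τ a x) ≡ (τ a v ≡ᵇ x)
τ-≡ᵇ a v x with v ≟ τ a x
... | yes e = trans (≡⇒≡ᵇ≡true {v} {τ a x} e) (sym (≡⇒≡ᵇ≡true {τ a v} {x} (trans (cong (τ a) e) (τ-involutive a x))))
... | no ne = trans (≢⇒≡ᵇ≡false {v} {τ a x} ne) (sym (≢⇒≡ᵇ≡false {τ a v} {x} (λ e → ne (trans (sym (τ-involutive a v)) (cong (τ a) e)))))

pos-map-τ : ∀ a v w → pos v (map (τ a) w) ≡ pos (τ a v) w
pos-map-τ a v [] = refl
pos-map-τ a v (x ∷ w) rewrite τ-≡ᵇ a v x | pos-map-τ a v w = refl

at-iden : ∀ m q → q < m → at (iden m) (suc q) ≡ suc q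
at-iden m q lt rewrite iden≡consecutive m = at-consecutive m 1 q lt

length-inverse : ∀ w → length (inverse w) ≡ length w
length-inverse w = trans (length-map (λ j → pos j w) (iden (length w))) (length-iden (length w))

at-inverse : ∀ w q → q < length w → at (inverse w) (suc q) ≡ pos (suc q) w
at-inverse w q lt = trans (at-map (λ j → pos j w) (iden (length w)) q (subst (q <_) (sym (length-iden (length w))) lt))
                       (cong (λ z → pos z w) (at-iden (length w) q lt))

∈-iden⁻ : ∀ {m v} → v ∈ iden m → 1 ≤ v × v ≤ m
∈-iden⁻ {m} {v} mm = InS-∈⁻ {m} {iden m} ↭-refl mm

inverse-uniq : ∀ {m w} → InS m w → Uniq (inverse w)
inverse-uniq {m} {w} p = uniq-map (λ j → pos j w) inj (iden-uniq (length w))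
  where
  inj : ∀ a b → a ∈ iden (length w) → b ∈ iden (length w) → pos a w ≡ pos b w → a ≡ b
  inj a b ma mb e =
    let ra = ∈-iden⁻ {length w} ma ; rb = ∈-iden⁻ {length w} mb
        ma2 = InS-∈⁺ p (proj₁ ra) (subst (a ≤_) (InS-length p) (proj₂ ra))
        mb2 = InS-∈⁺ p (proj₁ rb) (subst (b ≤_) (InS-length p) (proj₂ rb))
    in trans (sym (pos-at ma2)) (trans (cong (at w) e) (pos-at mb2))

pos-inverse : ∀ {m w} q → InS m w → q < m → pos (suc q) (inverse w) ≡ at w (suc q)
pos-inverse {m} {w} q p lt with InS-∈⁻ p (at-∈ w q (subst (q <_) (sym (InS-length p)) lt))
... | c , d with pred-of (at w (suc q)) c
... | a' , e = trans (pos-of-at a' (inverse-uniq p) lt1 h) (sym e)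
  where
  lt1 : a' < length (inverse w)
  lt1 = subst (a' <_) (sym (trans (length-inverse w) (InS-length p))) (subst (_≤ m) e d)
  h : at (inverse w) (suc a') ≡ suc q
  h = trans (at-inverse w a' (subst (a' <_) (length-inverse w) lt1))
         (trans (cong (λ z → pos z w) (sym e)) (pos-of-at q (InS-uniq p) (subst (q <_) (sym (InS-length p)) lt) refl))

pos-inverse′ : ∀ {m w p} → InS m w → 1 ≤ p → p ≤ m → pos p (inverse w) ≡ at w p
pos-inverse′ {p = suc q} P _ d = pos-inverse q P d

inverse-swapAt : ∀ {m w} r → InS m w → 1 ≤ r → suc r ≤ m → inverse (swapAt w r) ≡ swapVal r (inverse w)
inverse-swapAt {m} {w} r p a b =
  trans (cong (λ L → map (λ j → pos j (swapAt w r)) (iden L)) (length-swapAt w r))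
     (trans (map-cong-∈ _ _ (iden (length w)) (λ j _ → pos-swapAt {j} {w} r (InS-uniq p) a (subst (suc r ≤_) (sym (InS-length p)) b)))
         (map-∘ {g = τ r} {f = λ j → pos j w} (iden (length w))))

map-τ-iden : ∀ m a → 1 ≤ a → suc a ≤ m → map (τ a) (iden m) ≡ swapAt (iden m) a
map-τ-iden m a c d = at-ext _ _ (trans (length-map (τ a) (iden m)) (sym (length-swapAt (iden m) a))) h
  where
  h : ∀ q → q < length (swapAt (iden m) a) → at (map (τ a) (iden m)) (suc q) ≡ at (swapAt (iden m) a) (suc q)
  h q lt with subst (q <_) (trans (length-swapAt (iden m) a) (length-iden m)) lt
  ... | lt2 with τ-range a (suc q) m c d (s≤s z≤n) lt2
  ... | r1 , r2 with pred-of (τ a (suc q)) r1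
  ... | q3 , e3 =
    trans (at-map (τ a) (iden m) q (subst (q <_) (sym (length-iden m)) lt2))
       (trans (cong (τ a) (at-iden m q lt2))
           (trans e3 (trans (sym (at-iden m q3 (subst (_≤ m) e3 r2)))
             (trans (cong (at (iden m)) (sym e3))
               (sym (at-swapAt (iden m) a q c (subst (suc a ≤_) (sym (length-iden m)) d) (subst (q <_) (sym (length-iden m)) lt2)))))))

map-τ-InS : ∀ {m w} a → InS m w → 1 ≤ a → suc a ≤ m → InS m (map (τ a) w)
map-τ-InS {m} {w} a p c d = ↭-trans (map⁺ (τ a) p) (subst (_↭ iden m) (sym (map-τ-iden m a c d)) (swapAt-↭ (iden m) a))

swapAt-InS : ∀ {m w} r → InS m w → InS m (swapAt w r)
swapAt-InS {m} {w} r p = ↭-trans (swapAt-↭ w r) p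

-- Right and left 0-Hecke products

heckeR-InS : ∀ {m w} r → InS m w → InS m (heckeR w r)
heckeR-InS {m} {w} r p with at w r <ᵇ at w (suc r)
... | true = swapAt-InS r p
... | false = p

rightAscent : List ℕ → ℕ → Bool
rightAscent w b = at w b <ᵇ at w (suc b)

leftAscent : List ℕ → ℕ → Bool
leftAscent w a = pos a w <ᵇ pos (suc a) w

heckeR-ascent : ∀ w b → rightAscent w b ≡ true → heckeR w b ≡ swapAt w b
heckeR-ascent w b e rewrite e = refl
heckeR-no-ascent : ∀ w b → rightAscent w b ≡ false → heckeR w b ≡ w
heckeR-no-ascent w b e rewrite e = refl
heckeL-ascent : ∀ w a → leftAscent w a ≡ true → heckeL w a ≡ map (τ a) w
heckeL-ascent w a e rewrite e = refl
heckeL-no-ascent : ∀ w a → leftAscent w a ≡ false → heckeL w a ≡ w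
heckeL-no-ascent w a e rewrite e = refl

heckeR-heckeL-comm-generic : ∀ w a b → rightAscent (map (τ a) w) b ≡ rightAscent w b → leftAscent (swapAt w b) a ≡ leftAscent w a →
                             heckeR (heckeL w a) b ≡ heckeL (heckeR w b) a
heckeR-heckeL-comm-generic w a b sameRight sameLeft = by-cases (leftAscent w a) refl (rightAscent w b) refl
  where
  by-cases : ∀ x → leftAscent w a ≡ x → ∀ y → rightAscent w b ≡ y → heckeR (heckeL w a) b ≡ heckeL (heckeR w b) a
  by-cases true l true r = begin
    heckeR (heckeL w a) b      ≡⟨ cong (λ z → heckeR z b) (heckeL-ascent w a l) ⟩
    heckeR (map (τ a) w) b     ≡⟨ heckeR-ascent (map (τ a) w) b (trans sameRight r) ⟩
    swapAt (map (τ a) w) b     ≡⟨ map-swapAt (τ a) w b ⟩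
    map (τ a) (swapAt w b)     ≡⟨ heckeL-ascent (swapAt w b) a (trans sameLeft l) ⟨
    heckeL (swapAt w b) a      ≡⟨ cong (λ z → heckeL z a) (heckeR-ascent w b r) ⟨
    heckeL (heckeR w b) a      ∎
    where open ≡-Reasoning
  by-cases true l false r = begin
    heckeR (heckeL w a) b      ≡⟨ cong (λ z → heckeR z b) (heckeL-ascent w a l) ⟩
    heckeR (map (τ a) w) b     ≡⟨ heckeR-no-ascent (map (τ a) w) b (trans sameRight r) ⟩
    map (τ a) w                ≡⟨ heckeL-ascent w a l ⟨
    heckeL w a                 ≡⟨ cong (λ z → heckeL z a) (heckeR-no-ascent w b r) ⟨
    heckeL (heckeR w b) a      ∎
    where open ≡-Reasoning
  by-cases false l true r = begin
    heckeR (heckeL w a) b      ≡⟨ cong (λ z → heckeR z b) (heckeL-no-ascent w a l) ⟩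
    heckeR w b                 ≡⟨ heckeR-ascent w b r ⟩
    swapAt w b                 ≡⟨ heckeL-no-ascent (swapAt w b) a (trans sameLeft l) ⟨
    heckeL (swapAt w b) a      ≡⟨ cong (λ z → heckeL z a) (heckeR-ascent w b r) ⟨
    heckeL (heckeR w b) a      ∎
    where open ≡-Reasoning
  by-cases false l false r = begin
    heckeR (heckeL w a) b      ≡⟨ cong (λ z → heckeR z b) (heckeL-no-ascent w a l) ⟩
    heckeR w b                 ≡⟨ heckeR-no-ascent w b r ⟩
    w                          ≡⟨ heckeL-no-ascent w a l ⟨
    heckeL w a                 ≡⟨ cong (λ z → heckeL z a) (heckeR-no-ascent w b r) ⟨
    heckeL (heckeR w b) a      ∎
    where open ≡-Reasoning

rightAscent-map-τ : ∀ w a b → 1 ≤ b → suc b ≤ length w → NotPair a (at w b) (at w (suc b)) → rightAscent (map (τ a) w) b ≡ rightAscent w b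
rightAscent-map-τ w a (suc b) _ le np =
  trans (cong₂ _<ᵇ_ (at-map (τ a) w b (<-trans (n<1+n b) le)) (at-map (τ a) w (suc b) le))
     (τ-<ᵇ a (at w (suc b)) (at w (suc (suc b))) np)

leftAscent-swapAt : ∀ w a b → Uniq w → 1 ≤ b → suc b ≤ length w → NotPair b (pos a w) (pos (suc a) w) → leftAscent (swapAt w b) a ≡ leftAscent w a
leftAscent-swapAt w a b u c d np =
  trans (cong₂ _<ᵇ_ (pos-swapAt {a} {w} b u c d) (pos-swapAt {suc a} {w} b u c d))
     (τ-<ᵇ b (pos a w) (pos (suc a) w) np)

-- Associativity (s_a ∘ w) ∘ s_r = s_a ∘ (w ∘ s_r) of the 0-Hecke monoid, for r = suc b.
module _ {m w a b} (p : InS m w) (a1 : 1 ≤ a) (a2 : suc a ≤ m) (b2 : suc (suc b) ≤ m) where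
  private
    u = InS-uniq p
    b2′ : suc (suc b) ≤ length w
    b2′ = subst (suc (suc b) ≤_) (sym (InS-length p)) b2
    b<len : suc b ≤ length w
    b<len = <⇒≤ b2′
    posAt : ∀ {v} → at w (suc b) ≡ v → pos v w ≡ suc b
    posAt e = pos-of-at b u b<len e
    posAt-suc : ∀ {v} → at w (suc (suc b)) ≡ v → pos v w ≡ suc (suc b)
    posAt-suc e = pos-of-at (suc b) u b2′ e
    no-<-back : ∀ k → (suc k <ᵇ k) ≡ false
    no-<-back k = ≮⇒<ᵇ≡false (λ lt → <-asym lt (n<1+n k))

  swapAt≡map-τ : at w (suc b) ≡ a → at w (suc (suc b)) ≡ suc a → swapAt w (suc b) ≡ map (τ a) w
  swapAt≡map-τ e1 e2 = at-ext _ _ (trans (length-swapAt w (suc b)) (sym (length-map (τ a) w))) same-at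
    where
    same-at : ∀ q → q < length (map (τ a) w) → at (swapAt w (suc b)) (suc q) ≡ at (map (τ a) w) (suc q)
    same-at q lt0 with subst (q <_) (length-map (τ a) w) lt0
    ... | lt = trans (at-swapAt w (suc b) q (s≤s z≤n) b2′ lt) (trans (by-position (τ-view (suc b) (suc q))) (sym (at-map (τ a) w q lt)))
      where
      by-position : τView (suc b) (suc q) → at w (τ (suc b) (suc q)) ≡ τ a (at w (suc q))
      by-position (is-i e) =
        trans (cong (at w) (trans (cong (τ (suc b)) e) (τ-self (suc b)))) (trans e2 (trans (sym (τ-self a)) (cong (τ a) (sym (trans (cong (at w) e) e1)))))
      by-position (is-suc-i e) =
        trans (cong (at w) (trans (cong (τ (suc b)) e) (τ-suc (suc b)))) (trans e1 (trans (sym (τ-suc a)) (cong (τ a) (sym (trans (cong (at w) e) e2)))))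
      by-position (is-other n1 n2) rewrite τ-fixes (suc b) (suc q) n1 n2 =
        sym (τ-fixes a (at w (suc q)) (λ e → n1 (trans (sym (pos-of-at q u lt e)) (posAt e1)))
                                      (λ e → n2 (trans (sym (pos-of-at q u lt e)) (posAt-suc e2))))

  heckeR-heckeL-comm-ascending : at w (suc b) ≡ a → at w (suc (suc b)) ≡ suc a →
                                 heckeR (heckeL w a) (suc b) ≡ heckeL (heckeR w (suc b)) a
  heckeR-heckeL-comm-ascending e1 e2 = begin
    heckeR (heckeL w a) (suc b)      ≡⟨ cong (λ z → heckeR z (suc b)) (heckeL-ascent w a leftAsc) ⟩
    heckeR (map (τ a) w) (suc b)     ≡⟨ heckeR-no-ascent (map (τ a) w) (suc b) noRightAsc ⟩
    map (τ a) w                      ≡⟨ swapAt≡map-τ e1 e2 ⟨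
    swapAt w (suc b)                 ≡⟨ heckeL-no-ascent (swapAt w (suc b)) a noLeftAsc ⟨
    heckeL (swapAt w (suc b)) a      ≡⟨ cong (λ z → heckeL z a) (heckeR-ascent w (suc b) rightAsc) ⟨
    heckeL (heckeR w (suc b)) a      ∎
    where
    open ≡-Reasoning
    leftAsc : leftAscent w a ≡ true
    leftAsc = trans (cong₂ _<ᵇ_ (posAt e1) (posAt-suc e2)) (<⇒<ᵇ≡true (n<1+n (suc b)))
    rightAsc : rightAscent w (suc b) ≡ true
    rightAsc = trans (cong₂ _<ᵇ_ e1 e2) (<⇒<ᵇ≡true (n<1+n a))
    noRightAsc : rightAscent (map (τ a) w) (suc b) ≡ false
    noRightAsc = trans (cong₂ _<ᵇ_ (trans (at-map (τ a) w b b<len) (trans (cong (τ a) e1) (τ-self a)))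
                                   (trans (at-map (τ a) w (suc b) b2′) (trans (cong (τ a) e2) (τ-suc a))))
                       (no-<-back a)
    noLeftAsc : leftAscent (swapAt w (suc b)) a ≡ false
    noLeftAsc = trans (cong₂ _<ᵇ_ (trans (pos-swapAt {a} {w} (suc b) u (s≤s z≤n) b2′) (cong (τ (suc b)) (posAt e1)))
                                  (trans (pos-swapAt {suc a} {w} (suc b) u (s≤s z≤n) b2′) (cong (τ (suc b)) (posAt-suc e2))))
                      (trans (cong₂ _<ᵇ_ (τ-self (suc b)) (τ-suc (suc b))) (no-<-back (suc b)))

  heckeR-heckeL-comm-descending : at w (suc b) ≡ suc a → at w (suc (suc b)) ≡ a →
                                  heckeR (heckeL w a) (suc b) ≡ heckeL (heckeR w (suc b)) a
  heckeR-heckeL-comm-descending f1 f2 = begin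
    heckeR (heckeL w a) (suc b)      ≡⟨ cong (λ z → heckeR z (suc b)) (heckeL-no-ascent w a noLeftAsc) ⟩
    heckeR w (suc b)                 ≡⟨ heckeR-no-ascent w (suc b) noRightAsc ⟩
    w                                ≡⟨ heckeL-no-ascent w a noLeftAsc ⟨
    heckeL w a                       ≡⟨ cong (λ z → heckeL z a) (heckeR-no-ascent w (suc b) noRightAsc) ⟨
    heckeL (heckeR w (suc b)) a      ∎
    where
    open ≡-Reasoning
    noLeftAsc : leftAscent w a ≡ false
    noLeftAsc = trans (cong₂ _<ᵇ_ (posAt-suc f2) (posAt f1)) (no-<-back (suc b))
    noRightAsc : rightAscent w (suc b) ≡ false
    noRightAsc = trans (cong₂ _<ᵇ_ f1 f2) (no-<-back a)

  heckeR-heckeL-comm-apart : NotPair a (at w (suc b)) (at w (suc (suc b))) →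
                             heckeR (heckeL w a) (suc b) ≡ heckeL (heckeR w (suc b)) a
  heckeR-heckeL-comm-apart np@(notAsc , notDesc) =
    heckeR-heckeL-comm-generic w a (suc b) (rightAscent-map-τ w a (suc b) (s≤s z≤n) b2′ np)
                                           (leftAscent-swapAt w a (suc b) u (s≤s z≤n) b2′ positions-apart)
    where
    at-of-pos : ∀ {v q} → 1 ≤ v → v ≤ m → pos v w ≡ q → at w q ≡ v
    at-of-pos c d e = trans (cong (at w) (sym e)) (pos-at (InS-∈⁺ p c d))
    positions-apart : NotPair (suc b) (pos a w) (pos (suc a) w)
    positions-apart = (λ (x , y) → notAsc (at-of-pos a1 (<⇒≤ a2) x , at-of-pos (s≤s z≤n) a2 y))
                    , (λ (x , y) → notDesc (at-of-pos (s≤s z≤n) a2 y , at-of-pos a1 (<⇒≤ a2) x))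

heckeR-heckeL-comm : ∀ {m w} a b → InS m w → 1 ≤ a → suc a ≤ m → 1 ≤ b → suc b ≤ m → heckeR (heckeL w a) b ≡ heckeL (heckeR w b) a
heckeR-heckeL-comm {m} {w} a (suc b) p a1 a2 _ b2
  with (at w (suc b) ≟ a ×-dec at w (suc (suc b)) ≟ suc a) | (at w (suc b) ≟ suc a ×-dec at w (suc (suc b)) ≟ a)
... | yes (e1 , e2) | _             = heckeR-heckeL-comm-ascending p a1 a2 b2 e1 e2
... | no _          | yes (f1 , f2) = heckeR-heckeL-comm-descending p a1 a2 b2 f1 f2
... | no notAsc     | no notDesc    = heckeR-heckeL-comm-apart p a1 a2 b2 (notAsc , notDesc)

foldl-heckeR-heckeL-comm : ∀ {m} c u a → InS m u → 1 ≤ a → suc a ≤ m → Letters m c → foldl heckeR (heckeL u a) c ≡ heckeL (foldl heckeR u c) a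
foldl-heckeR-heckeL-comm [] u a p a1 a2 [] = refl
foldl-heckeR-heckeL-comm (b ∷ c) u a p a1 a2 ((b1 , b2) ∷ ls) =
  trans (cong (λ z → foldl heckeR z c) (heckeR-heckeL-comm a b p a1 a2 b1 b2)) (foldl-heckeR-heckeL-comm c (heckeR u b) a (heckeR-InS b p) a1 a2 ls)

-- Inversions

countLT-↭ : ∀ x {xs ys} → xs ↭ ys → countLT x xs ≡ countLT x ys
countLT-↭ x ↭.refl = refl
countLT-↭ x (↭.prep y p) = cong (indicator (y <ᵇ x) +_) (countLT-↭ x p)
countLT-↭ x (↭.swap y z p) =
  trans (+-left-comm (indicator (y <ᵇ x)) (indicator (z <ᵇ x)) _) (cong (λ t → indicator (z <ᵇ x) + (indicator (y <ᵇ x) + t)) (countLT-↭ x p))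
countLT-↭ x (↭.trans p q) = trans (countLT-↭ x p) (countLT-↭ x q)

countLT-++ : ∀ x xs ys → countLT x (xs ++ ys) ≡ countLT x xs + countLT x ys
countLT-++ x [] ys = refl
countLT-++ x (y ∷ xs) ys = trans (cong (indicator (y <ᵇ x) +_) (countLT-++ x xs ys)) (sym (+-assoc (indicator (y <ᵇ x)) _ _))

countLT-≤ : ∀ x xs → countLT x xs ≤ length xs
countLT-≤ x [] = z≤n
countLT-≤ x (y ∷ xs) with y <ᵇ x
... | true = s≤s (countLT-≤ x xs)
... | false = m≤n⇒m≤1+n (countLT-≤ x xs)

countLT-∈ : ∀ x xs → x ∈ xs → suc (countLT x xs) ≤ length xs
countLT-∈ x (y ∷ xs) (here e) rewrite e | ≮⇒<ᵇ≡false {y} {y} (<-irrefl refl) = s≤s (countLT-≤ y xs)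
countLT-∈ x (y ∷ xs) (there m) with y <ᵇ x
... | true = s≤s (countLT-∈ x xs m)
... | false = m≤n⇒m≤1+n (countLT-∈ x xs m)

len-swapAt-ascent : ∀ w r → 1 ≤ r → suc r ≤ length w → at w r < at w (suc r) → len (swapAt w r) ≡ suc (len w)
len-swapAt-ascent (x ∷ y ∷ xs) (suc zero) _ _ lt
  rewrite <⇒<ᵇ≡true lt | ≮⇒<ᵇ≡false {y} {x} (λ l2 → <-asym l2 lt) = cong suc (+-left-comm (countLT y xs) (countLT x xs) (len xs))
len-swapAt-ascent (x ∷ y ∷ xs) (suc (suc r)) _ (s≤s le) lt =
  trans (cong₂ _+_ (countLT-↭ x (swapAt-↭ (y ∷ xs) (suc r))) (len-swapAt-ascent (y ∷ xs) (suc r) (s≤s z≤n) le lt))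
     (+-suc (countLT x (y ∷ xs)) (len (y ∷ xs)))
len-swapAt-ascent (x ∷ []) (suc r) _ (s≤s ()) lt

len-swapAt-no-ascent : ∀ w r → ¬ (at w r < at w (suc r)) → len (swapAt w r) ≤ len w
len-swapAt-no-ascent [] r nlt = ≤-refl
len-swapAt-no-ascent (x ∷ []) r nlt = ≤-refl
len-swapAt-no-ascent (x ∷ y ∷ xs) zero nlt = ≤-refl
len-swapAt-no-ascent (x ∷ y ∷ xs) (suc zero) nlt rewrite ≮⇒<ᵇ≡false {x} {y} nlt =
  ≤-trans (≤-reflexive (+-left-comm (countLT y xs) (countLT x xs) (len xs)))
          (≤-trans (m≤n+m _ (indicator (y <ᵇ x))) (≤-reflexive (sym (+-assoc (indicator (y <ᵇ x)) _ _))))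
len-swapAt-no-ascent (x ∷ y ∷ xs) (suc (suc r)) nlt =
  ≤-trans (≤-reflexive (cong (_+ len (swapAt (y ∷ xs) (suc r))) (countLT-↭ x (swapAt-↭ (y ∷ xs) (suc r)))))
          (+-monoʳ-≤ (countLT x (y ∷ xs)) (len-swapAt-no-ascent (y ∷ xs) (suc r) nlt))

at-nonzero : ∀ w p → 0 < at w p → 1 ≤ p × p ≤ length w
at-nonzero (x ∷ w) (suc zero) lt = s≤s z≤n , s≤s z≤n
at-nonzero (x ∷ w) (suc (suc p)) lt with at-nonzero w (suc p) lt
... | a , b = s≤s z≤n , s≤s b

swapAt-0 : ∀ w → swapAt w 0 ≡ w
swapAt-0 [] = refl
swapAt-0 (x ∷ []) = refl
swapAt-0 (x ∷ y ∷ w) = refl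

len-swapAt-≤ : ∀ w r → len (swapAt w r) ≤ suc (len w)
len-swapAt-≤ w r with at w r <? at w (suc r)
... | no nlt = m≤n⇒m≤1+n (len-swapAt-no-ascent w r nlt)
... | yes lt with r
... | zero rewrite swapAt-0 w = n≤1+n (len w)
... | suc r2 = ≤-reflexive (len-swapAt-ascent w (suc r2) (s≤s z≤n) (proj₂ (at-nonzero w (suc (suc r2)) (≤-trans (s≤s z≤n) lt))) lt)

len-foldl-swapAt-≤ : ∀ u c → len (foldl swapAt u c) ≤ len u + length c
len-foldl-swapAt-≤ u [] = ≤-reflexive (sym (+-identityʳ (len u)))
len-foldl-swapAt-≤ u (r ∷ c) = ≤-trans (len-foldl-swapAt-≤ (swapAt u r) c) (≤-trans (+-monoˡ-≤ (length c) (len-swapAt-≤ u r)) (≤-reflexive (sym (+-suc (len u) (length c)))))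

NotPair-sym : ∀ a x z → NotPair a x z → NotPair a z x
NotPair-sym a x z (p , q) = (λ (e1 , e2) → q (e2 , e1)) , (λ (e1 , e2) → p (e2 , e1))

countLT-map-τ : ∀ a x L → (∀ z → z ∈ L → NotPair a z x) → countLT (τ a x) (map (τ a) L) ≡ countLT x L
countLT-map-τ a x [] h = refl
countLT-map-τ a x (z ∷ L) h = cong₂ _+_ (cong indicator (τ-<ᵇ a z x (h z (here refl)))) (countLT-map-τ a x L (λ z2 m → h z2 (there m)))

len-map-τ-apart : ∀ a u → ¬ (a ∈ u × suc a ∈ u) → len (map (τ a) u) ≡ len u
len-map-τ-apart a [] h = refl
len-map-τ-apart a (x ∷ u) h =
  cong₂ _+_ (countLT-map-τ a x u (λ z m → (λ (e1 , e2) → h (subst (_∈ x ∷ u) e1 (there m) , subst (_∈ x ∷ u) e2 (here refl)))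
                                        , (λ (e1 , e2) → h (subst (_∈ x ∷ u) e2 (here refl) , subst (_∈ x ∷ u) e1 (there m)))))
            (len-map-τ-apart a u (λ (m1 , m2) → h (there m1 , there m2)))

countLT-map-τ-pair : ∀ a L → a ∉ L → suc a ∈ L → Uniq L → countLT (suc a) (map (τ a) L) ≡ suc (countLT a L)
countLT-map-τ-pair a (x ∷ L) na (here e) (nx ∷u u) rewrite sym e | τ-suc a | <⇒<ᵇ≡true (n<1+n a) | ≮⇒<ᵇ≡false {suc a} {a} (λ l → <-irrefl refl (<-trans l (n<1+n a))) =
  cong suc (trans (cong (λ z → countLT z (map (τ a) L)) (sym (τ-self a)))
    (countLT-map-τ a a L (λ z m → (λ (e1 , e2) → na (there (subst (_∈ L) e1 m))) , (λ (e1 , e2) → nx (subst (_∈ L) e1 m)))))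
countLT-map-τ-pair a (x ∷ L) na (there m) (nx ∷u u) =
  trans (cong (_+ countLT (suc a) (map (τ a) L)) (cong indicator (trans (cong (_<ᵇ suc a) (τ-fixes a x xa xsa)) (<ᵇ-cong {x} {suc a} {x} {a} (λ l → ≤∧≢⇒< (s≤s⁻¹ l) xa) (λ l → <-trans l (n<1+n a))))))
     (trans (cong (indicator (x <ᵇ a) +_) (countLT-map-τ-pair a L (λ m2 → na (there m2)) m u)) (+-suc (indicator (x <ᵇ a)) (countLT a L)))
  where
  xa : x ≢ a
  xa e = na (here (sym e))
  xsa : x ≢ suc a
  xsa e = nx (subst (_∈ L) (sym e) m)

len-map-τ-ascent : ∀ a u → Uniq u → a ∈ u → suc a ∈ u → pos a u < pos (suc a) u → len (map (τ a) u) ≡ suc (len u)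
len-map-τ-ascent a (x ∷ u) (nx ∷u uu) ma msa lt with x ≟ a
... | yes e rewrite e | τ-self a =
  cong₂ _+_ (countLT-map-τ-pair a u nx (msa' msa) uu) (len-map-τ-apart a u (λ (m1 , _) → nx m1))
  where
  msa' : suc a ∈ a ∷ u → suc a ∈ u
  msa' (here e2) = ⊥-elim (<-irrefl (sym e2) (n<1+n a))
  msa' (there m) = m
... | no ne with x ≟ suc a
... | yes e2 = contradiction (≤-trans (s≤s (proj₁ (pos-∈-range ma))) (≤-trans lt (≤-reflexive p1))) λ { (s≤s ()) }
  where
  p1 : pos (suc a) (x ∷ u) ≡ 1
  p1 = pos-of-at 0 (nx ∷u uu) (s≤s z≤n) e2
... | no ne2 = trans (cong₂ _+_ (countLT-map-τ a x u np)
                            (len-map-τ-ascent a u uu ma' msa' lt'))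
                 (+-suc (countLT x u) (len u))
  where
  tl : ∀ {v} → v ∈ x ∷ u → x ≢ v → v ∈ u
  tl (here e) n = ⊥-elim (n (sym e))
  tl (there m) n = m
  ma' : a ∈ u
  ma' = tl ma ne
  msa' : suc a ∈ u
  msa' = tl msa ne2
  np : ∀ z → z ∈ u → NotPair a z x
  np z m = (λ (_ , e) → ne2 e) , (λ (_ , e) → ne e)
  lt' : pos a u < pos (suc a) u
  lt' with pos-spec ma' | pos-spec msa'
  ... | q1 , e1 , _ | q2 , e2 , _ =
    subst₂ _<_ (sym e1) (sym e2) (s≤s⁻¹ (subst₂ _<_ (pos-cons {a} {x} {u} (λ e → ne (sym e)) e1) (pos-cons {suc a} {x} {u} (λ e → ne2 (sym e)) e2) lt))

at-swapAt′ : ∀ w r p → 1 ≤ r → suc r ≤ length w → 1 ≤ p → p ≤ length w → at (swapAt w r) p ≡ at w (τ r p)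
at-swapAt′ w r (suc q) a b _ d = at-swapAt w r q a b d

at-map′ : ∀ (f : ℕ → ℕ) w p → 1 ≤ p → p ≤ length w → at (map f w) p ≡ f (at w p)
at-map′ f w (suc q) _ d = at-map f w q d

at-InS : ∀ {m w p} → InS m w → 1 ≤ p → p ≤ m → 1 ≤ at w p × at w p ≤ m
at-InS {m} {w} {suc q} P _ d = InS-∈⁻ P (at-∈ w q (subst (suc q ≤_) (sym (InS-length P)) d))

involution-pos : ∀ {m y p} → IsInvolution m y → 1 ≤ p → p ≤ m → pos p y ≡ at y p
involution-pos {m} {y} {suc q} (P , I) _ d = trans (sym (at-inverse y q (subst (suc q ≤_) (sym (InS-length P)) d))) (cong (λ z → at z (suc q)) I)

involution-at-at : ∀ {m y p} → IsInvolution m y → 1 ≤ p → p ≤ m → at y (at y p) ≡ p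
involution-at-at {m} {y} {p} II c d = trans (cong (at y) (sym (involution-pos II c d))) (pos-at (InS-∈⁺ (proj₁ II) c d))

at-at⇒involution : ∀ {m y} → InS m y → (∀ p → 1 ≤ p → p ≤ m → at y (at y p) ≡ p) → IsInvolution m y
at-at⇒involution {m} {y} P h = P , at-ext _ _ (trans (length-inverse y) refl) g
  where
  g : ∀ q → q < length y → at (inverse y) (suc q) ≡ at y (suc q)
  g q lt with at-InS {m} {y} {suc q} P (s≤s z≤n) (subst (suc q ≤_) (InS-length P) lt)
  ... | c , d with pred-of (at y (suc q)) c
  ... | a , e = trans (at-inverse y q lt)
                   (trans (pos-of-at a (InS-uniq P) (subst (a <_) (sym (InS-length P)) (subst (_≤ m) e d))
                          (trans (cong (at y) (sym e)) (h (suc q) (s≤s z≤n) (subst (suc q ≤_) (InS-length P) lt)))) (sym e))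

countTrue-↭ : ∀ f {xs ys} → xs ↭ ys → countTrue f xs ≡ countTrue f ys
countTrue-↭ f ↭.refl = refl
countTrue-↭ f (↭.prep y p) = cong (indicator (f y) +_) (countTrue-↭ f p)
countTrue-↭ f (↭.swap y z p) =
  trans (+-left-comm (indicator (f y)) (indicator (f z)) _) (cong (λ t → indicator (f z) + (indicator (f y) + t)) (countTrue-↭ f p))
countTrue-↭ f (↭.trans p q) = trans (countTrue-↭ f p) (countTrue-↭ f q)

countTrue-map : ∀ f g L → countTrue f (map g L) ≡ countTrue (λ k → f (g k)) L
countTrue-map f g [] = refl
countTrue-map f g (x ∷ L) = cong (indicator (f (g x)) +_) (countTrue-map f g L)

countTrue-cong : ∀ f g L → (∀ k → k ∈ L → f k ≡ g k) → countTrue f L ≡ countTrue g L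
countTrue-cong f g [] h = refl
countTrue-cong f g (x ∷ L) h = cong₂ _+_ (cong indicator (h x (here refl))) (countTrue-cong f g L (λ k m → h k (there m)))

countTrue-≤ : ∀ f L → countTrue f L ≤ length L
countTrue-≤ f [] = z≤n
countTrue-≤ f (x ∷ L) with f x
... | true = s≤s (countTrue-≤ f L)
... | false = m≤n⇒m≤1+n (countTrue-≤ f L)

countTrue-flip : ∀ f g L c → Uniq L → c ∈ L → (∀ k → k ∈ L → k ≢ c → f k ≡ g k) → f c ≡ false → g c ≡ true → suc (countTrue f L) ≡ countTrue g L
countTrue-flip f g (x ∷ L) c (nx ∷u u) (here e) h fc gc rewrite sym e | fc | gc =
  cong suc (countTrue-cong f g L (λ k m → h k (there m) (λ e2 → nx (subst (_∈ L) e2 m))))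
countTrue-flip f g (x ∷ L) c (nx ∷u u) (there m) h fc gc =
  trans (sym (+-suc (indicator (f x)) (countTrue f L)))
     (cong₂ _+_ (cong indicator (h x (here refl) (λ e → nx (subst (_∈ L) (sym e) m)))) (countTrue-flip f g L c u m (λ k m2 → h k (there m2)) fc gc))

cycCount≡countTrue : ∀ {m} y → InS m y → cycCount y ≡ countTrue (λ k → k ≤ᵇ at y k) (iden m)
cycCount≡countTrue {m} y P = trans (cycCount-unfold y) (trans (cycLoop≡countTrue y (iden (length y))) (cong (countTrue (λ k → k ≤ᵇ at y k) ∘ iden) (InS-length P)))

cycCount-≤ : ∀ {m} y → InS m y → cycCount y ≤ m
cycCount-≤ {m} y P = ≤-trans (≤-reflexive (cycCount≡countTrue y P)) (≤-trans (countTrue-≤ _ (iden m)) (≤-reflexive (length-iden m)))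

∈-iden⁺ : ∀ {m v} → 1 ≤ v → v ≤ m → v ∈ iden m
∈-iden⁺ {m} c d = InS-∈⁺ {m} {iden m} ↭-refl c d

τ-≤ᵇ : ∀ v x y → NotPair v x y → (τ v x ≤ᵇ τ v y) ≡ (x ≤ᵇ y)
τ-≤ᵇ v x y np =
  ≤ᵇ-cong (λ le → ≮⇒≥ (λ lt → ≤⇒≯ le (proj₁ (τ-preserves-< v y x (NotPair-sym v x y np)) lt)))
         (λ le → ≮⇒≥ (λ lt → ≤⇒≯ le (proj₂ (τ-preserves-< v y x (NotPair-sym v x y np)) lt)))

-- Demazure conjugation of involutions

heckeConj : List ℕ → ℕ → List ℕ
heckeConj y j = heckeL (heckeR y j) j

-- Twice the involution length ℓ̂(y) of y ∈ S_m, as in the definition of Atom.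
invLength₂ : ℕ → List ℕ → ℕ
invLength₂ m y = len y + m ∸ cycCount y

heckeConj-descent : ∀ {m y j} → IsInvolution m y → 1 ≤ j → suc j ≤ m →
                    ¬ (at y j < at y (suc j)) → heckeConj y j ≡ y
heckeConj-descent {m} {y} {j} II j1 j2 nlt =
  trans (cong (λ z → heckeL z j) (heckeR-no-ascent y j (≮⇒<ᵇ≡false nlt))) (heckeL-no-ascent y j noLeftAscent)
  where
  noLeftAscent : leftAscent y j ≡ false
  noLeftAscent = trans (cong₂ _<ᵇ_ (involution-pos II j1 (<⇒≤ j2)) (involution-pos II (s≤s z≤n) j2)) (≮⇒<ᵇ≡false nlt)

module _ {m y j} (II : IsInvolution m y) (j1 : 1 ≤ j) (j2 : suc j ≤ m) (asc : at y j < at y (suc j)) where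
  private
    P = proj₁ II
    j≤m = <⇒≤ j2
    sj≤len : suc j ≤ length y
    sj≤len = subst (suc j ≤_) (sym (InS-length P)) j2
    ys = swapAt y j
    Pys : InS m ys
    Pys = swapAt-InS j P
    heckeR≡ys : heckeR y j ≡ ys
    heckeR≡ys = heckeR-ascent y j (<⇒<ᵇ≡true asc)
    at-ys : ∀ p → 1 ≤ p → p ≤ m → at ys p ≡ at y (τ j p)
    at-ys p c d = at-swapAt′ y j p j1 sj≤len c (subst (p ≤_) (sym (InS-length P)) d)
    pos-ys : ∀ v → pos v ys ≡ τ j (pos v y)
    pos-ys v = pos-swapAt {v} {y} j (InS-uniq P) j1 sj≤len
    cyc≤ : cycCount y ≤ len y + m
    cyc≤ = ≤-trans (cycCount-≤ y P) (m≤n+m m (len y))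

  -- When j and j+1 are fixed points, s_j ∘ y ∘ s_j degenerates to y s_j, which
  -- merges two fixed points into a 2-cycle.
  heckeConj-fixed-pair : at y j ≡ j → at y (suc j) ≡ suc j →
                         IsInvolution m (heckeConj y j) × invLength₂ m (heckeConj y j) ≡ 2 + invLength₂ m y
  heckeConj-fixed-pair yj ysj = subst (IsInvolution m) (sym conj≡ys) ys-involution , invLength-grows
    where
    noLeftAscent : leftAscent ys j ≡ false
    noLeftAscent = trans (cong₂ _<ᵇ_ (trans (pos-ys j) (cong (τ j) (trans (involution-pos II j1 j≤m) yj)))
                                    (trans (pos-ys (suc j)) (cong (τ j) (trans (involution-pos II (s≤s z≤n) j2) ysj))))
                        (trans (cong₂ _<ᵇ_ (τ-self j) (τ-suc j)) (≮⇒<ᵇ≡false (λ l → <-irrefl refl (<-trans l (n<1+n j)))))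
    conj≡ys : heckeConj y j ≡ ys
    conj≡ys = trans (cong (λ w → heckeL w j) heckeR≡ys) (heckeL-no-ascent ys j noLeftAscent)
    y-τ-comm : ∀ p → 1 ≤ p → p ≤ m → at y (τ j p) ≡ τ j (at y p)
    y-τ-comm p c d with τ-view j p
    ... | is-i refl = trans (cong (at y) (τ-self j)) (trans ysj (trans (sym (τ-self j)) (cong (τ j) (sym yj))))
    ... | is-suc-i refl = trans (cong (at y) (τ-suc j)) (trans yj (trans (sym (τ-suc j)) (cong (τ j) (sym ysj))))
    ... | is-other n1 n2 = trans (cong (at y) (τ-fixes j p n1 n2))
                                 (sym (τ-fixes j (at y p) (λ e → n1 (trans (sym (involution-at-at II c d)) (trans (cong (at y) e) yj)))
                                                          (λ e → n2 (trans (sym (involution-at-at II c d)) (trans (cong (at y) e) ysj)))))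
    ys-involution : IsInvolution m ys
    ys-involution = at-at⇒involution Pys h
      where
      h : ∀ p → 1 ≤ p → p ≤ m → at ys (at ys p) ≡ p
      h p c d with at-InS {m} {ys} {p} Pys c d
      ... | c2 , d2 = trans (at-ys (at ys p) c2 d2)
                       (trans (cong (λ t → at y (τ j t)) (trans (at-ys p c d) (y-τ-comm p c d)))
                       (trans (cong (at y) (τ-involutive j (at y p))) (involution-at-at II c d)))
    cyc-drops : suc (cycCount ys) ≡ cycCount y
    cyc-drops = trans (cong suc (cycCount≡countTrue ys Pys))
                  (trans (countTrue-flip _ _ (iden m) (suc j) (iden-uniq m) (∈-iden⁺ (s≤s z≤n) j2) same flipped fixed)
                         (sym (cycCount≡countTrue y P)))
      where
      same : ∀ k → k ∈ iden m → k ≢ suc j → (k ≤ᵇ at ys k) ≡ (k ≤ᵇ at y k)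
      same k mk ne with ∈-iden⁻ {m} mk | k ≟ j
      ... | c , d | yes refl = trans (≤⇒≤ᵇ≡true (≤-trans (n≤1+n k) (≤-reflexive (sym (trans (at-ys k c d) (trans (cong (at y) (τ-self k)) ysj))))))
                                     (sym (≤⇒≤ᵇ≡true (≤-reflexive (sym yj))))
      ... | c , d | no k≢j = cong (k ≤ᵇ_) (trans (at-ys k c d) (cong (at y) (τ-fixes j k k≢j ne)))
      flipped : (suc j ≤ᵇ at ys (suc j)) ≡ false
      flipped = ≰⇒≤ᵇ≡false (λ le → <-irrefl refl (≤-trans le (≤-reflexive (trans (at-ys (suc j) (s≤s z≤n) j2) (trans (cong (at y) (τ-suc j)) yj)))))
      fixed : (suc j ≤ᵇ at y (suc j)) ≡ true
      fixed = ≤⇒≤ᵇ≡true (≤-reflexive (sym ysj))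
    cyc<  : suc (cycCount ys) ≤ len y + m
    cyc< = ≤-trans (≤-reflexive cyc-drops) cyc≤
    invLength-grows : invLength₂ m (heckeConj y j) ≡ 2 + invLength₂ m y
    invLength-grows = begin
      invLength₂ m (heckeConj y j)             ≡⟨ cong (invLength₂ m) conj≡ys ⟩
      len ys + m ∸ cycCount ys                 ≡⟨ cong (λ a → a + m ∸ cycCount ys) (len-swapAt-ascent y j j1 sj≤len asc) ⟩
      suc (len y + m) ∸ cycCount ys            ≡⟨ +-∸-assoc 1 (≤-trans (n≤1+n _) cyc<) ⟩
      suc (len y + m ∸ cycCount ys)            ≡⟨ cong suc (+-∸-assoc 1 cyc<) ⟩
      2 + (len y + m ∸ suc (cycCount ys))      ≡⟨ cong (λ c → 2 + (len y + m ∸ c)) cyc-drops ⟩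
      2 + invLength₂ m y                       ∎
      where open ≡-Reasoning

  heckeConj-moved-pair : ¬ (at y j ≡ j × at y (suc j) ≡ suc j) →
                         IsInvolution m (heckeConj y j) × invLength₂ m (heckeConj y j) ≡ 2 + invLength₂ m y
  heckeConj-moved-pair notBothFixed = subst (IsInvolution m) (sym conj≡) conj-involution , invLength-grows
    where
    conj = map (τ j) ys
    Pconj : InS m conj
    Pconj = map-τ-InS j Pys j1 j2
    values-apart : NotPair j (at y j) (at y (suc j))
    values-apart = notBothFixed , (λ (e1 , e2) → <-asym (subst₂ _<_ e1 e2 asc) (n<1+n j))
    leftAscent-ys : leftAscent ys j ≡ true
    leftAscent-ys = trans (cong₂ _<ᵇ_ (trans (pos-ys j) (cong (τ j) (involution-pos II j1 j≤m)))
                                      (trans (pos-ys (suc j)) (cong (τ j) (involution-pos II (s≤s z≤n) j2))))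
                          (trans (τ-<ᵇ j (at y j) (at y (suc j)) values-apart) (<⇒<ᵇ≡true asc))
    conj≡ : heckeConj y j ≡ conj
    conj≡ = trans (cong (λ w → heckeL w j) heckeR≡ys) (heckeL-ascent ys j leftAscent-ys)
    at-conj : ∀ p → 1 ≤ p → p ≤ m → at conj p ≡ τ j (at y (τ j p))
    at-conj p c d = trans (at-map′ (τ j) ys p c (subst (p ≤_) (sym (InS-length Pys)) d)) (cong (τ j) (at-ys p c d))
    conj-involution : IsInvolution m conj
    conj-involution = at-at⇒involution Pconj h
      where
      h : ∀ p → 1 ≤ p → p ≤ m → at conj (at conj p) ≡ p
      h p c d with at-InS {m} {conj} {p} Pconj c d | τ-range j p m j1 j2 c d
      ... | c2 , d2 | c3 , d3 =
        trans (at-conj (at conj p) c2 d2)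
        (trans (cong (λ t → τ j (at y (τ j t))) (at-conj p c d))
        (trans (cong (λ t → τ j (at y t)) (τ-involutive j (at y (τ j p))))
        (trans (cong (τ j) (involution-at-at II c3 d3)) (τ-involutive j p))))
    not-2-cycle : at y j ≢ suc j
    not-2-cycle e = <-asym asc (subst₂ _<_ (sym y[j+1]≡j) (sym e) (n<1+n j))
      where y[j+1]≡j = trans (cong (at y) (sym e)) (involution-at-at II j1 j≤m)
    pairs-apart : ∀ k → NotPair j k (at y k)
    pairs-apart k = (λ (k≡j , yk≡j+1) → not-2-cycle (trans (cong (at y) (sym k≡j)) yk≡j+1))
                  , (λ (k≡j+1 , yk≡j) → not-2-cycle (trans (cong (at y) (sym (trans (cong (at y) (sym k≡j+1)) yk≡j)))
                                                            (involution-at-at II (s≤s z≤n) j2)))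
    cyc-same : cycCount conj ≡ cycCount y
    cyc-same = trans (cycCount≡countTrue conj Pconj)
               (trans (countTrue-↭ (λ k → k ≤ᵇ at conj k) (↭-sym (map-τ-InS j (↭.refl {xs = iden m}) j1 j2)))
               (trans (countTrue-map (λ k → k ≤ᵇ at conj k) (τ j) (iden m))
               (trans (countTrue-cong _ _ (iden m) same) (sym (cycCount≡countTrue y P)))))
      where
      same : ∀ k → k ∈ iden m → (τ j k ≤ᵇ at conj (τ j k)) ≡ (k ≤ᵇ at y k)
      same k mk with ∈-iden⁻ {m} mk
      ... | c , d with τ-range j k m j1 j2 c d
      ... | c3 , d3 = trans (cong (τ j k ≤ᵇ_) (trans (at-conj (τ j k) c3 d3) (cong (λ t → τ j (at y t)) (τ-involutive j k))))
                            (τ-≤ᵇ j k (at y k) (pairs-apart k))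
    len-grows : len conj ≡ 2 + len y
    len-grows = trans (len-map-τ-ascent j ys (InS-uniq Pys) (InS-∈⁺ Pys j1 j≤m) (InS-∈⁺ Pys (s≤s z≤n) j2) (<ᵇ≡true⇒< _ _ leftAscent-ys))
                      (cong suc (len-swapAt-ascent y j j1 sj≤len asc))
    invLength-grows : invLength₂ m (heckeConj y j) ≡ 2 + invLength₂ m y
    invLength-grows = trans (cong (invLength₂ m) conj≡) (trans (cong₂ (λ a c → a + m ∸ c) len-grows cyc-same) (+-∸-assoc 2 cyc≤))

heckeConj-involution : ∀ {m y j} → IsInvolution m y → 1 ≤ j → suc j ≤ m →
                       IsInvolution m (heckeConj y j) × (heckeConj y j ≡ y ⊎ invLength₂ m (heckeConj y j) ≡ 2 + invLength₂ m y)
heckeConj-involution {m} {y} {j} II j1 j2 with at y j <? at y (suc j)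
... | no nlt = subst (IsInvolution m) (sym unchanged) II , inj₁ unchanged
  where unchanged = heckeConj-descent II j1 j2 nlt
... | yes asc with at y j ≟ j | at y (suc j) ≟ suc j
...   | yes yj | yes ysj = map₂ inj₂ (heckeConj-fixed-pair II j1 j2 asc yj ysj)
...   | yes _  | no ne   = map₂ inj₂ (heckeConj-moved-pair II j1 j2 asc (ne ∘ proj₂))
...   | no ne  | _       = map₂ inj₂ (heckeConj-moved-pair II j1 j2 asc (ne ∘ proj₁))

-- Sorting and standardization

insert-≤ : ∀ x y L → (x ≤ᵇ y) ≡ true → insert x (y ∷ L) ≡ x ∷ y ∷ L
insert-≤ x y L e rewrite e = refl
insert-≰ : ∀ x y L → (x ≤ᵇ y) ≡ false → insert x (y ∷ L) ≡ y ∷ insert x L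
insert-≰ x y L e rewrite e = refl

insert-comm : ∀ x y L → insert x (insert y L) ≡ insert y (insert x L)
insert-comm x y [] with x ≤? y | y ≤? x
... | yes a | yes b rewrite ≤-antisym a b = refl
... | yes a | no b rewrite ≤⇒≤ᵇ≡true a | ≰⇒≤ᵇ≡false b = refl
... | no a | yes b rewrite ≤⇒≤ᵇ≡true b | ≰⇒≤ᵇ≡false a = refl
... | no a | no b = ⊥-elim (a (≤-trans (≤-total' y x b) ≤-refl))
  where
  ≤-total' : ∀ p q → ¬ (p ≤ q) → q ≤ p
  ≤-total' p q n = <⇒≤ (≰⇒> n)
insert-comm x y (z ∷ L) with y ≤? z | x ≤? z
... | yes yz | yes xz with x ≤? y | y ≤? x
...   | yes a | yes b rewrite ≤-antisym a b = refl
...   | yes a | no b = trans (cong (insert x) (insert-≤ y z L (≤⇒≤ᵇ≡true yz))) (trans (insert-≤ x y (z ∷ L) (≤⇒≤ᵇ≡true a))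
                        (sym (trans (cong (insert y) (insert-≤ x z L (≤⇒≤ᵇ≡true xz))) (trans (insert-≰ y x (z ∷ L) (≰⇒≤ᵇ≡false b)) (cong (x ∷_) (insert-≤ y z L (≤⇒≤ᵇ≡true yz)))))))
...   | no a | yes b = trans (cong (insert x) (insert-≤ y z L (≤⇒≤ᵇ≡true yz))) (trans (insert-≰ x y (z ∷ L) (≰⇒≤ᵇ≡false a)) (trans (cong (y ∷_) (insert-≤ x z L (≤⇒≤ᵇ≡true xz)))
                        (sym (trans (cong (insert y) (insert-≤ x z L (≤⇒≤ᵇ≡true xz))) (insert-≤ y x (z ∷ L) (≤⇒≤ᵇ≡true b))))))
...   | no a | no b = ⊥-elim (a (<⇒≤ (≰⇒> b)))
insert-comm x y (z ∷ L) | yes yz | no xz =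
  trans (cong (insert x) (insert-≤ y z L (≤⇒≤ᵇ≡true yz))) (trans (insert-≰ x y (z ∷ L) (≰⇒≤ᵇ≡false (λ xy → xz (≤-trans xy yz)))) (trans (cong (y ∷_) (insert-≰ x z L (≰⇒≤ᵇ≡false xz)))
  (sym (trans (cong (insert y) (insert-≰ x z L (≰⇒≤ᵇ≡false xz))) (insert-≤ y z (insert x L) (≤⇒≤ᵇ≡true yz))))))
insert-comm x y (z ∷ L) | no yz | yes xz =
  trans (cong (insert x) (insert-≰ y z L (≰⇒≤ᵇ≡false yz))) (trans (insert-≤ x z (insert y L) (≤⇒≤ᵇ≡true xz))
  (sym (trans (cong (insert y) (insert-≤ x z L (≤⇒≤ᵇ≡true xz))) (trans (insert-≰ y x (z ∷ L) (≰⇒≤ᵇ≡false (λ yx → yz (≤-trans yx xz)))) (cong (x ∷_) (insert-≰ y z L (≰⇒≤ᵇ≡false yz)))))))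
insert-comm x y (z ∷ L) | no yz | no xz =
  trans (cong (insert x) (insert-≰ y z L (≰⇒≤ᵇ≡false yz))) (trans (insert-≰ x z (insert y L) (≰⇒≤ᵇ≡false xz)) (trans (cong (z ∷_) (insert-comm x y L))
  (sym (trans (cong (insert y) (insert-≰ x z L (≰⇒≤ᵇ≡false xz))) (insert-≰ y z (insert x L) (≰⇒≤ᵇ≡false yz))))))

isort-↭ : ∀ {xs ys} → xs ↭ ys → isort xs ≡ isort ys
isort-↭ ↭.refl = refl
isort-↭ (↭.prep x p) = cong (insert x) (isort-↭ p)
isort-↭ (↭.swap {xs} x y p) = trans (insert-comm x y (isort xs)) (cong (λ L → insert y (insert x L)) (isort-↭ p))
isort-↭ (↭.trans p q) = trans (isort-↭ p) (isort-↭ q)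

insert-↭ : ∀ x L → insert x L ↭ x ∷ L
insert-↭ x [] = ↭-refl
insert-↭ x (y ∷ L) with x ≤ᵇ y
... | true = ↭-refl
... | false = ↭-trans (↭-prep y (insert-↭ x L)) (↭-swap y x ↭-refl)

isort↭ : ∀ L → isort L ↭ L
isort↭ [] = ↭-refl
isort↭ (x ∷ L) = ↭-trans (insert-↭ x (isort L)) (↭-prep x (isort↭ L))

data Increasing : List ℕ → Set where
  []i : Increasing []
  _∷i_ : ∀ {x xs} → All (x <_) xs → Increasing xs → Increasing (x ∷ xs)

insert-increasing : ∀ x L → x ∉ L → Increasing L → Increasing (insert x L)
insert-increasing x [] nm []i = [] ∷i []i
insert-increasing x (y ∷ L) nm (a ∷i I) with x ≤? y
... | yes le rewrite insert-≤ x y L (≤⇒≤ᵇ≡true le) =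
  All-tabulate (h _) ∷i (a ∷i I)
  where
  xy : x < y
  xy = ≤∧≢⇒< le (λ e → nm (here e))
  h : ∀ v → v ∈ y ∷ L → x < v
  h v (here e) = subst (x <_) (sym e) xy
  h v (there m) = <-trans xy (All-lookup a m)
... | no nle rewrite insert-≰ x y L (≰⇒≤ᵇ≡false nle) =
  All-tabulate (h _ ∘ ∈-resp-↭ (insert-↭ x L)) ∷i insert-increasing x L (λ m → nm (there m)) I
  where
  h : ∀ v → v ∈ x ∷ L → y < v
  h v (here e) = subst (y <_) (sym e) (≰⇒> nle)
  h v (there m) = All-lookup a m

isort-increasing : ∀ L → Uniq L → Increasing (isort L)
isort-increasing [] u = []i
isort-increasing (x ∷ L) (nx ∷u u) = insert-increasing x (isort L) (λ m → nx (∈-resp-↭ (isort↭ L) m)) (isort-increasing L u)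

increasing-at-< : ∀ {L} → Increasing L → ∀ p q → p < q → q < length L → at L (suc p) < at L (suc q)
increasing-at-< {x ∷ L} (a ∷i I) zero (suc q) lt (s≤s ql) = All-lookup a (at-∈ L q ql)
increasing-at-< {x ∷ L} (a ∷i I) (suc p) (suc q) (s≤s lt) (s≤s ql) = increasing-at-< I p q lt ql

increasing-pos-< : ∀ {L a b} → Increasing L → a ∈ L → b ∈ L → a < b → pos a L < pos b L
increasing-pos-< {L} {a} {b} I ma mb lt with pos-spec ma | pos-spec mb
... | p , e1 , l1 , e2 | q , f1 , l2 , f2 rewrite e1 | f1 with <-cmp p q
... | tri< x _ _ = s≤s x
... | tri≈ _ refl _ = ⊥-elim (<-irrefl (trans (sym e2) f2) lt)
... | tri> _ _ y = ⊥-elim (<-asym lt (subst₂ _<_ f2 e2 (increasing-at-< I q p y l1)))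

indicator-<ᵇ-mono : ∀ z x y → x ≤ y → indicator (z <ᵇ x) ≤ indicator (z <ᵇ y)
indicator-<ᵇ-mono z x y le with z <? x
... | yes lt rewrite <⇒<ᵇ≡true lt | <⇒<ᵇ≡true (≤-trans lt le) = ≤-refl
... | no nlt rewrite ≮⇒<ᵇ≡false nlt = z≤n

countLT-mono : ∀ {x y} Q → x ≤ y → countLT x Q ≤ countLT y Q
countLT-mono [] le = z≤n
countLT-mono {x} {y} (z ∷ Q) le = +-mono-≤ (indicator-<ᵇ-mono z x y le) (countLT-mono Q le)

countLT-mono-< : ∀ {x y} Q → x ∈ Q → x < y → countLT x Q < countLT y Q
countLT-mono-< {x} {y} (z ∷ Q) (here e) lt rewrite sym e | ≮⇒<ᵇ≡false {x} {x} (<-irrefl refl) | <⇒<ᵇ≡true lt = s≤s (countLT-mono Q (<⇒≤ lt))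
countLT-mono-< {x} {y} (z ∷ Q) (there m) lt = +-mono-≤-< (indicator-<ᵇ-mono z x y (<⇒≤ lt)) (countLT-mono-< Q m lt)

countLT-minimum : ∀ x L → (∀ v → v ∈ L → x ≤ v) → countLT x L ≡ 0
countLT-minimum x [] h = refl
countLT-minimum x (v ∷ L) h rewrite ≮⇒<ᵇ≡false {v} {x} (λ lt → <-irrefl refl (<-≤-trans lt (h v (here refl)))) = countLT-minimum x L (λ w m → h w (there m))

countLT-consecutive : ∀ k s x → s ≤ x → x ≤ s + k → countLT x (consecutive k s) ≡ x ∸ s
countLT-consecutive zero s x le1 le2 with ≤-antisym le1 (≤-trans le2 (≤-reflexive (+-identityʳ s)))
... | refl = sym (n∸n≡0 s)
countLT-consecutive (suc k) s x le1 le2 with s ≟ x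
... | yes refl rewrite ≮⇒<ᵇ≡false {s} {s} (<-irrefl refl) | n∸n≡0 s = countLT-minimum s (consecutive k (suc s)) (λ v m → <⇒≤ (proj₁ (∈-consecutive⁻ {k} {suc s} m)))
... | no ne with ≤∧≢⇒< le1 ne
... | lt rewrite <⇒<ᵇ≡true lt = trans (cong suc (countLT-consecutive k (suc s) x lt (≤-trans le2 (≤-reflexive (+-suc s k))))) (sym (+-∸-assoc 1 lt))

countLT-iden : ∀ m k → 1 ≤ k → k ≤ suc m → countLT k (iden m) ≡ k ∸ 1
countLT-iden m k c d rewrite iden≡consecutive m = countLT-consecutive m 1 k c d

length-std : ∀ Q → length (std Q) ≡ length Q
length-std Q = length-map _ Q

std-map-τ-apart : ∀ i Q → ¬ (i ∈ Q × suc i ∈ Q) → std (map (τ i) Q) ≡ std Q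
std-map-τ-apart i Q h =
  trans (sym (map-∘ {g = λ x → suc (countLT x (map (τ i) Q))} {f = τ i} Q))
     (map-cong-∈ _ _ Q (λ x mx → cong suc (countLT-map-τ i x Q (λ z mz →
        (λ (e1 , e2) → h (subst (_∈ Q) e1 mz , subst (_∈ Q) e2 mx)) , (λ (e1 , e2) → h (subst (_∈ Q) e2 mx , subst (_∈ Q) e1 mz))))))

τ-<ᵇ-suc : ∀ i z → z ≢ suc i → (τ i z <ᵇ suc i) ≡ (z <ᵇ i)
τ-<ᵇ-suc i z ne with τ-view i z
... | is-i e rewrite e | τ-self i = trans (≮⇒<ᵇ≡false {suc i} {suc i} (<-irrefl refl)) (sym (≮⇒<ᵇ≡false {i} {i} (<-irrefl refl)))
... | is-suc-i e = ⊥-elim (ne e)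
... | is-other n1 n2 rewrite τ-fixes i z n1 n2 = <ᵇ-cong (λ l → ≤∧≢⇒< (s≤s⁻¹ l) n1) (λ l → <-trans l (n<1+n i))

τ-<ᵇ-self : ∀ i z → (τ i z <ᵇ i) ≡ (z <ᵇ i)
τ-<ᵇ-self i z with τ-view i z
... | is-i e rewrite e | τ-self i = trans (≮⇒<ᵇ≡false {suc i} {i} (λ l → <-irrefl refl (<-trans l (n<1+n i)))) (sym (≮⇒<ᵇ≡false {i} {i} (<-irrefl refl)))
... | is-suc-i e rewrite e | τ-suc i = trans (≮⇒<ᵇ≡false {i} {i} (<-irrefl refl)) (sym (≮⇒<ᵇ≡false {suc i} {i} (λ l → <-irrefl refl (<-trans l (n<1+n i)))))
... | is-other n1 n2 rewrite τ-fixes i z n1 n2 = refl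

<ᵇ-suc : ∀ i z → z ≢ i → (z <ᵇ suc i) ≡ (z <ᵇ i)
<ᵇ-suc i z ne = <ᵇ-cong (λ l → ≤∧≢⇒< (s≤s⁻¹ l) ne) (λ l → <-trans l (n<1+n i))

countLT-suc-map-τ-absent : ∀ i Q → suc i ∉ Q → countLT (suc i) (map (τ i) Q) ≡ countLT i Q
countLT-suc-map-τ-absent i [] n = refl
countLT-suc-map-τ-absent i (z ∷ Q) n = cong₂ _+_ (cong indicator (τ-<ᵇ-suc i z (λ e → n (here (sym e))))) (countLT-suc-map-τ-absent i Q (λ m → n (there m)))

countLT-suc-map-τ-present : ∀ i Q → Uniq Q → suc i ∈ Q → countLT (suc i) (map (τ i) Q) ≡ suc (countLT i Q)
countLT-suc-map-τ-present i (z ∷ Q) (nz ∷u u) (here e) rewrite sym e | τ-suc i | <⇒<ᵇ≡true (n<1+n i) | ≮⇒<ᵇ≡false {suc i} {i} (λ l → <-irrefl refl (<-trans l (n<1+n i))) =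
  cong suc (countLT-suc-map-τ-absent i Q nz)
countLT-suc-map-τ-present i (z ∷ Q) (nz ∷u u) (there m) =
  trans (cong₂ _+_ (cong indicator (τ-<ᵇ-suc i z (λ e → nz (subst (_∈ Q) (sym e) m)))) (countLT-suc-map-τ-present i Q u m)) (+-suc (indicator (z <ᵇ i)) (countLT i Q))

countLT-map-τ-self : ∀ i Q → countLT i (map (τ i) Q) ≡ countLT i Q
countLT-map-τ-self i [] = refl
countLT-map-τ-self i (z ∷ Q) = cong₂ _+_ (cong indicator (τ-<ᵇ-self i z)) (countLT-map-τ-self i Q)

countLT-suc : ∀ i Q → Uniq Q → i ∈ Q → countLT (suc i) Q ≡ suc (countLT i Q)
countLT-suc i (z ∷ Q) (nz ∷u u) (here e) rewrite sym e | <⇒<ᵇ≡true (n<1+n i) | ≮⇒<ᵇ≡false {i} {i} (<-irrefl refl) =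
  cong suc (sumL Q (λ w m → λ e2 → nz (subst (_∈ Q) e2 m)))
  where
  sumL : ∀ L → (∀ w → w ∈ L → w ≢ i) → countLT (suc i) L ≡ countLT i L
  sumL [] _ = refl
  sumL (w ∷ L) h = cong₂ _+_ (cong indicator (<ᵇ-suc i w (h w (here refl)))) (sumL L (λ w2 m → h w2 (there m)))
countLT-suc i (z ∷ Q) (nz ∷u u) (there m) =
  trans (cong₂ _+_ (cong indicator (<ᵇ-suc i z (λ e → nz (subst (_∈ Q) (sym e) m)))) (countLT-suc i Q u m)) (+-suc (indicator (z <ᵇ i)) (countLT i Q))

std-map-τ-together : ∀ i Q → Uniq Q → i ∈ Q → suc i ∈ Q → std (map (τ i) Q) ≡ map (τ (suc (countLT i Q))) (std Q)
std-map-τ-together i Q u mi msi =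
  trans (sym (map-∘ {g = λ x → suc (countLT x (map (τ i) Q))} {f = τ i} Q))
     (trans (map-cong-∈ _ _ Q h) (map-∘ {g = τ (suc (countLT i Q))} {f = λ x → suc (countLT x Q)} Q))
  where
  j = suc (countLT i Q)
  h : ∀ x → x ∈ Q → suc (countLT (τ i x) (map (τ i) Q)) ≡ τ j (suc (countLT x Q))
  h x mx with τ-view i x
  ... | is-i e rewrite e | τ-self i = trans (cong suc (countLT-suc-map-τ-present i Q u msi)) (sym (τ-self j))
  ... | is-suc-i e rewrite e | τ-suc i = trans (cong suc (countLT-map-τ-self i Q)) (sym (trans (cong (λ t → τ j (suc t)) (countLT-suc i Q u mi)) (τ-suc j)))
  ... | is-other n1 n2 = trans (cong suc (countLT-map-τ i x Q (λ z mz → (λ (_ , e) → n2 e) , (λ (_ , e) → n1 e))))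
                       (sym (τ-fixes j (suc (countLT x Q)) ne1 ne2))
    where
    ne1 : suc (countLT x Q) ≢ j
    ne1 e with <-cmp x i
    ... | tri< l _ _ = <⇒≢ (countLT-mono-< Q mx l) (suc-injective e)
    ... | tri≈ _ e2 _ = n1 e2
    ... | tri> _ _ g = <⇒≢ (countLT-mono-< Q mi g) (sym (suc-injective e))
    ne2 : suc (countLT x Q) ≢ suc j
    ne2 e with <-cmp x i
    ... | tri< l _ _ = <⇒≢ (<-≤-trans (countLT-mono-< Q mx l) (n≤1+n _)) (suc-injective e)
    ... | tri≈ _ e2 _ = n1 e2
    ... | tri> _ _ g = <⇒≢ (countLT-mono-< Q msi (≤∧≢⇒< g (λ e3 → n2 (sym e3)))) (sym (trans (suc-injective e) (sym (countLT-suc i Q u mi))))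

≡ᵇ-injective : ∀ (φ : ℕ → ℕ) v x → (φ x ≡ φ v → x ≡ v) → (φ v ≡ᵇ φ x) ≡ (v ≡ᵇ x)
≡ᵇ-injective φ v x h with v ≟ x
... | yes e = trans (≡⇒≡ᵇ≡true {φ v} {φ x} (cong φ e)) (sym (≡⇒≡ᵇ≡true e))
... | no ne = trans (≢⇒≡ᵇ≡false {φ v} {φ x} (λ e → ne (sym (h (sym e))))) (sym (≢⇒≡ᵇ≡false ne))

pos-map-inj : ∀ (φ : ℕ → ℕ) v L → (∀ a → a ∈ L → φ a ≡ φ v → a ≡ v) → pos (φ v) (map φ L) ≡ pos v L
pos-map-inj φ v [] h = refl
pos-map-inj φ v (x ∷ L) h rewrite pos-map-inj φ v L (λ a m → h a (there m)) | ≡ᵇ-injective φ v x (h x (here refl)) = refl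

countLT-injective : ∀ Q a b → a ∈ Q → b ∈ Q → countLT a Q ≡ countLT b Q → a ≡ b
countLT-injective Q a b ma mb e with <-cmp a b
... | tri< l _ _ = ⊥-elim (<⇒≢ (countLT-mono-< Q ma l) e)
... | tri≈ _ e2 _ = e2
... | tri> _ _ g = ⊥-elim (<⇒≢ (countLT-mono-< Q mb g) (sym e))

pos-std : ∀ Q v → v ∈ Q → pos (suc (countLT v Q)) (std Q) ≡ pos v Q
pos-std Q v mv = pos-map-inj (λ x → suc (countLT x Q)) v Q (λ a ma e → countLT-injective Q a v ma mv (suc-injective e))

map-at-iden : ∀ L → map (at L) (iden (length L)) ≡ L
map-at-iden L = at-ext _ _ (trans (length-map (at L) (iden (length L))) (length-iden (length L))) h
  where
  h : ∀ q → q < length L → at (map (at L) (iden (length L))) (suc q) ≡ at L (suc q)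
  h q lt = trans (at-map (at L) (iden (length L)) q (subst (q <_) (sym (length-iden (length L))) lt)) (cong (at L) (at-iden (length L) q lt))

length-isort : ∀ B → length (isort B) ≡ length B
length-isort B = ↭-length (isort↭ B)

destd-↭ : ∀ B z → InS (length B) z → destd B z ↭ B
destd-↭ B z P = ↭-trans (map⁺ (at (isort B)) P)
                (subst (_↭ B) (sym (trans (cong (λ t → map (at (isort B)) (iden t)) (sym (length-isort B))) (map-at-iden (isort B)))) (isort↭ B))

length-destd : ∀ B z → length (destd B z) ≡ length z
length-destd B z = length-map _ z

countLT-map-monotone : ∀ (f : ℕ → ℕ) k z → (∀ k2 → k2 ∈ z → (f k2 <ᵇ f k) ≡ (k2 <ᵇ k)) → countLT (f k) (map f z) ≡ countLT k z
countLT-map-monotone f k [] h = refl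
countLT-map-monotone f k (x ∷ z) h = cong₂ _+_ (cong indicator (h x (here refl))) (countLT-map-monotone f k z (λ k2 m → h k2 (there m)))

increasing-at-<ᵇ : ∀ {L} → Increasing L → ∀ p q → 1 ≤ p → p ≤ length L → 1 ≤ q → q ≤ length L → (at L p <ᵇ at L q) ≡ (p <ᵇ q)
increasing-at-<ᵇ {L} I (suc p) (suc q) _ pl _ ql with <-cmp p q
... | tri< l _ _ = trans (<⇒<ᵇ≡true (increasing-at-< I p q l ql)) (sym (<⇒<ᵇ≡true (s≤s l)))
... | tri≈ _ refl _ = trans (≮⇒<ᵇ≡false {at L (suc p)} {at L (suc p)} (<-irrefl refl)) (sym (≮⇒<ᵇ≡false {suc p} {suc p} (<-irrefl refl)))
... | tri> _ _ g = trans (≮⇒<ᵇ≡false (λ l → <-asym l (increasing-at-< I q p g pl))) (sym (≮⇒<ᵇ≡false (λ l → <-asym l (s≤s g))))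

std-destd : ∀ B z → Uniq B → InS (length B) z → std (destd B z) ≡ z
std-destd B z u P =
  trans (sym (map-∘ {g = λ x → suc (countLT x (map (at (isort B)) z))} {f = at (isort B)} z))
     (map-id-∈ _ z h)
  where
  m = length B
  I = isort-increasing B u
  rng : ∀ k → k ∈ z → 1 ≤ k × k ≤ length (isort B)
  rng k mk with InS-∈⁻ P mk
  ... | c , d = c , subst (k ≤_) (sym (length-isort B)) d
  h : ∀ k → k ∈ z → suc (countLT (at (isort B) k) (map (at (isort B)) z)) ≡ k
  h k mk with rng k mk | InS-∈⁻ P mk
  ... | c , d | c0 , d0 =
    trans (cong suc (trans (countLT-map-monotone (at (isort B)) k z (λ k2 m2 → let (c2 , d2) = rng k2 m2 in increasing-at-<ᵇ I k2 k c2 d2 c d))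
                 (trans (countLT-↭ k P) (countLT-iden m k c0 (m≤n⇒m≤1+n d0)))))
       (m+[n∸m]≡n c0)

at-rank : ∀ {L} → Increasing L → ∀ x → x ∈ L → at L (suc (countLT x L)) ≡ x
at-rank {h ∷ t} (a ∷i I) .h (here refl) rewrite ≮⇒<ᵇ≡false {h} {h} (<-irrefl refl) | countLT-minimum h t (λ v m → <⇒≤ (All-lookup a m)) = refl
at-rank {h ∷ t} (a ∷i I) x (there m) rewrite <⇒<ᵇ≡true (All-lookup a m) = at-rank I x m

destd-std : ∀ B → Uniq B → destd B (std B) ≡ B
destd-std B u =
  trans (sym (map-∘ {g = at (isort B)} {f = λ x → suc (countLT x B)} B))
     (map-id-∈ _ B (λ x mx → trans (cong (λ t → at (isort B) (suc t)) (countLT-↭ x (↭-sym (isort↭ B))))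
                               (at-rank (isort-increasing B u) x (∈-resp-↭ (↭-sym (isort↭ B)) mx))))


-- Blocks and inversions between blocks

blocks-map : ∀ (f : ℕ → ℕ) μ π → blocks μ (map f π) ≡ map (map f) (blocks μ π)
blocks-map f [] π = refl
blocks-map f (m ∷ μ) π = cong₂ _∷_ (take-map m π) (trans (cong (blocks μ) (drop-map m π)) (blocks-map f μ (drop m π)))

take-++ : ∀ (B C : List ℕ) → take (length B) (B ++ C) ≡ B
take-++ [] C = refl
take-++ (x ∷ B) C = cong (x ∷_) (take-++ B C)

drop-++ : ∀ (B C : List ℕ) → drop (length B) (B ++ C) ≡ C
drop-++ [] C = refl
drop-++ (x ∷ B) C = drop-++ B C

blocks-concat : ∀ bs μ → map length bs ≡ μ → blocks μ (concat bs) ≡ bs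
blocks-concat [] [] e = refl
blocks-concat (B ∷ bs) (_ ∷ _) refl = cong₂ _∷_ (take-++ B (concat bs)) (trans (cong (blocks _) (drop-++ B (concat bs))) (blocks-concat bs _ refl))
blocks-concat [] (m ∷ μ) ()
blocks-concat (B ∷ bs) [] ()

concat-blocks : ∀ μ π → sum μ ≡ length π → concat (blocks μ π) ≡ π
concat-blocks [] [] e = refl
concat-blocks [] (x ∷ π) ()
concat-blocks (m ∷ μ) π e =
  trans (cong (take m π ++_) (concat-blocks μ (drop m π) (trans (sym (m+n∸m≡n m (sum μ))) (trans (cong (_∸ m) e) (sym (length-drop m π))))))
     (take++drop≡id m π)

map-length-blocks : ∀ μ π → sum μ ≡ length π → map length (blocks μ π) ≡ μ
map-length-blocks [] π e = refl
map-length-blocks (m ∷ μ) π e =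
  cong₂ _∷_ (trans (length-take m π) (m≤n⇒m⊓n≡m (≤-trans (m≤m+n m (sum μ)) (≤-reflexive e))))
            (map-length-blocks μ (drop m π) (trans (sym (m+n∸m≡n m (sum μ))) (trans (cong (_∸ m) e) (sym (length-drop m π)))))

uniq-++ˡ : ∀ {B C} → Uniq (B ++ C) → Uniq B
uniq-++ˡ {[]} u = []u
uniq-++ˡ {x ∷ B} (nx ∷u u) = (λ m → nx (∈-++⁺ˡ m)) ∷u uniq-++ˡ u

uniq-++ʳ : ∀ {B C} → Uniq (B ++ C) → Uniq C
uniq-++ʳ {[]} u = u
uniq-++ʳ {x ∷ B} (nx ∷u u) = uniq-++ʳ {B} u

uniq-++-disjoint : ∀ {B C v} → Uniq (B ++ C) → v ∈ B → v ∉ C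
uniq-++-disjoint {x ∷ B} {C} (nx ∷u u) (here refl) mc = nx (∈-++⁺ʳ B mc)
uniq-++-disjoint {x ∷ B} (nx ∷u u) (there m) mc = uniq-++-disjoint {B} u m mc

pos-++ˡ : ∀ {x} B C → x ∈ B → pos x (B ++ C) ≡ pos x B
pos-++ˡ {x} (y ∷ B) C m with x ≟ y
... | yes e rewrite ≡⇒≡ᵇ≡true e = refl
... | no ne with m
... | here e = ⊥-elim (ne e)
... | there m2 with pos-spec m2
... | q , e1 , _ = trans (pos-cons {xs = B ++ C} ne (trans (pos-++ˡ B C m2) e1)) (sym (pos-cons {xs = B} ne e1))

pos-++ʳ : ∀ {x} B C → x ∉ B → x ∈ C → pos x (B ++ C) ≡ length B + pos x C
pos-++ʳ {x} [] C nb mc = refl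
pos-++ʳ {x} (y ∷ B) C nb mc with pos-spec (∈-++⁺ʳ B mc) | pos-spec mc
... | q , e1 , _ | q2 , e2 , _ =
  trans (pos-cons {xs = B ++ C} (λ e → nb (here e)) e1)
     (cong suc (trans (sym e1) (pos-++ʳ B C (λ m → nb (there m)) mc)))

bothIn-true : ∀ {i B} → i ∈ B → suc i ∈ B → bothIn i B ≡ true
bothIn-true m1 m2 rewrite elem-true m1 | elem-true m2 = refl

bothIn-true⇒ : ∀ {i B} → bothIn i B ≡ true → i ∈ B × suc i ∈ B
bothIn-true⇒ {i} {B} e with elem i B in e1 | elem (suc i) B in e2
... | true | true = elem-true⇒∈ e1 , elem-true⇒∈ e2
... | true | false with e
... | ()
bothIn-true⇒ {i} {B} e | false | _ with e
... | ()

∉⇒bothIn-false : ∀ {i B} → i ∉ B → bothIn i B ≡ false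
∉⇒bothIn-false {i} {B} i∉B rewrite elem-false i∉B = refl

bothIn-false⇒ : ∀ {i B} → bothIn i B ≡ false → ¬ (i ∈ B × suc i ∈ B)
bothIn-false⇒ e (m1 , m2) with trans (sym e) (bothIn-true m1 m2)
... | ()

any-bothIn-false-∷ : ∀ i B bs → any (bothIn i) (B ∷ bs) ≡ false → bothIn i B ≡ false × any (bothIn i) bs ≡ false
any-bothIn-false-∷ i B bs e with bothIn i B
... | true with e
... | ()
any-bothIn-false-∷ i B bs e | false = refl , e

Blockwise↭ : List (List ℕ) → List (List ℕ) → Set
Blockwise↭ = Pointwise (λ (B Q : List ℕ) → Q ↭ B)

concat-↭ : ∀ {bs Qs} → Blockwise↭ bs Qs → concat Qs ↭ concat bs
concat-↭ [] = ↭-refl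
concat-↭ (p ∷ ps) = ↭-++⁺ p (concat-↭ ps)

Blockwise↭-sym : ∀ {bs Qs} → Blockwise↭ bs Qs → Blockwise↭ Qs bs
Blockwise↭-sym [] = []
Blockwise↭-sym (p ∷ ps) = ↭-sym p ∷ Blockwise↭-sym ps

Blockwise↭-lengths : ∀ {bs Qs} → Blockwise↭ bs Qs → map length Qs ≡ map length bs
Blockwise↭-lengths [] = refl
Blockwise↭-lengths (p ∷ ps) = cong₂ _∷_ (↭-length p) (Blockwise↭-lengths ps)

Apart : ℕ → ℕ → List (List ℕ) → Set
Apart x y bs = All (λ B → ¬ (x ∈ B × y ∈ B)) bs

any-bothIn-false⇒Apart : ∀ i bs → any (bothIn i) bs ≡ false → Apart i (suc i) bs
any-bothIn-false⇒Apart i [] e = []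
any-bothIn-false⇒Apart i (B ∷ bs) e with any-bothIn-false-∷ i B bs e
... | e1 , e2 = bothIn-false⇒ e1 ∷ any-bothIn-false⇒Apart i bs e2

Apart-↭ : ∀ {x y bs Qs} → Blockwise↭ bs Qs → Apart x y bs → Apart x y Qs
Apart-↭ [] [] = []
Apart-↭ (p ∷ ps) (d ∷ ds) = (λ (a , b) → d (∈-resp-↭ p a , ∈-resp-↭ p b)) ∷ Apart-↭ ps ds

∈-++-∉ˡ : ∀ {x : ℕ} (B C : List ℕ) → x ∈ B ++ C → x ∉ B → x ∈ C
∈-++-∉ˡ {x} B C m nb with ∈-++⁻ B m
... | inj₁ a = ⊥-elim (nb a)
... | inj₂ b = b

Apart-pos-< : ∀ x y bs Qs → Blockwise↭ bs Qs → Apart x y bs → x ∈ concat bs → y ∈ concat bs →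
       pos x (concat bs) < pos y (concat bs) → pos x (concat Qs) < pos y (concat Qs)
Apart-pos-< x y (B ∷ bs) (Q ∷ Qs) (p ∷ ps) (d ∷ ds) mx my lt with x ∈? B | y ∈? B
... | yes a | yes b = ⊥-elim (d (a , b))
... | yes a | no b =
  subst₂ _<_ (sym (pos-++ˡ Q (concat Qs) aQ)) (sym (pos-++ʳ Q (concat Qs) bQ myQ))
    (≤-trans (s≤s (proj₂ (pos-∈-range aQ))) (≤-trans (≤-reflexive (+-comm 1 (length Q))) (+-monoʳ-≤ (length Q) (proj₁ (pos-∈-range myQ)))))
  where
  aQ = ∈-resp-↭ (↭-sym p) a
  bQ : y ∉ Q
  bQ m = b (∈-resp-↭ p m)
  myQ : y ∈ concat Qs
  myQ = ∈-resp-↭ (↭-sym (concat-↭ ps)) (∈-++-∉ˡ B (concat bs) my b)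
... | no a | yes b = ⊥-elim (<-asym lt (subst₂ _<_ (sym (pos-++ˡ B (concat bs) b)) (sym (pos-++ʳ B (concat bs) a mxr))
                       (≤-trans (s≤s (proj₂ (pos-∈-range b))) (≤-trans (≤-reflexive (+-comm 1 (length B))) (+-monoʳ-≤ (length B) (proj₁ (pos-∈-range mxr)))))))
  where
  mxr = ∈-++-∉ˡ B (concat bs) mx a
... | no a | no b =
  subst₂ _<_ (sym (pos-++ʳ Q (concat Qs) aQ (∈-resp-↭ (↭-sym (concat-↭ ps)) mxr))) (sym (pos-++ʳ Q (concat Qs) bQ (∈-resp-↭ (↭-sym (concat-↭ ps)) myr)))
    (+-monoʳ-< (length Q) (Apart-pos-< x y bs Qs ps ds mxr myr
       (+-cancelˡ-< (length B) _ _ (subst₂ _<_ (pos-++ʳ B (concat bs) a mxr) (pos-++ʳ B (concat bs) b myr) lt))))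
  where
  mxr = ∈-++-∉ˡ B (concat bs) mx a
  myr = ∈-++-∉ˡ B (concat bs) my b
  aQ : x ∉ Q
  aQ m = a (∈-resp-↭ p m)
  bQ : y ∉ Q
  bQ m = b (∈-resp-↭ p m)

crossInv : List ℕ → List ℕ → ℕ
crossInv [] ys = 0
crossInv (x ∷ xs) ys = countLT x ys + crossInv xs ys

len-++ : ∀ xs ys → len (xs ++ ys) ≡ len xs + len ys + crossInv xs ys
len-++ [] ys = sym (+-identityʳ (len ys))
len-++ (x ∷ xs) ys =
  trans (cong₂ _+_ (countLT-++ x xs ys) (len-++ xs ys)) (rearrange (countLT x xs) (countLT x ys) (len xs) (len ys) (crossInv xs ys))
  where
  rearrange : ∀ a b c d e → (a + b) + (c + d + e) ≡ (a + c) + d + (b + e)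
  rearrange = solve 5 (λ a b c d e → (a :+ b) :+ (c :+ d :+ e) := (a :+ c) :+ d :+ (b :+ e)) refl

blockCrossInv : List (List ℕ) → ℕ
blockCrossInv [] = 0
blockCrossInv (B ∷ bs) = crossInv B (concat bs) + blockCrossInv bs

blockInvSum : List (List ℕ) → ℕ
blockInvSum [] = 0
blockInvSum (B ∷ bs) = len B + blockInvSum bs

len-concat : ∀ bs → len (concat bs) ≡ blockInvSum bs + blockCrossInv bs
len-concat [] = refl
len-concat (B ∷ bs) = trans (len-++ B (concat bs)) (trans (cong (λ t → len B + t + crossInv B (concat bs)) (len-concat bs))
                          (rearrange (len B) (blockInvSum bs) (blockCrossInv bs) (crossInv B (concat bs))))
  where
  rearrange : ∀ a b c d → a + (b + c) + d ≡ (a + b) + (d + c)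
  rearrange = solve 4 (λ a b c d → a :+ (b :+ c) :+ d := (a :+ b) :+ (d :+ c)) refl

crossInv-↭ʳ : ∀ xs {ys ys2} → ys ↭ ys2 → crossInv xs ys ≡ crossInv xs ys2
crossInv-↭ʳ [] p = refl
crossInv-↭ʳ (x ∷ xs) p = cong₂ _+_ (countLT-↭ x p) (crossInv-↭ʳ xs p)

crossInv-↭ˡ : ∀ {xs xs2} ys → xs ↭ xs2 → crossInv xs ys ≡ crossInv xs2 ys
crossInv-↭ˡ ys ↭.refl = refl
crossInv-↭ˡ ys (↭.prep x p) = cong (countLT x ys +_) (crossInv-↭ˡ ys p)
crossInv-↭ˡ ys (↭.swap x y p) =
  trans (+-left-comm (countLT x ys) (countLT y ys) _) (cong (λ t → countLT y ys + (countLT x ys + t)) (crossInv-↭ˡ ys p))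
crossInv-↭ˡ ys (↭.trans p q) = trans (crossInv-↭ˡ ys p) (crossInv-↭ˡ ys q)

blockCrossInv-↭ : ∀ {bs Qs} → Blockwise↭ bs Qs → blockCrossInv Qs ≡ blockCrossInv bs
blockCrossInv-↭ [] = refl
blockCrossInv-↭ {B ∷ bs} {Q ∷ Qs} (p ∷ ps) =
  cong₂ _+_ (trans (crossInv-↭ˡ (concat Qs) p) (crossInv-↭ʳ B (concat-↭ ps))) (blockCrossInv-↭ ps)

blockInvSum-map-τ : ∀ i bs → Apart i (suc i) bs → blockInvSum (map (map (τ i)) bs) ≡ blockInvSum bs
blockInvSum-map-τ i [] [] = refl
blockInvSum-map-τ i (B ∷ bs) (d ∷ ds) = cong₂ _+_ (len-map-τ-apart i B d) (blockInvSum-map-τ i bs ds)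

blockCrossInv-map-τ : ∀ i bs → Apart i (suc i) bs → len (map (τ i) (concat bs)) ≡ suc (len (concat bs)) →
                blockCrossInv (map (map (τ i)) bs) ≡ suc (blockCrossInv bs)
blockCrossInv-map-τ i bs ds e =
  +-cancelˡ-≡ (blockInvSum bs) _ _
    (trans (cong (_+ blockCrossInv (map (map (τ i)) bs)) (sym (blockInvSum-map-τ i bs ds)))
    (trans (sym (len-concat (map (map (τ i)) bs)))
    (trans (cong len (concat-map {f = τ i} bs))
    (trans e (trans (cong suc (len-concat bs)) (sym (+-suc (blockInvSum bs) (blockCrossInv bs))))))))

blockWeight : List ℕ → ℕ
blockWeight B = invLength₂ (length B) (std B)

totalBlockWeight : List (List ℕ) → ℕ
totalBlockWeight [] = 0
totalBlockWeight (B ∷ bs) = blockWeight B + totalBlockWeight bs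

potential : List (List ℕ) → ℕ
potential bs = 2 * blockCrossInv bs + totalBlockWeight bs

∈-split : ∀ {x : ℕ} {ys} → x ∈ ys → Σ (List ℕ) λ r → (ys ↭ x ∷ r) × (∀ z → z ∈ r → z ∈ ys) × (∀ z → z ∈ ys → z ≢ x → z ∈ r)
∈-split {x} {y ∷ r} (here e) = r , subst (λ t → y ∷ r ↭ t ∷ r) (sym e) ↭-refl , (λ z m → there m) , h
  where
  h : ∀ z → z ∈ y ∷ r → z ≢ x → z ∈ r
  h z (here e2) ne = ⊥-elim (ne (trans e2 (sym e)))
  h z (there m) ne = m
∈-split {x} {y ∷ ys} (there m) with ∈-split m
... | r , p , f , g = y ∷ r , ↭-trans (↭-prep y p) (↭-swap y x ↭-refl) , f2 , g2
  where
  f2 : ∀ z → z ∈ y ∷ r → z ∈ y ∷ ys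
  f2 z (here e) = here e
  f2 z (there m2) = there (f z m2)
  g2 : ∀ z → z ∈ y ∷ ys → z ≢ x → z ∈ y ∷ r
  g2 z (here e) ne = here e
  g2 z (there m2) ne = there (g z m2 ne)

uniq-same-elements-↭ : ∀ {xs ys} → Uniq xs → Uniq ys → (∀ z → z ∈ xs → z ∈ ys) → (∀ z → z ∈ ys → z ∈ xs) → xs ↭ ys
uniq-same-elements-↭ {[]} {[]} _ _ f g = ↭-refl
uniq-same-elements-↭ {[]} {y ∷ ys} _ _ f g with g y (here refl)
... | ()
uniq-same-elements-↭ {x ∷ xs} {ys} (nx ∷u ux) uy f g with ∈-split (f x (here refl))
... | r , p , f2 , g2 with uniq-↭ p uy
... | nxr ∷u ur = ↭-trans (↭-prep x (uniq-same-elements-↭ ux ur h1 h2)) (↭-sym p)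
  where
  h1 : ∀ z → z ∈ xs → z ∈ r
  h1 z m = g2 z (f z (there m)) (λ e → nx (subst (_∈ xs) e m))
  h2 : ∀ z → z ∈ r → z ∈ xs
  h2 z m with g z (f2 z m)
  ... | here e = ⊥-elim (nxr (subst (_∈ r) e m))
  ... | there m2 = m2

inverse-InS : ∀ {m w} → InS m w → InS m (inverse w)
inverse-InS {m} {w} P = uniq-same-elements-↭ (inverse-uniq P) (iden-uniq m) h1 h2
  where
  lw = InS-length P
  h1 : ∀ z → z ∈ inverse w → z ∈ iden m
  h1 z mz with ∈-map⁻ (λ j → pos j w) mz
  ... | j , mj , e with ∈-iden⁻ {length w} mj
  ... | c , d = subst (_∈ iden m) (sym e) (∈-iden⁺ (proj₁ (pos-∈-range mjw)) (subst (pos j w ≤_) lw (proj₂ (pos-∈-range mjw))))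
    where
    mjw = InS-∈⁺ P c (subst (j ≤_) lw d)
  h2 : ∀ z → z ∈ iden m → z ∈ inverse w
  h2 z mz with ∈-iden⁻ {m} mz
  ... | c , d with pred-of z c
  ... | q , refl with at-InS {m} {w} {suc q} P c d
  ... | c2 , d2 with pred-of (at w (suc q)) c2
  ... | a , e = subst (_∈ inverse w) eq (at-∈ (inverse w) a (subst (a <_) (sym (trans (length-inverse w) lw)) (subst (_≤ m) e d2)))
    where
    eq : at (inverse w) (suc a) ≡ suc q
    eq = trans (at-inverse w a (subst (a <_) (sym lw) (subst (_≤ m) e d2)))
            (pos-of-at q (InS-uniq P) (subst (q <_) (sym lw) d) e)

map-τ-↭ : ∀ i Q → Uniq Q → i ∈ Q → suc i ∈ Q → map (τ i) Q ↭ Q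
map-τ-↭ i Q u mi msi = uniq-same-elements-↭ (uniq-map (τ i) (λ a b _ _ e → τ-injective i e) u) u h1 h2
  where
  cl : ∀ v → v ∈ Q → τ i v ∈ Q
  cl v mv with τ-view i v
  ... | is-i e rewrite e | τ-self i = msi
  ... | is-suc-i e rewrite e | τ-suc i = mi
  ... | is-other n1 n2 rewrite τ-fixes i v n1 n2 = mv
  h1 : ∀ z → z ∈ map (τ i) Q → z ∈ Q
  h1 z mz with ∈-map⁻ (τ i) mz
  ... | v , mv , e = subst (_∈ Q) (sym e) (cl v mv)
  h2 : ∀ z → z ∈ Q → z ∈ map (τ i) Q
  h2 z mz = subst (_∈ map (τ i) Q) (τ-involutive i z) (∈-map⁺ (τ i) (cl z mz))

length-heckeR : ∀ y r → length (heckeR y r) ≡ length y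
length-heckeR y r = by-ascent (rightAscent y r) refl
  where
  by-ascent : ∀ b → rightAscent y r ≡ b → length (heckeR y r) ≡ length y
  by-ascent true e = trans (cong length (heckeR-ascent y r e)) (length-swapAt y r)
  by-ascent false e = cong length (heckeR-no-ascent y r e)

length-heckeL : ∀ y r → length (heckeL y r) ≡ length y
length-heckeL y r = by-ascent (leftAscent y r) refl
  where
  by-ascent : ∀ b → leftAscent y r ≡ b → length (heckeL y r) ≡ length y
  by-ascent true e = trans (cong length (heckeL-ascent y r e)) (length-map (τ r) y)
  by-ascent false e = cong length (heckeL-no-ascent y r e)

length-heckeConj : ∀ y r → length (heckeConj y r) ≡ length y
length-heckeConj y r = trans (length-heckeL (heckeR y r) r) (length-heckeR y r)

length-blockStep : ∀ B i → length (blockStep B i) ≡ length B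
length-blockStep B i = trans (length-destd B (heckeConj (std B) (suc (countLT i B)))) (trans (length-heckeConj (std B) (suc (countLT i B))) (length-std B))

-- Atoms

foldl-heckeR-InS : ∀ {m} u c → InS m u → InS m (foldl heckeR u c)
foldl-heckeR-InS u []      P = P
foldl-heckeR-InS u (r ∷ c) P = foldl-heckeR-InS (heckeR u r) c (heckeR-InS r P)

inverse-hecke-snoc : ∀ {m x} c j → InS m x → Letters m c → 1 ≤ j → suc j ≤ m → at x j < at x (suc j) →
                     foldl heckeR (inverse (swapAt x j)) (c ++ [ j ]) ≡ heckeConj (foldl heckeR (inverse x) c) j
inverse-hecke-snoc {m} {x} c j Px lc j1 j2 asc = begin
  foldl heckeR (inverse (swapAt x j)) (c ++ [ j ])  ≡⟨ foldl-++ heckeR (inverse (swapAt x j)) c [ j ] ⟩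
  heckeR (foldl heckeR (inverse (swapAt x j)) c) j  ≡⟨ cong (λ t → heckeR (foldl heckeR t c) j) (inverse-swapAt j Px j1 j2) ⟩
  heckeR (foldl heckeR (swapVal j (inverse x)) c) j ≡⟨ cong (λ t → heckeR (foldl heckeR t c) j) (heckeL-ascent (inverse x) j leftAsc) ⟨
  heckeR (foldl heckeR (heckeL (inverse x) j) c) j  ≡⟨ cong (λ t → heckeR t j) (foldl-heckeR-heckeL-comm c (inverse x) j Px⁻¹ j1 j2 lc) ⟩
  heckeR (heckeL (foldl heckeR (inverse x) c) j) j  ≡⟨ heckeR-heckeL-comm j j (foldl-heckeR-InS (inverse x) c Px⁻¹) j1 j2 j1 j2 ⟩
  heckeConj (foldl heckeR (inverse x) c) j          ∎
  where
  open ≡-Reasoning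
  Px⁻¹ = inverse-InS Px
  leftAsc : leftAscent (inverse x) j ≡ true
  leftAsc = trans (cong₂ _<ᵇ_ (pos-inverse′ Px j1 (<⇒≤ j2)) (pos-inverse j Px j2)) (<⇒<ᵇ≡true asc)

atom-step : ∀ {m y x j} → IsInvolution m y → Atom m y x → 1 ≤ j → suc j ≤ m → at x j < at x (suc j) →
            invLength₂ m (heckeConj y j) ≡ 2 + invLength₂ m y → Atom m (heckeConj y j) (swapAt x j)
atom-step {m} {y} {x} {j} II (Px , (c , (lc , lenc , fc) , hc) , ax) j1 j2 asc grows =
  swapAt-InS j Px , (c ++ [ j ] , reduced , hecke) , double-length
  where
  len-grows : len (swapAt x j) ≡ suc (len x)
  len-grows = len-swapAt-ascent x j j1 (subst (suc j ≤_) (sym (InS-length Px)) j2) asc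
  reduced : Reduced m (swapAt x j) (c ++ [ j ])
  reduced = All++⁺ lc ((j1 , j2) ∷ [])
          , trans (length-++ c {[ j ]}) (trans (+-comm (length c) 1) (trans (cong suc lenc) (sym len-grows)))
          , trans (foldl-++ swapAt (iden m) c [ j ]) (cong (λ t → swapAt t j) fc)
  hecke : foldl heckeR (inverse (swapAt x j)) (c ++ [ j ]) ≡ heckeConj y j
  hecke = trans (inverse-hecke-snoc c j Px lc j1 j2 asc) (cong (λ t → heckeConj t j) hc)
  double-length : 2 * len (swapAt x j) ≡ len (heckeConj y j) + m ∸ cycCount (heckeConj y j)
  double-length = trans (cong (2 *_) len-grows) (trans (*-suc 2 (len x)) (trans (cong (2 +_) ax) (sym grows)))

blockAct : ℕ → List ℕ → List ℕ
blockAct i B = if bothIn i B then blockStep B i else B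

blockAct-both : ∀ i B → bothIn i B ≡ true → blockAct i B ≡ blockStep B i
blockAct-both i B e rewrite e = refl
blockAct-not-both : ∀ i B → bothIn i B ≡ false → blockAct i B ≡ B
blockAct-not-both i B e rewrite e = refl

actMu-within : ∀ μ π i → any (bothIn i) (blocks μ π) ≡ true → actMu μ π i ≡ concat (map (blockAct i) (blocks μ π))
actMu-within μ π i e rewrite e = refl
actMu-across : ∀ μ π i → any (bothIn i) (blocks μ π) ≡ false → actMu μ π i ≡ heckeL π i
actMu-across μ π i e rewrite e = refl

any-bothIn-true⇒∈ : ∀ i bs → any (bothIn i) bs ≡ true → i ∈ concat bs × suc i ∈ concat bs
any-bothIn-true⇒∈ i [] ()
any-bothIn-true⇒∈ i (B ∷ bs) e with bothIn i B in f
... | true with bothIn-true⇒ {i} {B} f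
... | a , b = ∈-++⁺ˡ {ys = concat bs} a , ∈-++⁺ˡ {ys = concat bs} b
any-bothIn-true⇒∈ i (B ∷ bs) e | false with any-bothIn-true⇒∈ i bs e
... | a , b = ∈-++⁺ʳ B a , ∈-++⁺ʳ B b

map-blockAct-absent : ∀ i bs → i ∉ concat bs → map (blockAct i) bs ≡ bs
map-blockAct-absent i [] n = refl
map-blockAct-absent i (B ∷ bs) i∉ = cong₂ _∷_ (blockAct-not-both i B (∉⇒bothIn-false {B = B} (i∉ ∘ ∈-++⁺ˡ {ys = concat bs}))) (map-blockAct-absent i bs (i∉ ∘ ∈-++⁺ʳ B))

map-τ-absent : ∀ i Q → i ∉ Q → suc i ∉ Q → map (τ i) Q ≡ Q
map-τ-absent i Q n1 n2 = map-id-∈ (τ i) Q (λ v m → τ-fixes i v (λ e → n1 (subst (_∈ Q) e m)) (λ e → n2 (subst (_∈ Q) e m)))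

module _ {B i} (II : BlockInvolution B) (u : Uniq B) (mi : i ∈ B) (msi : suc i ∈ B) where
  private
    m = length B
    j = suc (countLT i B)
    j2 : suc j ≤ m
    j2 = subst (_≤ m) (cong suc (countLT-suc i B u mi)) (countLT-∈ (suc i) B msi)
    conj = heckeConj-involution II (s≤s z≤n) j2
    Pconj : InS m (heckeConj (std B) j)
    Pconj = proj₁ (proj₁ conj)

  std-blockStep : std (blockStep B i) ≡ heckeConj (std B) j
  std-blockStep = std-destd B (heckeConj (std B) j) u Pconj

  blockStep-↭ : blockStep B i ↭ B
  blockStep-↭ = destd-↭ B (heckeConj (std B) j) Pconj

  blockStep-involution : BlockInvolution (blockStep B i)
  blockStep-involution = subst₂ IsInvolution (sym (length-blockStep B i)) (sym std-blockStep) (proj₁ conj)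

  blockStep-weight : blockStep B i ≡ B ⊎ blockWeight (blockStep B i) ≡ 2 + blockWeight B
  blockStep-weight with proj₂ conj
  ... | inj₁ e = inj₁ (trans (cong (destd B) e) (destd-std B u))
  ... | inj₂ p = inj₂ (trans (cong₂ invLength₂ (length-blockStep B i) std-blockStep) p)

  invBlockAtom-step : ∀ {Q} → InvBlockAtom B Q → pos i Q < pos (suc i) Q → blockStep B i ≢ B →
                      InvBlockAtom (blockStep B i) (map (τ i) Q)
  invBlockAtom-step {Q} (QB , x , atom , eQ) lt moved =
    ↭-trans (map-τ-↭ i Q uQ miQ msiQ) (↭-trans QB (↭-sym blockStep-↭)) , swapAt x j
    , subst₂ (λ a b → Atom a b (swapAt x j)) (sym (length-blockStep B i)) (sym std-blockStep) (atom-step II atom (s≤s z≤n) j2 x-ascent grows)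
    , std-map-τ-Q
    where
    Px = proj₁ atom
    uQ = uniq-↭ (↭-sym QB) u
    miQ = ∈-resp-↭ (↭-sym QB) mi
    msiQ = ∈-resp-↭ (↭-sym QB) msi
    cQ : countLT i Q ≡ countLT i B
    cQ = countLT-↭ i QB
    grows : invLength₂ m (heckeConj (std B) j) ≡ 2 + invLength₂ m (std B)
    grows with proj₂ conj
    ... | inj₁ e = ⊥-elim (moved (trans (cong (destd B) e) (destd-std B u)))
    ... | inj₂ p = p
    pos-i : pos j (inverse x) ≡ pos i Q
    pos-i = trans (cong (λ t → pos (suc t) (inverse x)) (sym cQ)) (trans (cong (pos (suc (countLT i Q))) (sym eQ)) (pos-std Q i miQ))
    pos-suc-i : pos (suc j) (inverse x) ≡ pos (suc i) Q
    pos-suc-i = trans (cong (λ t → pos (suc t) (inverse x)) (trans (cong suc (sym cQ)) (sym (countLT-suc i Q uQ miQ))))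
                      (trans (cong (pos (suc (countLT (suc i) Q))) (sym eQ)) (pos-std Q (suc i) msiQ))
    x-ascent : at x j < at x (suc j)
    x-ascent = subst₂ _<_ (trans (sym pos-i) (pos-inverse (countLT i B) Px (≤-trans (n≤1+n j) j2)))
                          (trans (sym pos-suc-i) (pos-inverse j Px j2)) lt
    std-map-τ-Q : std (map (τ i) Q) ≡ inverse (swapAt x j)
    std-map-τ-Q = trans (std-map-τ-together i Q uQ miQ msiQ)
                        (trans (cong₂ (λ a b → map (τ (suc a)) b) cQ eQ) (sym (inverse-swapAt j Px (s≤s z≤n) j2)))

map-blockAct-properties : ∀ i bs → Uniq (concat bs) → All BlockInvolution bs → any (bothIn i) bs ≡ true →
                          (map (blockAct i) bs ≡ bs ⊎ totalBlockWeight (map (blockAct i) bs) ≡ 2 + totalBlockWeight bs) ×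
                          Blockwise↭ bs (map (blockAct i) bs) × All BlockInvolution (map (blockAct i) bs)
map-blockAct-properties i (B ∷ bs) u (bi ∷ bis) e with bothIn i B in f
... | true = weight , blockStep-↭ bi uB mi msi ∷ subst (Blockwise↭ bs) (sym rest) (Pointwise-refl ↭-refl)
                    , blockStep-involution bi uB mi msi ∷ subst (All BlockInvolution) (sym rest) bis
  where
  uB = uniq-++ˡ u
  mi = proj₁ (bothIn-true⇒ f)
  msi = proj₂ (bothIn-true⇒ f)
  rest : map (blockAct i) bs ≡ bs
  rest = map-blockAct-absent i bs (uniq-++-disjoint {B} u mi)
  weight : blockStep B i ∷ map (blockAct i) bs ≡ B ∷ bs ⊎ blockWeight (blockStep B i) + totalBlockWeight (map (blockAct i) bs) ≡ 2 + (blockWeight B + totalBlockWeight bs)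
  weight with blockStep-weight bi uB mi msi
  ... | inj₁ same  = inj₁ (cong₂ _∷_ same rest)
  ... | inj₂ grows = inj₂ (trans (cong₂ _+_ grows (cong totalBlockWeight rest)) (+-assoc 2 (blockWeight B) (totalBlockWeight bs)))
... | false with map-blockAct-properties i bs (uniq-++ʳ {B} u) bis e
...   | weight , pw , bis′ = Sum.map (cong (B ∷_)) (λ grows → trans (cong (blockWeight B +_) grows) (+-left-comm (blockWeight B) 2 _)) weight
                           , ↭-refl ∷ pw , bi ∷ bis′

invBlockAtoms⇒Blockwise↭ : ∀ {bs Qs} → Pointwise InvBlockAtom bs Qs → Blockwise↭ bs Qs
invBlockAtoms⇒Blockwise↭ [] = []
invBlockAtoms⇒Blockwise↭ (a ∷ as) = proj₁ a ∷ invBlockAtoms⇒Blockwise↭ as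

map-map-τ-absent : ∀ i Qs → i ∉ concat Qs → suc i ∉ concat Qs → map (map (τ i)) Qs ≡ Qs
map-map-τ-absent i [] n1 n2 = refl
map-map-τ-absent i (Q ∷ Qs) n1 n2 =
  cong₂ _∷_ (map-τ-absent i Q (λ m → n1 (∈-++⁺ˡ m)) (λ m → n2 (∈-++⁺ˡ m)))
            (map-map-τ-absent i Qs (λ m → n1 (∈-++⁺ʳ Q m)) (λ m → n2 (∈-++⁺ʳ Q m)))

uniq-++-disjoint′ : ∀ {B C : List ℕ} {v} → Uniq (B ++ C) → v ∈ C → v ∉ B
uniq-++-disjoint′ {B} u mc mb = uniq-++-disjoint {B} u mb mc

map-blockAct-invBlockAtoms : ∀ i bs Qs → Pointwise InvBlockAtom bs Qs → All BlockInvolution bs → Uniq (concat bs) → any (bothIn i) bs ≡ true →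
         map (blockAct i) bs ≢ bs → pos i (concat Qs) < pos (suc i) (concat Qs) →
         Pointwise InvBlockAtom (map (blockAct i) bs) (map (map (τ i)) Qs)
map-blockAct-invBlockAtoms i [] [] [] [] u () ne lt
map-blockAct-invBlockAtoms i (B ∷ bs) (Q ∷ Qs) (ab ∷ abs) (bi ∷ bis) u e ne lt with bothIn i B in f
... | true with bothIn-true⇒ {i} {B} f
... | mi , msi = subst₂ (λ X Y → Pointwise InvBlockAtom (blockStep B i ∷ X) (map (τ i) Q ∷ Y)) (sym r1) (sym r2)
                   (invBlockAtom-step bi (uniq-++ˡ u) mi msi ab lt' ne' ∷ abs)
  where
  QB = proj₁ ab
  ni : i ∉ concat bs
  ni = uniq-++-disjoint {B} u mi
  nsi : suc i ∉ concat bs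
  nsi = uniq-++-disjoint {B} u msi
  r1 : map (blockAct i) bs ≡ bs
  r1 = map-blockAct-absent i bs ni
  cp = concat-↭ (invBlockAtoms⇒Blockwise↭ abs)
  r2 : map (map (τ i)) Qs ≡ Qs
  r2 = map-map-τ-absent i Qs (λ m → ni (∈-resp-↭ cp m)) (λ m → nsi (∈-resp-↭ cp m))
  ne' : blockStep B i ≢ B
  ne' e2 = ne (cong₂ _∷_ e2 r1)
  miQ = ∈-resp-↭ (↭-sym QB) mi
  msiQ = ∈-resp-↭ (↭-sym QB) msi
  lt' : pos i Q < pos (suc i) Q
  lt' = subst₂ _<_ (pos-++ˡ Q (concat Qs) miQ) (pos-++ˡ Q (concat Qs) msiQ) lt
map-blockAct-invBlockAtoms i (B ∷ bs) (Q ∷ Qs) (ab ∷ abs) (bi ∷ bis) u e ne lt | false with any-bothIn-true⇒∈ i bs e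
... | mi , msi = subst (λ X → Pointwise InvBlockAtom (B ∷ map (blockAct i) bs) (X ∷ map (map (τ i)) Qs)) (sym r0)
                   (ab ∷ map-blockAct-invBlockAtoms i bs Qs abs bis (uniq-++ʳ {B} u) e (λ e2 → ne (cong (B ∷_) e2)) lt')
  where
  QB = proj₁ ab
  nB : i ∉ B
  nB = uniq-++-disjoint′ {B} u mi
  nsB : suc i ∉ B
  nsB = uniq-++-disjoint′ {B} u msi
  nQ : i ∉ Q
  nQ m = nB (∈-resp-↭ QB m)
  nsQ : suc i ∉ Q
  nsQ m = nsB (∈-resp-↭ QB m)
  r0 : map (τ i) Q ≡ Q
  r0 = map-τ-absent i Q nQ nsQ
  cp = concat-↭ (invBlockAtoms⇒Blockwise↭ abs)
  lt' : pos i (concat Qs) < pos (suc i) (concat Qs)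
  lt' = +-cancelˡ-< (length Q) _ _ (subst₂ _<_ (pos-++ʳ Q (concat Qs) nQ (∈-resp-↭ (↭-sym cp) mi)) (pos-++ʳ Q (concat Qs) nsQ (∈-resp-↭ (↭-sym cp) msi)) lt)

map-τ-invBlockAtoms : ∀ i bs Qs → Pointwise InvBlockAtom bs Qs → Apart i (suc i) bs →
          Pointwise InvBlockAtom (map (map (τ i)) bs) (map (map (τ i)) Qs)
map-τ-invBlockAtoms i [] [] [] [] = []
map-τ-invBlockAtoms i (B ∷ bs) (Q ∷ Qs) ((QB , ia) ∷ abs) (d ∷ ds) =
  (map⁺ (τ i) QB , subst₂ (λ a b → InvAtom a b (std (map (τ i) Q))) (sym (length-map (τ i) B)) (sym (std-map-τ-apart i B d))
                      (subst (InvAtom (length B) (std B)) (sym (std-map-τ-apart i Q dQ)) ia))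
  ∷ map-τ-invBlockAtoms i bs Qs abs ds
  where
  dQ : ¬ (i ∈ Q × suc i ∈ Q)
  dQ (a , b) = d (∈-resp-↭ QB a , ∈-resp-↭ QB b)

totalBlockWeight-map-τ : ∀ i bs → Apart i (suc i) bs → totalBlockWeight (map (map (τ i)) bs) ≡ totalBlockWeight bs
totalBlockWeight-map-τ i []       []       = refl
totalBlockWeight-map-τ i (B ∷ bs) (d ∷ ds) = cong₂ _+_ (cong₂ invLength₂ (length-map (τ i) B) (std-map-τ-apart i B d)) (totalBlockWeight-map-τ i bs ds)

blockInvolutions-map-τ : ∀ i bs → Apart i (suc i) bs → All BlockInvolution bs → All BlockInvolution (map (map (τ i)) bs)
blockInvolutions-map-τ i []       []       []       = []
blockInvolutions-map-τ i (B ∷ bs) (d ∷ ds) (b ∷ bi) = subst₂ IsInvolution (sym (length-map (τ i) B)) (sym (std-map-τ-apart i B d)) b ∷ blockInvolutions-map-τ i bs ds bi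

take-consecutive : ∀ m N s → take m (consecutive N s) ≡ consecutive (m ⊓ N) s
take-consecutive zero N s = refl
take-consecutive (suc m) zero s = refl
take-consecutive (suc m) (suc N) s = cong (s ∷_) (take-consecutive m N (suc s))

drop-consecutive : ∀ m N s → drop m (consecutive N s) ≡ consecutive (N ∸ m) (m + s)
drop-consecutive zero N s = refl
drop-consecutive (suc m) zero s = refl
drop-consecutive (suc m) (suc N) s = trans (drop-consecutive m N (suc s)) (cong (consecutive (N ∸ m)) (+-suc m s))

IsConsecutive : List ℕ → Set
IsConsecutive B = Σ ℕ λ k → Σ ℕ λ s → B ≡ consecutive k s

blocks-consecutive : ∀ μ N s → All IsConsecutive (blocks μ (consecutive N s))
blocks-consecutive [] N s = []
blocks-consecutive (m ∷ μ) N s = (m ⊓ N , s , take-consecutive m N s) ∷ subst (λ t → All IsConsecutive (blocks μ t)) (sym (drop-consecutive m N s)) (blocks-consecutive μ (N ∸ m) (m + s))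

len-consecutive : ∀ k s → len (consecutive k s) ≡ 0
len-consecutive zero s = refl
len-consecutive (suc k) s = cong₂ _+_ (countLT-minimum s (consecutive k (suc s)) (λ v m → <⇒≤ (proj₁ (∈-consecutive⁻ {k} {suc s} m)))) (len-consecutive k (suc s))

std-consecutive : ∀ k s → std (consecutive k s) ≡ iden k
std-consecutive k s = at-ext _ _ (trans (length-std (consecutive k s)) (trans (length-consecutive k s) (sym (length-iden k)))) h
  where
  h : ∀ q → q < length (iden k) → at (std (consecutive k s)) (suc q) ≡ at (iden k) (suc q)
  h q lt0 with subst (q <_) (length-iden k) lt0
  ... | lt = trans (at-map (λ x → suc (countLT x (consecutive k s))) (consecutive k s) q (subst (q <_) (sym (length-consecutive k s)) lt))
               (trans (cong (λ t → suc (countLT t (consecutive k s))) (at-consecutive k s q lt))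
               (trans (cong suc (trans (countLT-consecutive k s (s + q) (m≤m+n s q) (+-monoʳ-≤ s (<⇒≤ lt))) (m+n∸m≡n s q)))
                   (sym (at-iden k q lt))))

iden-involution : ∀ k → IsInvolution k (iden k)
iden-involution k = at-at⇒involution ↭-refl h
  where
  h : ∀ p → 1 ≤ p → p ≤ k → at (iden k) (at (iden k) p) ≡ p
  h (suc q) c d = trans (cong (at (iden k)) (at-iden k q d)) (at-iden k q d)

countTrue-all : ∀ f L → (∀ k → k ∈ L → f k ≡ true) → countTrue f L ≡ length L
countTrue-all f [] h = refl
countTrue-all f (x ∷ L) h rewrite h x (here refl) = cong suc (countTrue-all f L (λ k m → h k (there m)))

cycCount-iden : ∀ k → cycCount (iden k) ≡ k
cycCount-iden k = trans (cycCount≡countTrue (iden k) ↭-refl) (trans (countTrue-all _ (iden k) h) (length-iden k))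
  where
  h : ∀ p → p ∈ iden k → (p ≤ᵇ at (iden k) p) ≡ true
  h p m with ∈-iden⁻ {k} m
  ... | c , d with pred-of p c
  ... | q , refl = ≤⇒≤ᵇ≡true (≤-reflexive (sym (at-iden k q d)))

len-iden : ∀ k → len (iden k) ≡ 0
len-iden k = trans (cong len (iden≡consecutive k)) (len-consecutive k 1)

inverse-iden : ∀ k → inverse (iden k) ≡ iden k
inverse-iden k = proj₂ (iden-involution k)

invLength₂-iden : ∀ k → invLength₂ k (iden k) ≡ 0
invLength₂-iden k = trans (cong₂ (λ a c → a + k ∸ c) (len-iden k) (cycCount-iden k)) (n∸n≡0 k)

atom-iden : ∀ k → Atom k (iden k) (iden k)
atom-iden k = ↭-refl , ([] , ([] , sym (len-iden k) , refl) , inverse-iden k) ,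
              trans (cong (2 *_) (len-iden k)) (sym (invLength₂-iden k))

consecutive-block : ∀ B → IsConsecutive B → InvBlockAtom B B × BlockInvolution B × blockWeight B ≡ 0
consecutive-block B (k , s , e) rewrite e =
  (↭-refl , iden L , subst (λ t → Atom L t (iden L)) (sym sk) (atom-iden L) , trans sk (sym (inverse-iden L)))
  , subst (IsInvolution L) (sym sk) (iden-involution L)
  , trans (cong (invLength₂ L) sk) (invLength₂-iden L)
  where
  L = length (consecutive k s)
  sk : std (consecutive k s) ≡ iden L
  sk = trans (std-consecutive k s) (cong iden (sym (length-consecutive k s)))

foldl-swapAt-InS : ∀ {m} u c → InS m u → InS m (foldl swapAt u c)
foldl-swapAt-InS u []      P = P
foldl-swapAt-InS u (r ∷ c) P = foldl-swapAt-InS (swapAt u r) c (swapAt-InS r P)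

wordPerm : ℕ → List ℕ → List ℕ
wordPerm m a = foldl swapAt (iden m) a

wordPerm-InS : ∀ m a → InS m (wordPerm m a)
wordPerm-InS m a = foldl-swapAt-InS (iden m) a ↭-refl

wordPerm-snoc : ∀ m a i → wordPerm m (a ++ [ i ]) ≡ swapAt (wordPerm m a) i
wordPerm-snoc m a i = foldl-++ swapAt (iden m) a [ i ]

len-wordPerm-≤ : ∀ m a → len (wordPerm m a) ≤ length a
len-wordPerm-≤ m a = ≤-trans (len-foldl-swapAt-≤ (iden m) a) (≤-reflexive (cong (_+ length a) (len-iden m)))

reduced-word-ascent : ∀ m pre i rest → length (pre ++ i ∷ rest) ≡ len (wordPerm m (pre ++ i ∷ rest)) →
                      at (wordPerm m pre) i < at (wordPerm m pre) (suc i)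
reduced-word-ascent m pre i rest reduced with at (wordPerm m pre) i <? at (wordPerm m pre) (suc i)
... | yes asc = asc
... | no ¬asc = ⊥-elim (<-irrefl (sym reduced) shorter)
  where
  open ≤-Reasoning
  shorter : len (wordPerm m (pre ++ i ∷ rest)) < length (pre ++ i ∷ rest)
  shorter = begin-strict
    len (wordPerm m (pre ++ i ∷ rest))                   ≡⟨ cong len (foldl-++ swapAt (iden m) pre (i ∷ rest)) ⟩
    len (foldl swapAt (swapAt (wordPerm m pre) i) rest)  ≤⟨ len-foldl-swapAt-≤ _ rest ⟩
    len (swapAt (wordPerm m pre) i) + length rest        ≤⟨ +-monoˡ-≤ _ (≤-trans (len-swapAt-no-ascent (wordPerm m pre) i ¬asc) (len-wordPerm-≤ m pre)) ⟩
    length pre + length rest                             <⟨ +-monoʳ-< (length pre) (n<1+n _) ⟩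
    length pre + length (i ∷ rest)                       ≡⟨ length-++ pre ⟨
    length (pre ++ i ∷ rest)                             ∎

increasing-positions⇒iden : ∀ n z → InS n z → (∀ i → 1 ≤ i → i < n → pos i z < pos (suc i) z) → z ≡ iden n
increasing-positions⇒iden n z P h = at-ext z (iden n) (trans lz (sym (length-iden n))) g
  where
  lz = InS-length P
  lo : ∀ k → 1 ≤ k → k ≤ n → k ≤ pos k z
  lo (suc zero) _ d = proj₁ (pos-∈-range (InS-∈⁺ P (s≤s z≤n) d))
  lo (suc (suc k)) _ d = ≤-trans (s≤s (lo (suc k) (s≤s z≤n) (<⇒≤ d))) (h (suc k) (s≤s z≤n) d)
  hi : ∀ d k → k + d ≡ n → 1 ≤ k → pos k z ≤ k
  hi zero k e c = ≤-trans (proj₂ (pos-∈-range (InS-∈⁺ P c (≤-reflexive (trans (sym (+-identityʳ k)) e))))) (≤-reflexive (trans lz (trans (sym e) (+-identityʳ k))))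
  hi (suc d) k e c = s≤s⁻¹ (≤-trans (h k c kn) (hi d (suc k) (trans (sym (+-suc k d)) e) (s≤s z≤n)))
    where
    kn : k < n
    kn = ≤-trans (s≤s (m≤m+n k d)) (≤-reflexive (trans (sym (+-suc k d)) e))
  g : ∀ q → q < length (iden n) → at z (suc q) ≡ at (iden n) (suc q)
  g q lt0 with subst (q <_) (length-iden n) lt0
  ... | lt = trans (cong (at z) (sym pk)) (trans (pos-at (InS-∈⁺ P (s≤s z≤n) lt)) (sym (at-iden n q lt)))
    where
    pk : pos (suc q) z ≡ suc q
    pk = ≤-antisym (hi (n ∸ suc q) (suc q) (m+[n∸m]≡n lt) (s≤s z≤n)) (lo (suc q) (s≤s z≤n) lt)

swapAt-involutive : ∀ w r → 1 ≤ r → suc r ≤ length w → swapAt (swapAt w r) r ≡ w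
swapAt-involutive w r c d = at-ext _ _ (trans (length-swapAt (swapAt w r) r) (length-swapAt w r)) h
  where
  h : ∀ q → q < length w → at (swapAt (swapAt w r) r) (suc q) ≡ at w (suc q)
  h q lt with τ-range r (suc q) (length w) c d (s≤s z≤n) lt
  ... | c2 , d2 = trans (at-swapAt (swapAt w r) r q c (subst (suc r ≤_) (sym (length-swapAt w r)) d) (subst (q <_) (sym (length-swapAt w r)) lt))
                 (trans (at-swapAt′ w r (τ r (suc q)) c d c2 d2) (cong (at w) (τ-involutive r (suc q))))

heckeConjWord : ℕ → List ℕ → List ℕ
heckeConjWord m c = foldl heckeConj (iden m) c

HeckeSquare : ℕ → List ℕ → Set
HeckeSquare m c = foldl heckeR (inverse (wordPerm m c)) c ≡ heckeConjWord m c ×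
                  IsInvolution m (heckeConjWord m c) × invLength₂ m (heckeConjWord m c) ≤ 2 * length c

-- foldl heckeR (inverse X) c is the 0-Hecke product X⁻¹ ∘ X for a reduced word c of X.
module _ {m} (c : List ℕ) (lc : Letters m c) (reduced : length c ≡ len (wordPerm m c)) where

  heckeSquare-along : ∀ pre rest → pre ++ rest ≡ c → HeckeSquare m pre → Letters m rest → HeckeSquare m c
  heckeSquare-along pre []         e sq _ = subst (HeckeSquare m) (trans (sym (++-identityʳ pre)) e) sq
  heckeSquare-along pre (j ∷ rest) e (hecke , inv , bound) ((j1 , j2) ∷ ls) =
    heckeSquare-along (pre ++ [ j ]) rest (trans (++-assoc pre [ j ] rest) e) (hecke′ , inv′ , bound′) ls
    where
    asc : at (wordPerm m pre) j < at (wordPerm m pre) (suc j)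
    asc = reduced-word-ascent m pre j rest (trans (cong length e) (trans reduced (cong (len ∘ wordPerm m) (sym e))))
    conj-snoc : heckeConjWord m (pre ++ [ j ]) ≡ heckeConj (heckeConjWord m pre) j
    conj-snoc = foldl-++ heckeConj (iden m) pre [ j ]
    hecke′ : foldl heckeR (inverse (wordPerm m (pre ++ [ j ]))) (pre ++ [ j ]) ≡ heckeConjWord m (pre ++ [ j ])
    hecke′ = begin
      foldl heckeR (inverse (wordPerm m (pre ++ [ j ]))) (pre ++ [ j ])  ≡⟨ cong (λ t → foldl heckeR (inverse t) (pre ++ [ j ])) (wordPerm-snoc m pre j) ⟩
      foldl heckeR (inverse (swapAt (wordPerm m pre) j)) (pre ++ [ j ])  ≡⟨ inverse-hecke-snoc pre j (wordPerm-InS m pre) (All++⁻ˡ pre (subst (Letters m) (sym e) lc)) j1 j2 asc ⟩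
      heckeConj (foldl heckeR (inverse (wordPerm m pre)) pre) j          ≡⟨ cong (λ t → heckeConj t j) hecke ⟩
      heckeConj (heckeConjWord m pre) j                                  ≡⟨ conj-snoc ⟨
      heckeConjWord m (pre ++ [ j ])                                     ∎
      where open ≡-Reasoning
    step = heckeConj-involution inv j1 j2
    inv′ : IsInvolution m (heckeConjWord m (pre ++ [ j ]))
    inv′ = subst (IsInvolution m) (sym conj-snoc) (proj₁ step)
    bound-step : invLength₂ m (heckeConj (heckeConjWord m pre) j) ≤ 2 * suc (length pre)
    bound-step with proj₂ step
    ... | inj₁ same  = ≤-trans (≤-reflexive (cong (invLength₂ m) same)) (≤-trans bound (*-monoʳ-≤ 2 (n≤1+n _)))
    ... | inj₂ grows = ≤-trans (≤-reflexive grows) (≤-trans (+-monoʳ-≤ 2 bound) (≤-reflexive (sym (*-suc 2 (length pre)))))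
    bound′ : invLength₂ m (heckeConjWord m (pre ++ [ j ])) ≤ 2 * length (pre ++ [ j ])
    bound′ = subst₂ _≤_ (cong (invLength₂ m) (sym conj-snoc)) (cong (2 *_) (sym (trans (length-++ pre) (+-comm (length pre) 1)))) bound-step

  reduced-heckeSquare : HeckeSquare m c
  reduced-heckeSquare = heckeSquare-along [] c refl (inverse-iden m , iden-involution m , ≤-reflexive (invLength₂-iden m)) lc

record AtomPeel (m : ℕ) (y x c : List ℕ) (j : ℕ) : Set where
  field
    j≥1    : 1 ≤ j
    j<m    : suc j ≤ m
    ascent : at (wordPerm m c) j < at (wordPerm m c) (suc j)
    x≡     : x ≡ swapAt (wordPerm m c) j
    involution : IsInvolution m (heckeConjWord m c)
    atom   : Atom m (heckeConjWord m c) (wordPerm m c)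
    conj≡  : heckeConj (heckeConjWord m c) j ≡ y
    moved  : heckeConjWord m c ≢ y

-- The converse of atom-step.
atom-peel : ∀ {m y x} c j → Letters m (c ++ [ j ]) → length (c ++ [ j ]) ≡ len x → wordPerm m (c ++ [ j ]) ≡ x →
            foldl heckeR (inverse x) (c ++ [ j ]) ≡ y → 2 * len x ≡ len y + m ∸ cycCount y → AtomPeel m y x c j
atom-peel {m} {y} {x} c j lc lenc fc hc ax = record
  { j≥1 = j1 ; j<m = j2 ; ascent = asc ; x≡ = x≡ ; involution = proj₁ (proj₂ sq) ; atom = atom ; conj≡ = conj≡ ; moved = moved }
  where
  lc′ = proj₁ (∷ʳ⁻ lc)
  j1 = proj₁ (proj₂ (∷ʳ⁻ lc))
  j2 = proj₂ (proj₂ (∷ʳ⁻ lc))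
  X′ = wordPerm m c
  PX′ = wordPerm-InS m c
  x≡ : x ≡ swapAt X′ j
  x≡ = trans (sym fc) (wordPerm-snoc m c j)
  asc : at X′ j < at X′ (suc j)
  asc = reduced-word-ascent m c j [] (trans lenc (cong len (sym fc)))
  len-x : len x ≡ suc (length c)
  len-x = trans (sym lenc) (trans (length-++ c) (+-comm (length c) 1))
  len-X′ : length c ≡ len X′
  len-X′ = suc-injective (trans (sym len-x) (trans (cong len x≡) (len-swapAt-ascent X′ j j1 (subst (suc j ≤_) (sym (InS-length PX′)) j2) asc)))
  sq = reduced-heckeSquare c lc′ len-X′
  y′ = heckeConjWord m c
  conj≡ : heckeConj y′ j ≡ y
  conj≡ = sym (trans (sym hc) (trans (cong (λ t → foldl heckeR (inverse t) (c ++ [ j ])) x≡)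
                      (trans (inverse-hecke-snoc c j PX′ lc′ j1 j2 asc) (cong (λ t → heckeConj t j) (proj₁ sq)))))
  invLength-y : invLength₂ m y ≡ 2 + 2 * length c
  invLength-y = trans (sym ax) (trans (cong (2 *_) len-x) (*-suc 2 (length c)))
  invLength-y′ : invLength₂ m y′ ≡ 2 * len X′
  invLength-y′ with proj₂ (heckeConj-involution (proj₁ (proj₂ sq)) j1 j2)
  ... | inj₁ same  = ⊥-elim (<-irrefl refl (≤-trans (n≤1+n _) (≤-trans (≤-reflexive (sym (trans (cong (invLength₂ m) (trans (sym same) conj≡)) invLength-y))) (proj₂ (proj₂ sq)))))
  ... | inj₂ grows = trans (+-cancelˡ-≡ 2 _ _ (trans (sym grows) (trans (cong (invLength₂ m) conj≡) invLength-y))) (cong (2 *_) len-X′)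
  atom : Atom m y′ X′
  atom = PX′ , (c , (lc′ , len-X′ , refl) , proj₁ sq) , sym invLength-y′
  moved : y′ ≢ y
  moved e = <-irrefl (trans (sym invLength-y′) (trans (cong (invLength₂ m) e) (trans invLength-y (cong (λ t → 2 + 2 * t) len-X′))))
                     (m<n+m (2 * len X′) {2} (s≤s z≤n))

record BlockPeel (B Q : List ℕ) (i : ℕ) : Set where
  field
    B′         : List ℕ
    invAtom    : InvBlockAtom B′ (map (τ i) Q)
    involution : BlockInvolution B′
    B′↭B       : B′ ↭ B
    act≡       : blockAct i B′ ≡ B
    moved      : B′ ≢ B
    ordered    : pos i (map (τ i) Q) < pos (suc i) (map (τ i) Q)
    i∈B        : i ∈ B
    suc-i∈B    : suc i ∈ B

-- The values of Q are s, s+1, …, so the letter j of std B is the value i = s + j - 1.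
peel-block : ∀ B Q → Q ↭ B → Uniq B → ∀ s → isort Q ≡ consecutive (length B) s → ∀ x c j →
             Letters (length B) (c ++ [ j ]) → length (c ++ [ j ]) ≡ len x → wordPerm (length B) (c ++ [ j ]) ≡ x →
             foldl heckeR (inverse x) (c ++ [ j ]) ≡ std B → 2 * len x ≡ len (std B) + length B ∸ cycCount (std B) →
             std Q ≡ inverse x → Σ ℕ (BlockPeel B Q)
peel-block B Q QB u s sorted x c j lc lenc fc hc ax eQ = i , record
  { B′ = B′ ; invAtom = invAtom ; involution = subst₂ IsInvolution (sym length-B′) (sym std-B′) (AtomPeel.involution peeled)
  ; B′↭B = B′↭B ; act≡ = act≡ ; moved = λ e → AtomPeel.moved peeled (trans (sym std-B′) (cong std e))
  ; ordered = ordered ; i∈B = ∈-resp-↭ QB i∈Q ; suc-i∈B = ∈-resp-↭ QB suc-i∈Q }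
  where
  m = length B
  peeled = atom-peel c j lc lenc fc hc ax
  open AtomPeel peeled using (j≥1; j<m; ascent; x≡)
  j₀ = proj₁ (pred-of j j≥1)
  j≡ : j ≡ suc j₀
  j≡ = proj₂ (pred-of j j≥1)
  j₀<m : j₀ < m
  j₀<m = subst (_≤ m) j≡ (<⇒≤ j<m)
  i = s + j₀
  X′ = wordPerm m c
  y′ = heckeConjWord m c
  Py′ = proj₁ (AtomPeel.involution peeled)
  Px : InS m x
  Px = subst (InS m) (sym x≡) (swapAt-InS j (wordPerm-InS m c))
  j+1≤len : suc j ≤ length X′
  j+1≤len = subst (suc j ≤_) (sym (InS-length (wordPerm-InS m c))) j<m
  uQ = uniq-↭ (↭-sym QB) u
  i∈Q : i ∈ Q
  i∈Q = ∈-resp-↭ (isort↭ Q) (subst (i ∈_) (sym sorted) (∈-consecutive⁺ (m≤m+n s j₀) (+-monoʳ-< s j₀<m)))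
  suc-i∈Q : suc i ∈ Q
  suc-i∈Q = ∈-resp-↭ (isort↭ Q) (subst (suc i ∈_) (sym sorted)
              (∈-consecutive⁺ (≤-trans (m≤m+n s j₀) (n≤1+n _)) (subst (_≤ s + m) (trans (+-suc s (suc j₀)) (cong suc (+-suc s j₀))) (+-monoʳ-≤ s (subst (λ t → suc t ≤ m) j≡ j<m)))))
  rank-i : suc (countLT i Q) ≡ j
  rank-i = trans (cong suc (trans (countLT-↭ i (↭-sym (isort↭ Q))) (trans (cong (countLT i) sorted)
                  (trans (countLT-consecutive m s i (m≤m+n s j₀) (+-monoʳ-≤ s (<⇒≤ j₀<m))) (m+n∸m≡n s j₀)))))
                 (sym j≡)
  pos-in-Q : ∀ {v} → v ∈ Q → pos v Q ≡ at x (suc (countLT v Q))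
  pos-in-Q {v} v∈Q = trans (sym (pos-std Q v v∈Q)) (trans (cong (pos (suc (countLT v Q))) eQ)
                       (pos-inverse′ Px (s≤s z≤n) (subst (suc (countLT v Q) ≤_) (↭-length QB) (countLT-∈ v Q v∈Q))))
  B′ = destd B y′
  std-B′ : std B′ ≡ y′
  std-B′ = std-destd B y′ u Py′
  length-B′ : length B′ ≡ m
  length-B′ = trans (length-destd B y′) (InS-length Py′)
  B′↭B : B′ ↭ B
  B′↭B = destd-↭ B y′ Py′
  std-map-τ-Q : std (map (τ i) Q) ≡ inverse X′
  std-map-τ-Q = begin
    std (map (τ i) Q)                      ≡⟨ std-map-τ-together i Q uQ i∈Q suc-i∈Q ⟩
    map (τ (suc (countLT i Q))) (std Q)    ≡⟨ cong₂ (λ a b → map (τ a) b) rank-i (trans eQ (cong inverse x≡)) ⟩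
    swapVal j (inverse (swapAt X′ j))      ≡⟨ inverse-swapAt j (swapAt-InS j (wordPerm-InS m c)) j≥1 j<m ⟨
    inverse (swapAt (swapAt X′ j) j)       ≡⟨ cong inverse (swapAt-involutive X′ j j≥1 j+1≤len) ⟩
    inverse X′                             ∎
    where open ≡-Reasoning
  invAtom : InvBlockAtom B′ (map (τ i) Q)
  invAtom = ↭-trans (map-τ-↭ i Q uQ i∈Q suc-i∈Q) (↭-trans QB (↭-sym B′↭B))
          , X′ , subst₂ (λ a b → Atom a b X′) (sym length-B′) (sym std-B′) (AtomPeel.atom peeled)
          , std-map-τ-Q
  act≡ : blockAct i B′ ≡ B
  act≡ = begin
    blockAct i B′                                              ≡⟨ blockAct-both i B′ (bothIn-true (∈-resp-↭ (↭-sym B′↭B) (∈-resp-↭ QB i∈Q))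
                                                                                                  (∈-resp-↭ (↭-sym B′↭B) (∈-resp-↭ QB suc-i∈Q))) ⟩
    map (at (isort B′)) (heckeConj (std B′) (suc (countLT i B′)))
                                                               ≡⟨ cong₂ (λ a b → map (at a) (heckeConj b (suc (countLT i B′)))) (isort-↭ B′↭B) std-B′ ⟩
    destd B (heckeConj y′ (suc (countLT i B′)))                ≡⟨ cong (λ t → destd B (heckeConj y′ (suc t))) (trans (countLT-↭ i B′↭B) (sym (countLT-↭ i QB))) ⟩
    destd B (heckeConj y′ (suc (countLT i Q)))                 ≡⟨ cong (λ t → destd B (heckeConj y′ t)) rank-i ⟩
    destd B (heckeConj y′ j)                                   ≡⟨ cong (destd B) (AtomPeel.conj≡ peeled) ⟩
    destd B (std B)                                            ≡⟨ destd-std B u ⟩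
    B                                                          ∎
    where open ≡-Reasoning
  ordered : pos i (map (τ i) Q) < pos (suc i) (map (τ i) Q)
  ordered = subst₂ _<_ (sym (trans (pos-map-τ i i Q) (cong (λ t → pos t Q) (τ-self i))))
                       (sym (trans (pos-map-τ i (suc i) Q) (cong (λ t → pos t Q) (τ-suc i))))
                       (subst₂ _<_ (sym pos-suc-i) (sym pos-i) ascent)
    where
    pos-i : pos i Q ≡ at X′ (suc j)
    pos-i = trans (pos-in-Q i∈Q) (trans (cong (at x) rank-i) (trans (cong (λ t → at t j) x≡)
                  (trans (at-swapAt′ X′ j j j≥1 j+1≤len j≥1 (<⇒≤ j+1≤len)) (cong (at X′) (τ-self j)))))
    pos-suc-i : pos (suc i) Q ≡ at X′ j
    pos-suc-i = trans (pos-in-Q suc-i∈Q) (trans (cong (λ t → at x (suc t)) (trans (countLT-suc i Q uQ i∈Q) rank-i)) (trans (cong (λ t → at t (suc j)) x≡)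
                      (trans (at-swapAt′ X′ j (suc j) j≥1 j+1≤len (s≤s z≤n) j+1≤len) (cong (at X′) (τ-suc j)))))

search : (P : ℕ → Set) → (∀ i → Dec (P i)) → ∀ k → (Σ ℕ λ i → 1 ≤ i × i < k × P i) ⊎ (∀ i → 1 ≤ i → i < k → ¬ P i)
search P d zero = inj₂ (λ i _ ())
search P d (suc k) with search P d k
... | inj₁ (i , a , b , c) = inj₁ (i , a , ≤-trans b (n≤1+n k) , c)
... | inj₂ h with k ≟ 0
... | yes refl = inj₂ (λ i a b → ⊥-elim (<-irrefl refl (≤-trans b a)))
... | no nz with d k
... | yes p = inj₁ (k , ≤∧≢⇒< z≤n (λ e → nz (sym e)) , n<1+n k , p)
... | no np = inj₂ h2
  where
  h2 : ∀ i → 1 ≤ i → i < suc k → ¬ P i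
  h2 i a b with i ≟ k
  ... | yes refl = np
  ... | no ne = h i a (≤∧≢⇒< (s≤s⁻¹ b) ne)

Apart-sym : ∀ {x y} bs → Apart x y bs → Apart y x bs
Apart-sym [] [] = []
Apart-sym (B ∷ bs) (d ∷ ds) = (λ (a , b) → d (b , a)) ∷ Apart-sym bs ds

Apart⇒any-bothIn-false : ∀ i bs → Apart i (suc i) bs → any (bothIn i) bs ≡ false
Apart⇒any-bothIn-false i [] [] = refl
Apart⇒any-bothIn-false i (B ∷ bs) (d ∷ ds) with bothIn i B in e
... | true = ⊥-elim (d (bothIn-true⇒ {i} {B} e))
... | false = Apart⇒any-bothIn-false i bs ds

Apart-map-τ : ∀ i bs → Apart i (suc i) bs → Apart i (suc i) (map (map (τ i)) bs)
Apart-map-τ i [] [] = []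
Apart-map-τ i (B ∷ bs) (d ∷ ds) = h ∷ Apart-map-τ i bs ds
  where
  back1 : ∀ {w} → w ∈ map (τ i) B → τ i w ∈ B
  back1 m with ∈-map⁻ (τ i) m
  ... | v , mv , e = subst (_∈ B) (trans (sym (τ-involutive i v)) (cong (τ i) (sym e))) mv
  h : ¬ (i ∈ map (τ i) B × suc i ∈ map (τ i) B)
  h (a , b) = d (subst (_∈ B) (τ-suc i) (back1 b) , subst (_∈ B) (τ-self i) (back1 a))

Together : ℕ → ℕ → List (List ℕ) → Set
Together x y cs = All (λ C → (x ∈ C → y ∈ C) × (y ∈ C → x ∈ C)) cs

any-bothIn-true⇒Together : ∀ i bs → Uniq (concat bs) → any (bothIn i) bs ≡ true → Together i (suc i) bs
any-bothIn-true⇒Together i [] u ()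
any-bothIn-true⇒Together i (B ∷ bs) u e with bothIn i B in f
... | true = ((λ _ → proj₂ b) , (λ _ → proj₁ b)) ∷ none bs (uniq-++-disjoint {B} u (proj₁ b)) (uniq-++-disjoint {B} u (proj₂ b))
  where
  b = bothIn-true⇒ {i} {B} f
  none : ∀ cs → i ∉ concat cs → suc i ∉ concat cs → Together i (suc i) cs
  none [] _ _ = []
  none (C ∷ cs) n1 n2 = ((λ m → ⊥-elim (n1 (∈-++⁺ˡ m))) , (λ m → ⊥-elim (n2 (∈-++⁺ˡ m)))) ∷ none cs (λ m → n1 (∈-++⁺ʳ C m)) (λ m → n2 (∈-++⁺ʳ C m))
... | false with any-bothIn-true⇒∈ i bs e
... | mi , msi = ((λ m → ⊥-elim (uniq-++-disjoint {B} u m mi)) , (λ m → ⊥-elim (uniq-++-disjoint {B} u m msi))) ∷ any-bothIn-true⇒Together i bs (uniq-++ʳ {B} u) e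

Together-↭ : ∀ {x y bs Qs} → Blockwise↭ bs Qs → Together x y bs → Together x y Qs
Together-↭ [] [] = []
Together-↭ (p ∷ ps) ((f , g) ∷ ss) = ((λ m → ∈-resp-↭ (↭-sym p) (f (∈-resp-↭ p m))) , (λ m → ∈-resp-↭ (↭-sym p) (g (∈-resp-↭ p m)))) ∷ Together-↭ ps ss

Together-∈ : ∀ {x y} cs → Together x y cs → x ∈ concat cs → y ∈ concat cs
Together-∈ (C ∷ cs) ((f , g) ∷ ss) m with ∈-++⁻ C m
... | inj₁ a = ∈-++⁺ˡ (f a)
... | inj₂ b = ∈-++⁺ʳ C (Together-∈ cs ss b)

Together-pos-< : ∀ x y cs → Together x y cs → All (λ C → x ∈ C → y ∈ C → pos x C < pos y C) cs → x ∈ concat cs → pos x (concat cs) < pos y (concat cs)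
Together-pos-< x y (C ∷ cs) ((f , g) ∷ ss) (h ∷ hs) mx with x ∈? C
... | yes a = subst₂ _<_ (sym (pos-++ˡ C (concat cs) a)) (sym (pos-++ˡ C (concat cs) (f a))) (h a (f a))
... | no a = subst₂ _<_ (sym (pos-++ʳ C (concat cs) a mxr)) (sym (pos-++ʳ C (concat cs) (λ m → a (g m)) (ff mxr)))
               (+-monoʳ-< (length C) (Together-pos-< x y cs ss hs mxr))
  where
  mxr = ∈-++-∉ˡ C (concat cs) mx a
  ff : x ∈ concat cs → y ∈ concat cs
  ff m = Together-∈ cs ss m

uniq-concat⇒All-uniq : ∀ cs → Uniq (concat cs) → All Uniq cs
uniq-concat⇒All-uniq [] u = []
uniq-concat⇒All-uniq (C ∷ cs) u = uniq-++ˡ u ∷ uniq-concat⇒All-uniq cs (uniq-++ʳ {C} u)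

Blockwise↭-isort : ∀ Qs → Blockwise↭ Qs (map isort Qs)
Blockwise↭-isort [] = []
Blockwise↭-isort (Q ∷ Qs) = isort↭ Q ∷ Blockwise↭-isort Qs

isort-blocks-ordered : ∀ i Qs → All Uniq Qs → All (λ C → i ∈ C → suc i ∈ C → pos i C < pos (suc i) C) (map isort Qs)
isort-blocks-ordered i [] [] = []
isort-blocks-ordered i (Q ∷ Qs) (u ∷ us) = (λ a b → increasing-pos-< (isort-increasing Q u) a b (n<1+n i)) ∷ isort-blocks-ordered i Qs us

-- Peeling off a last letter

map-τ-involutive : ∀ i L → map (τ i) (map (τ i) L) ≡ L
map-τ-involutive i L = trans (sym (map-∘ L)) (map-id-∈ (λ x → τ i (τ i x)) L (λ x _ → τ-involutive i x))

pos-map-τ-self : ∀ i L → pos i (map (τ i) L) ≡ pos (suc i) L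
pos-map-τ-self i L = trans (pos-map-τ i i L) (cong (λ t → pos t L) (τ-self i))

pos-map-τ-suc : ∀ i L → pos (suc i) (map (τ i) L) ≡ pos i L
pos-map-τ-suc i L = trans (pos-map-τ i (suc i) L) (cong (λ t → pos t L) (τ-suc i))

∈-map-τ : ∀ i {v} L → τ i v ∈ L → v ∈ map (τ i) L
∈-map-τ i {v} L m = subst (_∈ map (τ i) L) (τ-involutive i v) (∈-map⁺ (τ i) m)

pos-injective : ∀ {L a b} → a ∈ L → b ∈ L → pos a L ≡ pos b L → a ≡ b
pos-injective {L} ma mb e = trans (sym (pos-at ma)) (trans (cong (at L) e) (pos-at mb))

len-map-τ-descent : ∀ {m v} i → InS m v → 1 ≤ i → i < m → pos (suc i) v < pos i v → suc (len (map (τ i) v)) ≡ len v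
len-map-τ-descent {m} {v} i Pv i1 i2 descent =
  sym (trans (cong len (sym (map-τ-involutive i v)))
             (len-map-τ-ascent i (map (τ i) v) (InS-uniq Pv′) (InS-∈⁺ Pv′ i1 (<⇒≤ i2)) (InS-∈⁺ Pv′ (s≤s z≤n) i2)
                               (subst₂ _<_ (sym (pos-map-τ-self i v)) (sym (pos-map-τ-suc i v)) descent)))
  where Pv′ = map-τ-InS i Pv i1 i2

std≡iden⇒sorted : ∀ B → Uniq B → std B ≡ iden (length B) → isort B ≡ B
std≡iden⇒sorted B u e = sym (begin
  B                                              ≡⟨ destd-std B u ⟨
  destd B (std B)                                ≡⟨ cong (destd B) e ⟩
  map (at (isort B)) (iden (length B))           ≡⟨ cong (λ t → map (at (isort B)) (iden t)) (length-isort B) ⟨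
  map (at (isort B)) (iden (length (isort B)))   ≡⟨ map-at-iden (isort B) ⟩
  isort B                                        ∎)
  where open ≡-Reasoning

empty-word-block : ∀ {B Q x} → Q ↭ B → Uniq B → foldl swapAt (iden (length B)) [] ≡ x →
                   foldl heckeR (inverse x) [] ≡ std B → std Q ≡ inverse x → B ≡ Q × isort Q ≡ Q
empty-word-block {B} {Q} {x} QB u fc hc eQ = trans (sym sorted-B) (trans (isort-↭ (↭-sym QB)) sorted-Q) , sorted-Q
  where
  m = length B
  inverse-x : inverse x ≡ iden m
  inverse-x = trans (cong inverse (sym fc)) (inverse-iden m)
  sorted-B : isort B ≡ B
  sorted-B = std≡iden⇒sorted B u (trans (sym hc) inverse-x)
  sorted-Q : isort Q ≡ Q
  sorted-Q = std≡iden⇒sorted Q (uniq-↭ (↭-sym QB) u) (trans eQ (trans inverse-x (cong iden (sym (↭-length QB)))))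

record Peeled (bs Qs : List (List ℕ)) (i : ℕ) : Set where
  field
    bs′         : List (List ℕ)
    invAtoms    : Pointwise InvBlockAtom bs′ (map (map (τ i)) Qs)
    involutions : All BlockInvolution bs′
    bs↭bs′      : Blockwise↭ bs bs′
    act≡        : map (blockAct i) bs′ ≡ bs
    moved       : bs′ ≢ bs
    ordered     : pos i (concat (map (map (τ i)) Qs)) < pos (suc i) (concat (map (map (τ i)) Qs))
    bothIn-bs′  : any (bothIn i) bs′ ≡ true
    i∈          : i ∈ concat bs
    suc-i∈      : suc i ∈ concat bs

Peeled-here : ∀ {B Q bs Qs i} → Q ↭ B → BlockPeel B Q i → Pointwise InvBlockAtom bs Qs → All BlockInvolution bs →
              Uniq (B ++ concat bs) → Peeled (B ∷ bs) (Q ∷ Qs) i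
Peeled-here {B} {Q} {bs} {Qs} {i} QB p atoms bis u = record
  { bs′         = B′ ∷ bs
  ; invAtoms    = invAtom ∷ subst (Pointwise InvBlockAtom bs) (sym rest-fixed) atoms
  ; involutions = involution ∷ bis
  ; bs↭bs′      = B′↭B ∷ Pointwise-refl ↭-refl
  ; act≡        = cong₂ _∷_ act≡ (map-blockAct-absent i bs i∉bs)
  ; moved       = moved ∘ proj₁ ∘ ∷-injective
  ; ordered     = subst₂ _<_ (sym (pos-++ˡ (map (τ i) Q) _ i∈τQ)) (sym (pos-++ˡ (map (τ i) Q) _ suc-i∈τQ)) ordered
  ; bothIn-bs′  = subst (λ t → t ∨ any (bothIn i) bs ≡ true)
                        (sym (bothIn-true (∈-resp-↭ (↭-sym B′↭B) i∈B) (∈-resp-↭ (↭-sym B′↭B) suc-i∈B))) refl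
  ; i∈          = ∈-++⁺ˡ i∈B
  ; suc-i∈      = ∈-++⁺ˡ suc-i∈B
  }
  where
  open BlockPeel p
  i∉bs = uniq-++-disjoint {B} u i∈B
  Qs↭bs = concat-↭ (invBlockAtoms⇒Blockwise↭ atoms)
  rest-fixed : map (map (τ i)) Qs ≡ Qs
  rest-fixed = map-map-τ-absent i Qs (i∉bs ∘ ∈-resp-↭ Qs↭bs) (uniq-++-disjoint {B} u suc-i∈B ∘ ∈-resp-↭ Qs↭bs)
  i∈τQ : i ∈ map (τ i) Q
  i∈τQ = ∈-map-τ i Q (subst (_∈ Q) (sym (τ-self i)) (∈-resp-↭ (↭-sym QB) suc-i∈B))
  suc-i∈τQ : suc i ∈ map (τ i) Q
  suc-i∈τQ = ∈-map-τ i Q (subst (_∈ Q) (sym (τ-suc i)) (∈-resp-↭ (↭-sym QB) i∈B))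

Peeled-∷ : ∀ {B Q bs Qs i} → InvBlockAtom B Q → BlockInvolution B → Pointwise InvBlockAtom bs Qs → Uniq (B ++ concat bs) →
           Peeled bs Qs i → Peeled (B ∷ bs) (Q ∷ Qs) i
Peeled-∷ {B} {Q} {bs} {Qs} {i} atom bi atoms u p = record
  { bs′         = B ∷ bs′
  ; invAtoms    = subst (InvBlockAtom B) (sym Q-fixed) atom ∷ invAtoms
  ; involutions = bi ∷ involutions
  ; bs↭bs′      = ↭-refl ∷ bs↭bs′
  ; act≡        = cong₂ _∷_ (blockAct-not-both i B (∉⇒bothIn-false i∉B)) act≡
  ; moved       = moved ∘ proj₂ ∘ ∷-injective
  ; ordered     = subst₂ _<_ (sym (pos-++ʳ (map (τ i) Q) _ (subst (i ∉_) (sym Q-fixed) i∉Q) i∈rest))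
                             (sym (pos-++ʳ (map (τ i) Q) _ (subst (suc i ∉_) (sym Q-fixed) suc-i∉Q) suc-i∈rest))
                             (+-monoʳ-< (length (map (τ i) Q)) ordered)
  ; bothIn-bs′  = subst (λ t → t ∨ any (bothIn i) bs′ ≡ true) (sym (∉⇒bothIn-false i∉B)) bothIn-bs′
  ; i∈          = ∈-++⁺ʳ B i∈
  ; suc-i∈      = ∈-++⁺ʳ B suc-i∈
  }
  where
  open Peeled p
  QB = proj₁ atom
  i∉B = uniq-++-disjoint′ {B} u i∈
  i∉Q = i∉B ∘ ∈-resp-↭ QB
  suc-i∉Q = uniq-++-disjoint′ {B} u suc-i∈ ∘ ∈-resp-↭ QB
  Q-fixed : map (τ i) Q ≡ Q
  Q-fixed = map-τ-absent i Q i∉Q suc-i∉Q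
  concat-τ : concat (map (map (τ i)) Qs) ≡ map (τ i) (concat Qs)
  concat-τ = concat-map Qs
  Qs↭bs : concat Qs ↭ concat bs
  Qs↭bs = concat-↭ (invBlockAtoms⇒Blockwise↭ atoms)
  i∈rest : i ∈ concat (map (map (τ i)) Qs)
  i∈rest = subst (i ∈_) (sym concat-τ) (∈-map-τ i (concat Qs) (subst (_∈ concat Qs) (sym (τ-self i)) (∈-resp-↭ (↭-sym Qs↭bs) suc-i∈)))
  suc-i∈rest : suc i ∈ concat (map (map (τ i)) Qs)
  suc-i∈rest = subst (suc i ∈_) (sym concat-τ) (∈-map-τ i (concat Qs) (subst (_∈ concat Qs) (sym (τ-suc i)) (∈-resp-↭ (↭-sym Qs↭bs) i∈)))

peel-blocks : ∀ bs Qs → Pointwise InvBlockAtom bs Qs → All BlockInvolution bs → All (IsConsecutive ∘ isort) Qs →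
              Uniq (concat bs) → (bs ≡ Qs × map isort Qs ≡ Qs) ⊎ Σ ℕ (Peeled bs Qs)
peel-blocks [] [] [] [] [] u = inj₁ (refl , refl)
peel-blocks (B ∷ bs) (Q ∷ Qs) (atom@(QB , x , (Px , (c , (lc , lenc , fc) , hc) , ax) , eQ) ∷ atoms) (bi ∷ bis) ((k , s , sorted) ∷ cs) u
  with initLast c | peel-blocks bs Qs atoms bis cs (uniq-++ʳ {B} u)
... | [] | inj₁ (bs≡Qs , sorted-Qs) = inj₁ (cong₂ _∷_ (proj₁ trivial) bs≡Qs , cong₂ _∷_ (proj₂ trivial) sorted-Qs)
  where trivial = empty-word-block QB (uniq-++ˡ u) fc hc eQ
... | [] | inj₂ (i , p) = inj₂ (i , Peeled-∷ atom bi atoms u p)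
... | c′ ∷ʳ′ j | _ = inj₂ (map₂ (λ p → Peeled-here QB p atoms bis u) (peel-block B Q QB (uniq-++ˡ u) s sorted′ x c′ j lc lenc fc hc ax eQ))
  where
  k≡ : k ≡ length B
  k≡ = trans (sym (length-consecutive k s)) (trans (cong length (sym sorted)) (trans (length-isort Q) (↭-length QB)))
  sorted′ : isort Q ≡ consecutive (length B) s
  sorted′ = trans sorted (cong (λ t → consecutive t s) k≡)

-- The μ-action, the potential Ψ and the two inclusions

module _ (n : ℕ) (μ : List ℕ) (sμ : sum μ ≡ n) where

  Ψ : List ℕ → ℕ
  Ψ π = potential (blocks μ π)

  concat-blocks-InS : ∀ {π} → InS n π → concat (blocks μ π) ≡ π
  concat-blocks-InS P = concat-blocks μ _ (trans sμ (sym (InS-length P)))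

  map-length-blocks-InS : ∀ {π} → InS n π → map length (blocks μ π) ≡ μ
  map-length-blocks-InS P = map-length-blocks μ _ (trans sμ (sym (InS-length P)))

  blocks-uniq : ∀ {π} → InS n π → Uniq (concat (blocks μ π))
  blocks-uniq P = subst Uniq (sym (concat-blocks-InS P)) (InS-uniq P)

  data StepKind (π : List ℕ) (i : ℕ) : Set where
    within  : any (bothIn i) (blocks μ π) ≡ true → StepKind π i
    across  : any (bothIn i) (blocks μ π) ≡ false → leftAscent π i ≡ true → StepKind π i
    blocked : any (bothIn i) (blocks μ π) ≡ false → leftAscent π i ≡ false → StepKind π i

  stepKind : ∀ π i → StepKind π i
  stepKind π i with any (bothIn i) (blocks μ π) in w | leftAscent π i in l
  ... | true  | _     = within w
  ... | false | true  = across w l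
  ... | false | false = blocked w l

  blocked-step : ∀ {π i} → any (bothIn i) (blocks μ π) ≡ false → leftAscent π i ≡ false → actMu μ π i ≡ π
  blocked-step {π} {i} w l = trans (actMu-across μ π i w) (heckeL-no-ascent π i l)

  across-step : ∀ π i → IsMuInvolution n μ π → 1 ≤ i → i < n →
                any (bothIn i) (blocks μ π) ≡ false → leftAscent π i ≡ true →
                actMu μ π i ≡ map (τ i) π × Ψ (map (τ i) π) ≡ 2 + Ψ π × IsMuInvolution n μ (map (τ i) π)
  across-step π i (P , bis) i1 i2 w l =
      trans (actMu-across μ π i w) (heckeL-ascent π i l)
    , trans (cong potential (blocks-map (τ i) μ π))
            (trans (cong₂ (λ c t → 2 * c + t) (blockCrossInv-map-τ i bs apart len-grows) (totalBlockWeight-map-τ i bs apart))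
                   (cong (_+ totalBlockWeight bs) (*-suc 2 (blockCrossInv bs))))
    , map-τ-InS i P i1 i2 , subst (All BlockInvolution) (sym (blocks-map (τ i) μ π)) (blockInvolutions-map-τ i bs apart bis)
    where
    bs = blocks μ π
    apart = any-bothIn-false⇒Apart i bs w
    len-grows : len (map (τ i) (concat bs)) ≡ suc (len (concat bs))
    len-grows rewrite concat-blocks-InS P =
      len-map-τ-ascent i π (InS-uniq P) (InS-∈⁺ P i1 (<⇒≤ i2)) (InS-∈⁺ P (s≤s z≤n) i2) (<ᵇ≡true⇒< _ _ l)

  module _ {π i} (MI : IsMuInvolution n μ π) (w : any (bothIn i) (blocks μ π) ≡ true) where
    private
      P = proj₁ MI
      bis = proj₂ MI
      bs = blocks μ π
      props = map-blockAct-properties i bs (blocks-uniq P) bis w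
      blocks↭ : Blockwise↭ bs (map (blockAct i) bs)
      blocks↭ = proj₁ (proj₂ props)
      actMu≡ : actMu μ π i ≡ concat (map (blockAct i) bs)
      actMu≡ = actMu-within μ π i w

    blocks-within-step : blocks μ (actMu μ π i) ≡ map (blockAct i) bs
    blocks-within-step = trans (cong (blocks μ) actMu≡)
                               (blocks-concat (map (blockAct i) bs) μ (trans (Blockwise↭-lengths blocks↭) (map-length-blocks-InS P)))

    within-step-involution : IsMuInvolution n μ (actMu μ π i)
    within-step-involution = subst (InS n) (sym actMu≡) (↭-trans (concat-↭ blocks↭) (subst (_↭ iden n) (sym (concat-blocks-InS P)) P))
                           , subst (All BlockInvolution) (sym blocks-within-step) (proj₂ (proj₂ props))

    within-step-potential : actMu μ π i ≡ π ⊎ Ψ (actMu μ π i) ≡ 2 + Ψ π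
    within-step-potential with proj₁ props
    ... | inj₁ same  = inj₁ (trans actMu≡ (trans (cong concat same) (concat-blocks-InS P)))
    ... | inj₂ grows = inj₂ (begin
      Ψ (actMu μ π i)                                                     ≡⟨ cong potential blocks-within-step ⟩
      2 * blockCrossInv (map (blockAct i) bs) + totalBlockWeight (map (blockAct i) bs)
                                                                          ≡⟨ cong₂ (λ c t → 2 * c + t) (blockCrossInv-↭ blocks↭) grows ⟩
      2 * blockCrossInv bs + (2 + totalBlockWeight bs)                    ≡⟨ +-left-comm (2 * blockCrossInv bs) 2 _ ⟩
      2 + Ψ π                                                             ∎)
      where open ≡-Reasoning

  potential-step-≤ : ∀ π i → IsMuInvolution n μ π → 1 ≤ i → i < n → Ψ (actMu μ π i) ≤ 2 + Ψ π × IsMuInvolution n μ (actMu μ π i)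
  potential-step-≤ π i MI i1 i2 with stepKind π i
  ... | within w with within-step-potential MI w
  ...   | inj₁ same  = ≤-trans (≤-reflexive (cong Ψ same)) (m≤n+m (Ψ π) 2) , within-step-involution MI w
  ...   | inj₂ grows = ≤-reflexive grows , within-step-involution MI w
  potential-step-≤ π i MI i1 i2 | across w l with across-step π i MI i1 i2 w l
  ... | acts , grows , MI′ = subst (λ t → Ψ t ≤ 2 + Ψ π × IsMuInvolution n μ t) (sym acts) (≤-reflexive grows , MI′)
  potential-step-≤ π i MI i1 i2 | blocked w l =
    subst (λ t → Ψ t ≤ 2 + Ψ π × IsMuInvolution n μ t) (sym (blocked-step w l)) (m≤n+m (Ψ π) 2 , MI)

  potential-word-≤ : ∀ π as → IsMuInvolution n μ π → Letters n as → Ψ (foldl (actMu μ) π as) ≤ Ψ π + 2 * length as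
  potential-word-≤ π []       MI []                = m≤m+n (Ψ π) 0
  potential-word-≤ π (i ∷ as) MI ((i1 , i2) ∷ ls) with potential-step-≤ π i MI i1 i2
  ... | step≤ , MI′ = begin
    Ψ (foldl (actMu μ) (actMu μ π i) as)   ≤⟨ potential-word-≤ (actMu μ π i) as MI′ ls ⟩
    Ψ (actMu μ π i) + 2 * length as        ≤⟨ +-monoˡ-≤ (2 * length as) step≤ ⟩
    2 + Ψ π + 2 * length as                ≡⟨ cong (_+ 2 * length as) (+-comm 2 (Ψ π)) ⟩
    Ψ π + 2 + 2 * length as                ≡⟨ +-assoc (Ψ π) 2 (2 * length as) ⟩
    Ψ π + (2 + 2 * length as)              ≡⟨ cong (Ψ π +_) (*-suc 2 (length as)) ⟨
    Ψ π + 2 * suc (length as)              ∎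
    where open ≤-Reasoning

  effective-step : ∀ {π v} → IsMuInvolution n μ π → InS n v → Pointwise InvBlockAtom (blocks μ π) (blocks μ v) →
                   ∀ i → 1 ≤ i → i < n → actMu μ π i ≢ π → pos i v < pos (suc i) v →
                   Pointwise InvBlockAtom (blocks μ (actMu μ π i)) (blocks μ (swapVal i v)) ×
                   Ψ (actMu μ π i) ≡ 2 + Ψ π × IsMuInvolution n μ (actMu μ π i)
  effective-step {π} {v} MI Pv atoms i i1 i2 moves i<i+1 with stepKind π i
  ... | blocked w l = ⊥-elim (moves (blocked-step w l))
  ... | across w l with across-step π i MI i1 i2 w l
  ...   | acts , grows , MI′ =
    subst (λ t → Pointwise InvBlockAtom (blocks μ t) (blocks μ (swapVal i v)) × Ψ t ≡ 2 + Ψ π × IsMuInvolution n μ t) (sym acts)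
      (subst₂ (Pointwise InvBlockAtom) (sym (blocks-map (τ i) μ π)) (sym (blocks-map (τ i) μ v))
              (map-τ-invBlockAtoms i (blocks μ π) (blocks μ v) atoms (any-bothIn-false⇒Apart i (blocks μ π) w))
      , grows , MI′)
  effective-step {π} {v} MI Pv atoms i i1 i2 moves i<i+1 | within w =
      subst₂ (Pointwise InvBlockAtom) (sym (blocks-within-step MI w)) (sym (blocks-map (τ i) μ v))
             (map-blockAct-invBlockAtoms i (blocks μ π) (blocks μ v) atoms (proj₂ MI) (blocks-uniq (proj₁ MI)) w blocks-move ordered)
    , grows
    , within-step-involution MI w
    where
    blocks-move : map (blockAct i) (blocks μ π) ≢ blocks μ π
    blocks-move same = moves (trans (actMu-within μ π i w) (trans (cong concat same) (concat-blocks-InS (proj₁ MI))))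
    grows : Ψ (actMu μ π i) ≡ 2 + Ψ π
    grows with within-step-potential MI w
    ... | inj₁ same = ⊥-elim (moves same)
    ... | inj₂ g    = g
    ordered : pos i (concat (blocks μ v)) < pos (suc i) (concat (blocks μ v))
    ordered = subst₂ (λ a b → pos i a < pos (suc i) b) (sym (concat-blocks-InS Pv)) (sym (concat-blocks-InS Pv)) i<i+1

  record Reached (π v a : List ℕ) : Set where
    field
      letters      : Letters n a
      reduced      : length a ≡ len (wordPerm n a)
      acts         : actWord n μ a ≡ π
      inverse≡     : v ≡ inverse (wordPerm n a)
      blockAtoms   : Pointwise InvBlockAtom (blocks μ π) (blocks μ v)
      potential≡   : Ψ π ≡ 2 * len (wordPerm n a)
      muInvolution : IsMuInvolution n μ π

  iden-blocks-consecutive : All IsConsecutive (blocks μ (iden n))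
  iden-blocks-consecutive = subst (λ t → All IsConsecutive (blocks μ t)) (sym (iden≡consecutive n)) (blocks-consecutive μ n 1)

  identity-blocks : Pointwise InvBlockAtom (blocks μ (iden n)) (blocks μ (iden n)) ×
                    All BlockInvolution (blocks μ (iden n)) × totalBlockWeight (blocks μ (iden n)) ≡ 0
  identity-blocks = go (blocks μ (iden n)) iden-blocks-consecutive
    where
    go : ∀ bs → All IsConsecutive bs → Pointwise InvBlockAtom bs bs × All BlockInvolution bs × totalBlockWeight bs ≡ 0
    go []       []         = [] , [] , refl
    go (B ∷ bs) (c ∷ cs) with consecutive-block B c | go bs cs
    ... | atom , inv , w | atoms , invs , ws = atom ∷ atoms , inv ∷ invs , cong₂ _+_ w ws

  reached-[] : Reached (iden n) (iden n) []
  reached-[] = record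
    { letters      = []
    ; reduced      = sym (len-iden n)
    ; acts         = refl
    ; inverse≡     = sym (inverse-iden n)
    ; blockAtoms   = proj₁ identity-blocks
    ; potential≡   = trans (cong₂ (λ c t → 2 * c + t) no-cross-inversions (proj₂ (proj₂ identity-blocks))) (cong (2 *_) (sym (len-iden n)))
    ; muInvolution = ↭-refl , proj₁ (proj₂ identity-blocks)
    }
    where
    bs = blocks μ (iden n)
    no-cross-inversions : blockCrossInv bs ≡ 0
    no-cross-inversions = m+n≡0⇒n≡0 (blockInvSum bs) (trans (sym (len-concat bs)) (trans (cong len (concat-blocks-InS ↭-refl)) (len-iden n)))

  reached-step : ∀ {π v a} → Reached π v a → ∀ i → 1 ≤ i → i < n → actMu μ π i ≢ π → at (wordPerm n a) i < at (wordPerm n a) (suc i) →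
                 Reached (actMu μ π i) (swapVal i v) (a ++ [ i ])
  reached-step {π} {v} {a} r i i1 i2 moves asc = record
    { letters      = All++⁺ (Reached.letters r) ((i1 , i2) ∷ [])
    ; reduced      = trans (length-++ a {[ i ]}) (trans (+-comm (length a) 1) (trans (cong suc (Reached.reduced r)) (sym len-grows)))
    ; acts         = trans (foldl-++ (actMu μ) (iden n) a [ i ]) (cong (λ t → actMu μ t i) (Reached.acts r))
    ; inverse≡     = trans (cong (swapVal i) (Reached.inverse≡ r)) (trans (sym (inverse-swapAt i PW i1 i2)) (cong inverse (sym (wordPerm-snoc n a i))))
    ; blockAtoms   = proj₁ step
    ; potential≡   = trans (proj₁ (proj₂ step)) (trans (cong (2 +_) (Reached.potential≡ r)) (trans (sym (*-suc 2 _)) (cong (2 *_) (sym len-grows))))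
    ; muInvolution = proj₂ (proj₂ step)
    }
    where
    PW = wordPerm-InS n a
    len-grows : len (wordPerm n (a ++ [ i ])) ≡ suc (len (wordPerm n a))
    len-grows = trans (cong len (wordPerm-snoc n a i)) (len-swapAt-ascent (wordPerm n a) i i1 (subst (suc i ≤_) (sym (InS-length PW)) i2) asc)
    Pv : InS n v
    Pv = subst (InS n) (sym (Reached.inverse≡ r)) (inverse-InS PW)
    pos-v : ∀ k → 1 ≤ k → k ≤ n → pos k v ≡ at (wordPerm n a) k
    pos-v k c d = trans (cong (pos k) (Reached.inverse≡ r)) (pos-inverse′ PW c d)
    step = effective-step (Reached.muInvolution r) Pv (Reached.blockAtoms r) i i1 i2 moves
                          (subst₂ _<_ (sym (pos-v i i1 (<⇒≤ i2))) (sym (pos-v (suc i) (s≤s z≤n) i2)) asc)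

  module _ {π w as} (red : Reduced n w as) (acts : actWord n μ as ≡ π)
           (minimal : ∀ bs → Letters n bs → actWord n μ bs ≡ π → len w ≤ length bs) where
    private
      lenEq = proj₁ (proj₂ red)
      prod = proj₂ (proj₂ red)

    minimal-word-moves : ∀ pre i rest {π′} → pre ++ i ∷ rest ≡ as → Letters n (pre ++ rest) →
                         actWord n μ pre ≡ π′ → actMu μ π′ i ≢ π′
    minimal-word-moves pre i rest {π′} e letters′ acts′ fixed = <-irrefl refl (≤-trans (≤-reflexive len-w) too-short)
      where
      same-action : actWord n μ (pre ++ rest) ≡ π
      same-action = begin
        actWord n μ (pre ++ rest)                      ≡⟨ foldl-++ (actMu μ) (iden n) pre rest ⟩
        foldl (actMu μ) (actWord n μ pre) rest         ≡⟨ cong (λ t → foldl (actMu μ) t rest) (trans acts′ (sym fixed)) ⟩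
        foldl (actMu μ) (actMu μ π′ i) rest            ≡⟨ cong (λ t → foldl (actMu μ) (actMu μ t i) rest) acts′ ⟨
        foldl (actMu μ) (actWord n μ pre) (i ∷ rest)   ≡⟨ foldl-++ (actMu μ) (iden n) pre (i ∷ rest) ⟨
        actWord n μ (pre ++ i ∷ rest)                  ≡⟨ cong (actWord n μ) e ⟩
        actWord n μ as                                 ≡⟨ acts ⟩
        π                                              ∎
        where open ≡-Reasoning
      too-short : len w ≤ length (pre ++ rest)
      too-short = minimal (pre ++ rest) letters′ same-action
      len-w : suc (length (pre ++ rest)) ≡ len w
      len-w = trans (cong suc (length-++ pre)) (trans (sym (+-suc (length pre) (length rest)))
                (trans (sym (length-++ pre)) (trans (cong length e) lenEq)))

    reach-along : ∀ pre rest {π′ v′} → pre ++ rest ≡ as → Reached π′ v′ pre → Letters n rest →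
                  Reached (actWord n μ as) (inverse (wordPerm n as)) as
    reach-along pre [] e r _ =
      subst (λ t → Reached (actWord n μ t) (inverse (wordPerm n t)) t) (trans (sym (++-identityʳ pre)) e)
            (subst₂ (λ a b → Reached a b pre) (sym (Reached.acts r)) (Reached.inverse≡ r) r)
    reach-along pre (i ∷ rest) e r ((i1 , i2) ∷ ls) =
      reach-along (pre ++ [ i ]) rest (trans (++-assoc pre [ i ] rest) e)
        (reached-step r i i1 i2 (minimal-word-moves pre i rest e (All++⁺ (Reached.letters r) ls) (Reached.acts r)) asc) ls
      where
      asc : at (wordPerm n pre) i < at (wordPerm n pre) (suc i)
      asc = reduced-word-ascent n pre i rest
              (trans (cong length e) (trans lenEq (cong len (sym (trans (cong (wordPerm n) e) prod)))))

  invMuAtom⇒invBlockAtoms : ∀ π v → InvMuAtom n μ π v → ∃ λ (Qs : List (List ℕ)) → Pointwise InvBlockAtom (blocks μ π) Qs × v ≡ concat Qs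
  invMuAtom⇒invBlockAtoms π v (w , (Pw , (as , red@(letters , _ , prod) , acts) , minimal) , v≡) =
    blocks μ v , atoms , sym (concat-blocks-InS Pv)
    where
    r = reach-along red acts minimal [] as refl reached-[] letters
    Pv : InS n v
    Pv = subst (InS n) (sym v≡) (inverse-InS Pw)
    atoms : Pointwise InvBlockAtom (blocks μ π) (blocks μ v)
    atoms = subst₂ (λ a b → Pointwise InvBlockAtom (blocks μ a) (blocks μ b)) acts (trans (cong inverse prod) (sym v≡)) (Reached.blockAtoms r)

  Candidate : List ℕ → List ℕ → Set
  Candidate π v = IsMuInvolution n μ π × InS n v × Pointwise InvBlockAtom (blocks μ π) (blocks μ v)

  sorted-blocks≡iden-blocks : ∀ π v → Candidate π v → (∀ i → 1 ≤ i → i < n → any (bothIn i) (blocks μ π) ≡ false → pos i v < pos (suc i) v) →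
                              map isort (blocks μ v) ≡ blocks μ (iden n)
  sorted-blocks≡iden-blocks π v ((P , bis) , Pv , atoms) across-ordered =
    trans (sym (blocks-concat (map isort Qs) μ (trans (Blockwise↭-lengths sorting) (map-length-blocks-InS Pv))))
          (cong (blocks μ) (increasing-positions⇒iden n sorted Psorted ordered))
    where
    Qs = blocks μ v
    bs = blocks μ π
    sorting = Blockwise↭-isort Qs
    blocks↭ = invBlockAtoms⇒Blockwise↭ atoms
    sorted = concat (map isort Qs)
    Psorted : InS n sorted
    Psorted = ↭-trans (concat-↭ sorting) (subst (_↭ iden n) (sym (concat-blocks-InS Pv)) Pv)
    ordered : ∀ i → 1 ≤ i → i < n → pos i sorted < pos (suc i) sorted
    ordered i i1 i2 with any (bothIn i) bs in w
    ... | false = Apart-pos-< i (suc i) Qs (map isort Qs) sorting (Apart-↭ blocks↭ (any-bothIn-false⇒Apart i bs w)) i∈ suc-i∈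
                    (subst₂ (λ a b → pos i a < pos (suc i) b) (sym (concat-blocks-InS Pv)) (sym (concat-blocks-InS Pv)) (across-ordered i i1 i2 w))
      where
      i∈ = subst (i ∈_) (sym (concat-blocks-InS Pv)) (InS-∈⁺ Pv i1 (<⇒≤ i2))
      suc-i∈ = subst (suc i ∈_) (sym (concat-blocks-InS Pv)) (InS-∈⁺ Pv (s≤s z≤n) i2)
    ... | true = Together-pos-< i (suc i) (map isort Qs) (Together-↭ sorting (Together-↭ blocks↭ (any-bothIn-true⇒Together i bs (blocks-uniq P) w)))
                   (isort-blocks-ordered i Qs (uniq-concat⇒All-uniq Qs (blocks-uniq Pv)))
                   (∈-resp-↭ (↭-sym (concat-↭ sorting)) (subst (i ∈_) (sym (concat-blocks-InS Pv)) (InS-∈⁺ Pv i1 (<⇒≤ i2))))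

  data PeelResult (π v : List ℕ) : Set where
    done : π ≡ iden n → v ≡ iden n → PeelResult π v
    step : ∀ i π′ → 1 ≤ i → i < n → Candidate π′ (map (τ i) v) → pos (suc i) v < pos i v →
           actMu μ π′ i ≡ π → π ≢ π′ → PeelResult π v

  peel-across : ∀ {π v} → Candidate π v → ∀ i → 1 ≤ i → i < n →
                any (bothIn i) (blocks μ π) ≡ false → pos (suc i) v < pos i v → PeelResult π v
  peel-across {π} {v} ((P , bis) , Pv , atoms) i i1 i2 w descent =
    step i (map (τ i) π) i1 i2 candidate descent acts moved
    where
    bs = blocks μ π
    apart = any-bothIn-false⇒Apart i bs w
    candidate : Candidate (map (τ i) π) (map (τ i) v)
    candidate = (map-τ-InS i P i1 i2 , subst (All BlockInvolution) (sym (blocks-map (τ i) μ π)) (blockInvolutions-map-τ i bs apart bis))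
              , map-τ-InS i Pv i1 i2
              , subst₂ (Pointwise InvBlockAtom) (sym (blocks-map (τ i) μ π)) (sym (blocks-map (τ i) μ v)) (map-τ-invBlockAtoms i bs (blocks μ v) atoms apart)
    still-apart : any (bothIn i) (blocks μ (map (τ i) π)) ≡ false
    still-apart = subst (λ t → any (bothIn i) t ≡ false) (sym (blocks-map (τ i) μ π)) (Apart⇒any-bothIn-false i (map (map (τ i)) bs) (Apart-map-τ i bs apart))
    π-descent : pos (suc i) π < pos i π
    π-descent = subst₂ _<_ (cong (pos (suc i)) (concat-blocks-InS P)) (cong (pos i) (concat-blocks-InS P))
                  (Apart-pos-< (suc i) i (blocks μ v) bs (Blockwise↭-sym (invBlockAtoms⇒Blockwise↭ atoms))
                     (Apart-sym (blocks μ v) (Apart-↭ (invBlockAtoms⇒Blockwise↭ atoms) apart))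
                     (subst (suc i ∈_) (sym (concat-blocks-InS Pv)) (InS-∈⁺ Pv (s≤s z≤n) i2))
                     (subst (i ∈_) (sym (concat-blocks-InS Pv)) (InS-∈⁺ Pv i1 (<⇒≤ i2)))
                     (subst₂ _<_ (cong (pos (suc i)) (sym (concat-blocks-InS Pv))) (cong (pos i) (sym (concat-blocks-InS Pv))) descent))
    leftAsc : leftAscent (map (τ i) π) i ≡ true
    leftAsc = trans (cong₂ _<ᵇ_ (pos-map-τ-self i π) (pos-map-τ-suc i π)) (<⇒<ᵇ≡true π-descent)
    acts : actMu μ (map (τ i) π) i ≡ π
    acts = trans (actMu-across μ (map (τ i) π) i still-apart) (trans (heckeL-ascent (map (τ i) π) i leftAsc) (map-τ-involutive i π))
    moved : π ≢ map (τ i) π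
    moved e = 1+n≢n (sym (pos-injective (InS-∈⁺ P i1 (<⇒≤ i2)) (InS-∈⁺ P (s≤s z≤n) i2) (trans (cong (pos i) e) (pos-map-τ-self i π))))

  peel-within : ∀ {π v} → Candidate π v → (∀ i → 1 ≤ i → i < n → any (bothIn i) (blocks μ π) ≡ false → pos i v < pos (suc i) v) →
                PeelResult π v
  peel-within {π} {v} cand@((P , bis) , Pv , atoms) across-ordered
    with peel-blocks (blocks μ π) (blocks μ v) atoms bis consecutive-blocks (blocks-uniq P)
    where
    sorted≡ = sorted-blocks≡iden-blocks π v cand across-ordered
    consecutive-blocks : All (IsConsecutive ∘ isort) (blocks μ v)
    consecutive-blocks = All-map⁻ (subst (All IsConsecutive) (sym sorted≡) iden-blocks-consecutive)
  ... | inj₁ (bs≡Qs , sorted-Qs) = done (trans (sym (concat-blocks-InS P)) (trans (cong concat bs≡Qs) (trans (concat-blocks-InS Pv) v≡iden))) v≡iden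
    where
    v≡iden : v ≡ iden n
    v≡iden = trans (sym (concat-blocks-InS Pv)) (trans (cong concat (sym sorted-Qs))
               (trans (cong concat (sorted-blocks≡iden-blocks π v cand across-ordered)) (concat-blocks-InS ↭-refl)))
  ... | inj₂ (i , p) = step i (concat bs′) i1 i2 candidate descent acts moved′
    where
    open Peeled p
    i1 : 1 ≤ i
    i1 = proj₁ (InS-∈⁻ P (subst (i ∈_) (concat-blocks-InS P) i∈))
    i2 : i < n
    i2 = proj₂ (InS-∈⁻ P (subst (suc i ∈_) (concat-blocks-InS P) suc-i∈))
    blocks-π′ : blocks μ (concat bs′) ≡ bs′
    blocks-π′ = blocks-concat bs′ μ (trans (Blockwise↭-lengths bs↭bs′) (map-length-blocks-InS P))
    concat-τ : concat (map (map (τ i)) (blocks μ v)) ≡ map (τ i) v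
    concat-τ = trans (concat-map (blocks μ v)) (cong (map (τ i)) (concat-blocks-InS Pv))
    candidate : Candidate (concat bs′) (map (τ i) v)
    candidate = (↭-trans (concat-↭ bs↭bs′) (subst (_↭ iden n) (sym (concat-blocks-InS P)) P) , subst (All BlockInvolution) (sym blocks-π′) involutions)
              , map-τ-InS i Pv i1 i2
              , subst₂ (Pointwise InvBlockAtom) (sym blocks-π′) (sym (blocks-map (τ i) μ v)) invAtoms
    descent : pos (suc i) v < pos i v
    descent = subst₂ _<_ (trans (cong (pos i) concat-τ) (pos-map-τ-self i v)) (trans (cong (pos (suc i)) concat-τ) (pos-map-τ-suc i v)) ordered
    acts : actMu μ (concat bs′) i ≡ π
    acts = trans (actMu-within μ (concat bs′) i (subst (λ t → any (bothIn i) t ≡ true) (sym blocks-π′) bothIn-bs′))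
                 (trans (cong (concat ∘ map (blockAct i)) blocks-π′) (trans (cong concat act≡) (concat-blocks-InS P)))
    moved′ : π ≢ concat bs′
    moved′ e = moved (sym (trans (cong (blocks μ) e) blocks-π′))

  peel : ∀ π v → Candidate π v → PeelResult π v
  peel π v cand with search (λ i → any (bothIn i) (blocks μ π) ≡ false × pos (suc i) v < pos i v)
                            (λ i → (any (bothIn i) (blocks μ π) ≟B false) ×-dec (pos (suc i) v <? pos i v)) n
  ... | inj₁ (i , i1 , i2 , w , descent) = peel-across cand i i1 i2 w descent
  ... | inj₂ none = peel-within cand ordered
    where
    Pv = proj₁ (proj₂ cand)
    ordered : ∀ i → 1 ≤ i → i < n → any (bothIn i) (blocks μ π) ≡ false → pos i v < pos (suc i) v
    ordered i i1 i2 w = ≤∧≢⇒< (≮⇒≥ (λ d → none i i1 i2 (w , d)))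
                             (λ e → 1+n≢n (sym (pos-injective (InS-∈⁺ Pv i1 (<⇒≤ i2)) (InS-∈⁺ Pv (s≤s z≤n) i2) e)))

  reach : ∀ k π v → len v ≡ k → Candidate π v → Σ (List ℕ) (Reached π v)
  reach k π v len≡ cand with peel π v cand
  ... | done π≡ v≡ = [] , subst₂ (λ a b → Reached a b []) (sym π≡) (sym v≡) reached-[]
  reach zero π v len≡ cand | step i π′ i1 i2 cand′ descent acts moved =
    ⊥-elim (1+n≢0 (trans (len-map-τ-descent i (proj₁ (proj₂ cand)) i1 i2 descent) len≡))
  reach (suc k) π v len≡ cand | step i π′ i1 i2 cand′ descent acts moved
    with reach k π′ (map (τ i) v) (suc-injective (trans (len-map-τ-descent i (proj₁ (proj₂ cand)) i1 i2 descent) len≡)) cand′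
  ... | a , r = a ++ [ i ] , subst₂ (λ x y → Reached x y (a ++ [ i ])) acts (map-τ-involutive i v)
                                    (reached-step r i i1 i2 (moved ∘ trans (sym acts)) ascent)
    where
    PW = wordPerm-InS n a
    pos≡at : ∀ k → 1 ≤ k → k ≤ n → pos k (map (τ i) v) ≡ at (wordPerm n a) k
    pos≡at k c d = trans (cong (pos k) (Reached.inverse≡ r)) (pos-inverse′ PW c d)
    ascent : at (wordPerm n a) i < at (wordPerm n a) (suc i)
    ascent = subst₂ _<_ (trans (sym (pos-map-τ-self i v)) (pos≡at i i1 (<⇒≤ i2)))
                        (trans (sym (pos-map-τ-suc i v)) (pos≡at (suc i) (s≤s z≤n) i2)) descent

  potential-lower-bound : ∀ as → Letters n as → Ψ (actWord n μ as) ≤ 2 * length as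
  potential-lower-bound as l = ≤-trans (potential-word-≤ (iden n) as (Reached.muInvolution reached-[]) l)
                                       (≤-reflexive (cong (_+ 2 * length as) Ψ-iden))
    where
    Ψ-iden : Ψ (iden n) ≡ 0
    Ψ-iden = trans (Reached.potential≡ reached-[]) (cong (2 *_) (len-iden n))

  invBlockAtoms⇒invMuAtom : ∀ π v → IsMuInvolution n μ π → (Qs : List (List ℕ)) → Pointwise InvBlockAtom (blocks μ π) Qs →
                            v ≡ concat Qs → InvMuAtom n μ π v
  invBlockAtoms⇒invMuAtom π v MI Qs atoms v≡ =
    wordPerm n a , (wordPerm-InS n a , (a , (Reached.letters r , Reached.reduced r , refl) , Reached.acts r) , minimal) , Reached.inverse≡ r
    where
    P = proj₁ MI
    blocks↭ = invBlockAtoms⇒Blockwise↭ atoms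
    blocks-v : blocks μ v ≡ Qs
    blocks-v = trans (cong (blocks μ) v≡) (blocks-concat Qs μ (trans (Blockwise↭-lengths blocks↭) (map-length-blocks-InS P)))
    Pv : InS n v
    Pv = subst (InS n) (sym v≡) (↭-trans (concat-↭ blocks↭) (subst (_↭ iden n) (sym (concat-blocks-InS P)) P))
    reached = reach (len v) π v refl (MI , Pv , subst (Pointwise InvBlockAtom (blocks μ π)) (sym blocks-v) atoms)
    a = proj₁ reached
    r = proj₂ reached
    minimal : ∀ as → Letters n as → actWord n μ as ≡ π → len (wordPerm n a) ≤ length as
    minimal as l e = *-cancelˡ-≤ 2 (≤-trans (≤-reflexive (trans (sym (Reached.potential≡ r)) (cong Ψ (sym e)))) (potential-lower-bound as l))

theorem3p1 : (n : ℕ) (μ π : List ℕ) → IsComposition n μ → IsMuInvolution n μ π →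
    (v : List ℕ) →
    (InvMuAtom n μ π v →
    ∃ λ (Qs : List (List ℕ)) → Pointwise InvBlockAtom (blocks μ π) Qs × v ≡ concat Qs)
    × ((Qs : List (List ℕ)) → Pointwise InvBlockAtom (blocks μ π) Qs → v ≡ concat Qs →
    InvMuAtom n μ π v)
theorem3p1 n μ π (_ , sμ) MI v = invMuAtom⇒invBlockAtoms n μ sμ π v , invBlockAtoms⇒invMuAtom n μ sμ π v MI
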